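{- For every $n\ge 1$, the number of $n\times n$ alternating sign matrices whose SW key avoids both $312$ and $321$ is the Catalan number $C_n=\frac{1}{n+1}\binom{2n}{n}$.
   Context: An alternating sign matrix (ASM) of size $n$ is an $n\times n$ matrix with entries in $\{0,1,-1\}$ such that every row and every column sums to $1$ and the nonzero entries of each row and of each column alternate in sign. Position $(i,j)$ is the $i$-th row from the top and $j$-th column from the left. The permutation matrix of $\sigma=\sigma(1)\dots\sigma(n)$ has a $1$ in row $i$, column $\sigma(i)$ for each $i$. A permutation $\sigma$ contains $\pi=\pi(1)\dots\pi(k)$ if there are indices $i_1<\dots<i_k$ with $\sigma(i_a)<\sigma(i_b)$ iff $\pi(a)<\pi(b)$; otherwise $\sigma$ avoids $\pi$. SW key process: a $-1$ entry is removable if no other $-1$ entry lies weakly southwest of it (weakly below and weakly to the left). For a removable $-1$ at $(i,j)$, let $(i,j_0)$ be the nearest $1$ to its west in its row and $(i_0,j)$ the nearest $1$ below it in its column; its neighboring $1$s are the $1$ entries weakly southwest of it such that no other $1$ entry lies both weakly northeast of them and weakly southwest of the $-1$. Consider the $1$s at $(i,j_0)$, $(i_0,j)$ and the neighboring $1$s lying in the rectangle of rows $i..i_0$ and columns $j_0..j$. Replace the south-most of these $1$s by $0$; then moving east to west, for each subsequent one of these $1$s, in column $c$ say, place a new $1$ in the row of the previously replaced $1$ and column $c$, and replace the old $1$ in column $c$ by $0$; finally replace the $-1$ by $0$. Repeating until no $-1$ remains yields a permutation matrix, independent of the order of removals, called the SW key of $A$. -}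

module Defs where

open import Data.Nat using (ℕ; zero; suc; _*_; _/_; _+_)
import Data.Nat
import Data.Vec
open import Data.Nat.Combinatorics using (_C_)
open import Data.Integer using (ℤ; 0ℤ; 1ℤ; -1ℤ; -_) renaming (_+_ to _+ℤ_)
import Data.Integer.Properties as ℤP
open import Data.Fin using (Fin; _≤_; _<_)
open import Data.Vec using (Vec; lookup; toList; transpose)
open import Data.List using (List; foldr; filter)
open import Data.List.Relation.Unary.Linked using (Linked)
open import Data.Sum using (_⊎_)
open import Data.Product using (Σ; ∃; ∃-syntax; _×_; _,_)
open import Relation.Nullary using (¬_; ¬?)
open import Relation.Binary.PropositionalEquality using (_≡_; _≢_)
open import Relation.Binary.Construct.Closure.ReflexiveTransitive using (Star)
open import Function.Bundles using (_⇔_)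

-- Matrices.  Row index i (0 = top row), column index j (0 = leftmost).
-- "below"  = larger row index, "left/west" = smaller column index.

Matrix : ℕ → Set
Matrix n = Vec (Vec ℤ n) n

at : ∀ {n} → Matrix n → Fin n → Fin n → ℤ
at A i j = lookup (lookup A i) j

sumℤ : List ℤ → ℤ
sumℤ = foldr _+ℤ_ 0ℤ

nonzeros : List ℤ → List ℤ
nonzeros = filter (λ x → ¬? (x ℤP.≟ 0ℤ))

Alternating : List ℤ → Set
Alternating xs = Linked (λ a b → b ≡ - a) (nonzeros xs)

record IsASM {n : ℕ} (A : Matrix n) : Set where
  field
    entries    : ∀ i j → (at A i j ≡ 0ℤ) ⊎ ((at A i j ≡ 1ℤ) ⊎ (at A i j ≡ -1ℤ))
    rowSum     : ∀ i → sumℤ (toList (lookup A i)) ≡ 1ℤ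
    colSum     : ∀ j → sumℤ (toList (lookup (transpose A) j)) ≡ 1ℤ
    rowAlt     : ∀ i → Alternating (toList (lookup A i))
    colAlt     : ∀ j → Alternating (toList (lookup (transpose A) j))

-- SW key process.
-- (a , b) is weakly southwest of (i , j)  iff  i ≤ a  and  b ≤ j.

module _ {n : ℕ} (A : Matrix n) where

  Removable : Fin n → Fin n → Set
  Removable i j =
    at A i j ≡ -1ℤ ×
    (∀ a b → i ≤ a → b ≤ j → at A a b ≡ -1ℤ → (a ≡ i × b ≡ j))

  NearestWest : Fin n → Fin n → Fin n → Set
  NearestWest i j j0 =
    j0 < j × at A i j0 ≡ 1ℤ × (∀ b → j0 < b → b < j → at A i b ≢ 1ℤ)

  NearestSouth : Fin n → Fin n → Fin n → Set
  NearestSouth i j i0 =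
    i < i0 × at A i0 j ≡ 1ℤ × (∀ a → i < a → a < i0 → at A a j ≢ 1ℤ)

  Neighbor : Fin n → Fin n → Fin n → Fin n → Set
  Neighbor i j a b =
    at A a b ≡ 1ℤ × i ≤ a × b ≤ j ×
    (∀ c d → at A c d ≡ 1ℤ → c ≤ a → b ≤ d → i ≤ c → d ≤ j → (c ≡ a × d ≡ b))

  -- the 1s involved in the removal of the -1 at (i , j): the neighboring 1s
  -- in the rectangle of rows i..i0 and columns j0..j (this includes the
  -- 1s at (i , j0) and (i0 , j))
  Involved : (i j j0 i0 : Fin n) → Fin n → Fin n → Set
  Involved i j j0 i0 a b =
    Neighbor i j a b × i ≤ a × a ≤ i0 × j0 ≤ b × b ≤ j

  -- the involved 1s have distinct rows and columns and, ordered by column,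
  -- their rows increase.  Moving east to west, the involved 1 in column q
  -- is replaced by a new 1 in column q and in the row p of the previously
  -- replaced involved 1, i.e. the involved 1 with the next larger column.
  NewOne : (i j j0 i0 : Fin n) → Fin n → Fin n → Set
  NewOne i j j0 i0 p q =
    (∃[ a ] Involved i j j0 i0 a q) ×
    (∃[ d ] (Involved i j j0 i0 p d × q < d ×
             (∀ a' e → Involved i j j0 i0 a' e → q < e → ¬ (e < d))))

  Step : Matrix n → Set
  Step A' = ∃[ i ] ∃[ j ] ∃[ j0 ] ∃[ i0 ]
    (Removable i j × NearestWest i j j0 × NearestSouth i j i0 ×
     (∀ p q → (p ≡ i × q ≡ j) → at A' p q ≡ 0ℤ) ×
     (∀ p q → NewOne i j j0 i0 p q → at A' p q ≡ 1ℤ) ×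
     (∀ p q → Involved i j j0 i0 p q → ¬ NewOne i j j0 i0 p q → at A' p q ≡ 0ℤ) ×
     (∀ p q → ¬ (p ≡ i × q ≡ j) → ¬ NewOne i j j0 i0 p q →
              ¬ Involved i j j0 i0 p q → at A' p q ≡ at A p q))

StepRel : ∀ {n} → Matrix n → Matrix n → Set
StepRel A A' = Step A A'

IsSWKey : ∀ {n} → Matrix n → Matrix n → Set
IsSWKey A K = Star StepRel A K × (∀ i j → at K i j ≢ -1ℤ)

Contains : ∀ {n k} → Matrix n → Vec ℕ k → Set
Contains {n} {k} K π =
  Σ (Fin k → Fin n) λ r → Σ (Fin k → Fin n) λ c →
    (∀ a b → a < b → r a < r b) ×
    (∀ a → at K (r a) (c a) ≡ 1ℤ) ×
    (∀ a b → (c a < c b) ⇔ (lookup π a Data.Nat.< lookup π b))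

Avoids : ∀ {n k} → Matrix n → Vec ℕ k → Set
Avoids K π = ¬ Contains K π

p312 : Vec ℕ 3
p312 = 3 Data.Vec.∷ 1 Data.Vec.∷ 2 Data.Vec.∷ Data.Vec.[]

p321 : Vec ℕ 3
p321 = 3 Data.Vec.∷ 2 Data.Vec.∷ 1 Data.Vec.∷ Data.Vec.[]

catalan : ℕ → ℕ
catalan n = ((2 * n) C n) / suc n

Counted : ∀ {n} → Matrix n → Set
Counted A = IsASM A × (∃[ K ] (IsSWKey A K × Avoids K p312 × Avoids K p321))

-- The counted ASMs are exactly the band ASMs, whose entries vanish two or
-- more places above the diagonal.  A band ASM is determined by the sequence
-- 0 = ν 0 ≤ ν 1 ≤ ⋯ ≤ ν n = n with ν k ≤ k, where the sum of its first k rows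
-- is the indicator of {0, …, k} with ν k removed; these sequences are counted
-- by ballot numbers, which give the Catalan number.
--
-- Band ASMs are counted: removing the -1 of the last row that has one lowers
-- ν on a block of rows and keeps a band matrix.  When no -1 is left, every 1
-- of the key is at column a + 1 of its row a or at a jump of ν, which rules
-- out 312 and 321.
--
-- Counted ASMs are band ASMs: an entry off the band makes the first r + 1 rows
-- sum to 1 in some column c ≥ r + 2.  Removal steps only move 1s down their
-- columns, and whenever such a column loses its 1 the column of the removed
-- -1 gains one, so the key inherits this property.  In a permutation matrix
-- it forces two 1s below row r in the first r + 2 columns, left of a 1 in
-- column c above them: a 312 or a 321.

module Submission where

open import Defs
open import Data.Nat using (ℕ; _≤_)
open import Data.Fin using (Fin)
open import Data.Product using (Σ; ∃; _×_)
open import Relation.Binary.PropositionalEquality using (_≡_)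
open import Function.Definitions using (Injective)

module Search where

  open import Data.Nat as ℕ using (ℕ; zero; suc; z≤n; s≤s)
  import Data.Nat.Properties as ℕₚ
  open import Data.Fin as Fin using (Fin; toℕ)
  import Data.Fin.Properties as Finₚ
  open import Data.Empty using (⊥-elim)
  open import Data.Sum using (_⊎_; inj₁; inj₂)
  open import Data.Product using (∃-syntax; _×_; _,_)
  open import Relation.Nullary using (¬_; yes; no; Dec)
  open import Relation.Binary.PropositionalEquality

  least-Fin : ∀ {n} (P : Fin n → Set) → (∀ x → Dec (P x)) → ∀ x → P x →
              ∃[ y ] (P y × (∀ z → P z → toℕ y ℕ.≤ toℕ z))
  least-Fin {suc n} P P? x px with P? Fin.zero
  ... | yes p0 = Fin.zero , p0 , (λ z _ → z≤n)
  ... | no ¬p0 with x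
  ...   | Fin.zero = ⊥-elim (¬p0 px)
  ...   | Fin.suc x′ with least-Fin (λ z → P (Fin.suc z)) (λ z → P? (Fin.suc z)) x′ px
  ...     | y , py , least = Fin.suc y , py , least′
    where
    least′ : ∀ z → P z → toℕ (Fin.suc y) ℕ.≤ toℕ z
    least′ Fin.zero pz = ⊥-elim (¬p0 pz)
    least′ (Fin.suc z) pz = s≤s (least z pz)

  greatest-Fin : ∀ {n} (P : Fin n → Set) → (∀ x → Dec (P x)) → ∀ x → P x →
                 ∃[ y ] (P y × (∀ z → P z → toℕ z ℕ.≤ toℕ y))
  greatest-Fin {suc n} P P? x px with Finₚ.any? (λ z → P? (Fin.suc z))
  ... | yes (z , pz) with greatest-Fin (λ z → P (Fin.suc z)) (λ z → P? (Fin.suc z)) z pz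
  ...   | y , py , greatest = Fin.suc y , py , greatest′
    where
    greatest′ : ∀ z → P z → toℕ z ℕ.≤ toℕ (Fin.suc y)
    greatest′ Fin.zero pz = z≤n
    greatest′ (Fin.suc z) pz = s≤s (greatest z pz)
  greatest-Fin {suc n} P P? x px | no none with x
  ... | Fin.suc x′ = ⊥-elim (none (x′ , px))
  ... | Fin.zero = Fin.zero , px , greatest
    where
    greatest : ∀ z → P z → toℕ z ℕ.≤ 0
    greatest Fin.zero pz = z≤n
    greatest (Fin.suc z) pz = ⊥-elim (none (z , pz))

  least-below : ∀ {P : ℕ → Set} → (∀ x → Dec (P x)) → ∀ m →
                (∃[ a ] (a ℕ.< m × P a × (∀ b → b ℕ.< a → ¬ P b))) ⊎ (∀ a → a ℕ.< m → ¬ P a)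
  least-below P? zero = inj₂ (λ a ())
  least-below P? (suc m) with least-below P? m
  ... | inj₁ (a , a<m , pa , least) = inj₁ (a , ℕₚ.m<n⇒m<1+n a<m , pa , least)
  ... | inj₂ none with P? m
  ...   | yes pm = inj₁ (m , ℕₚ.n<1+n m , pm , none)
  ...   | no ¬pm = inj₂ none′
    where
    none′ : ∀ a → a ℕ.< suc m → ¬ _
    none′ a a<m+1 with ℕₚ.m≤n⇒m<n∨m≡n (ℕₚ.≤-pred a<m+1)
    ... | inj₁ a<m = none a a<m
    ... | inj₂ refl = ¬pm

  greatest-below : ∀ {P : ℕ → Set} → (∀ x → Dec (P x)) → ∀ m →
                   (∃[ r ] (r ℕ.< m × P r × (∀ b → r ℕ.< b → b ℕ.< m → ¬ P b))) ⊎ (∀ a → a ℕ.< m → ¬ P a)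
  greatest-below P? zero = inj₂ (λ a ())
  greatest-below P? (suc m) with P? m
  ... | yes pm = inj₁ (m , ℕₚ.n<1+n m , pm , λ b m<b b<m+1 → ⊥-elim
      (ℕₚ.<-irrefl refl (ℕₚ.<-≤-trans m<b (ℕₚ.≤-pred b<m+1))))
  ... | no ¬pm with greatest-below P? m
  ...   | inj₁ (r , r<m , pr , greatest) = inj₁ (r , ℕₚ.m<n⇒m<1+n r<m , pr , greatest′)
    where
    greatest′ : ∀ b → r ℕ.< b → b ℕ.< suc m → ¬ _
    greatest′ b r<b b<m+1 with ℕₚ.m≤n⇒m<n∨m≡n (ℕₚ.≤-pred b<m+1)
    ... | inj₁ b<m = greatest b r<b b<m
    ... | inj₂ refl = ¬pm
  ...   | inj₂ none = inj₂ none′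
    where
    none′ : ∀ a → a ℕ.< suc m → ¬ _
    none′ a a<m+1 with ℕₚ.m≤n⇒m<n∨m≡n (ℕₚ.≤-pred a<m+1)
    ... | inj₁ a<m = none a a<m
    ... | inj₂ refl = ¬pm

module PrefixSums where

  open import Data.Nat as ℕ using (ℕ; zero; suc)
  import Data.Nat.Properties as ℕₚ
  open import Data.Integer as ℤ using (ℤ; 0ℤ; 1ℤ; -1ℤ; +_; _+_; _-_; -_)
  import Data.Integer.Properties as ℤₚ
  open import Data.Integer.Tactic.RingSolver using (solve-∀)
  open import Data.Bool using (true; false; if_then_else_; T)
  open import Data.Empty using (⊥-elim)
  open import Data.Sum using (_⊎_; inj₁; inj₂)
  open import Data.Product using (∃-syntax; _×_; _,_)
  open import Relation.Nullary using (¬_; yes; no)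
  open import Relation.Binary.PropositionalEquality

  psum : (ℕ → ℤ) → ℕ → ℤ
  psum f zero = 0ℤ
  psum f (suc k) = psum f k + f k

  δ : ℕ → ℕ → ℤ
  δ u x = if x ℕ.≡ᵇ u then 1ℤ else 0ℤ

  θ : ℕ → ℕ → ℤ
  θ u k = if u ℕ.<ᵇ k then 1ℤ else 0ℤ

  Bit : ℤ → Set
  Bit z = z ≡ 0ℤ ⊎ z ≡ 1ℤ

  Trit : ℤ → Set
  Trit z = z ≡ 0ℤ ⊎ (z ≡ 1ℤ ⊎ z ≡ -1ℤ)

  1≢0 : 1ℤ ≢ 0ℤ
  1≢0 ()

  -1≢0 : -1ℤ ≢ 0ℤ
  -1≢0 ()

  1≢-1 : 1ℤ ≢ -1ℤ
  1≢-1 ()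

  1+1≢0 : 1ℤ + 1ℤ ≢ 0ℤ
  1+1≢0 ()

  1+1≢1 : 1ℤ + 1ℤ ≢ 1ℤ
  1+1≢1 ()

  bit-nonneg : ∀ {z} → Bit z → 0ℤ ℤ.≤ z
  bit-nonneg (inj₁ refl) = ℤₚ.≤-refl
  bit-nonneg (inj₂ refl) = ℤ.+≤+ ℕ.z≤n

  bit≢-1 : ∀ {z} → Bit z → z ≢ -1ℤ
  bit≢-1 (inj₁ refl) ()
  bit≢-1 (inj₂ refl) ()

  bit-≢0⇒1 : ∀ {z} → Bit z → z ≢ 0ℤ → z ≡ 1ℤ
  bit-≢0⇒1 (inj₁ e) ne = ⊥-elim (ne e)
  bit-≢0⇒1 (inj₂ e) ne = e

  bit-difference : ∀ {a b} → Bit a → Bit b → Trit (b - a)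
  bit-difference (inj₁ refl) (inj₁ refl) = inj₁ refl
  bit-difference (inj₁ refl) (inj₂ refl) = inj₂ (inj₁ refl)
  bit-difference (inj₂ refl) (inj₁ refl) = inj₂ (inj₂ refl)
  bit-difference (inj₂ refl) (inj₂ refl) = inj₁ refl

  δ-view : ∀ u x → (x ≡ u × δ u x ≡ 1ℤ) ⊎ (x ≢ u × δ u x ≡ 0ℤ)
  δ-view u x with x ℕ.≡ᵇ u in eq
  ... | true = inj₁ (ℕₚ.≡ᵇ⇒≡ x u (subst T (sym eq) _) , refl)
  ... | false = inj₂ ((λ e → subst T eq (ℕₚ.≡⇒≡ᵇ x u e)) , refl)

  δ-refl : ∀ u → δ u u ≡ 1ℤ
  δ-refl u with δ-view u u
  ... | inj₁ (_ , e) = e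
  ... | inj₂ (ne , _) = ⊥-elim (ne refl)

  δ-≢ : ∀ {u x} → x ≢ u → δ u x ≡ 0ℤ
  δ-≢ {u} {x} ne with δ-view u x
  ... | inj₁ (e , _) = ⊥-elim (ne e)
  ... | inj₂ (_ , e) = e

  δ≡1⇒≡ : ∀ {u x} → δ u x ≡ 1ℤ → x ≡ u
  δ≡1⇒≡ {u} {x} e with δ-view u x
  ... | inj₁ (p , _) = p
  ... | inj₂ (_ , z) = ⊥-elim (1≢0 (trans (sym e) z))

  δ-bit : ∀ u x → Bit (δ u x)
  δ-bit u x with δ-view u x
  ... | inj₁ (_ , e) = inj₂ e
  ... | inj₂ (_ , e) = inj₁ e

  θ-view : ∀ u k → (u ℕ.< k × θ u k ≡ 1ℤ) ⊎ (k ℕ.≤ u × θ u k ≡ 0ℤ)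
  θ-view u k with u ℕ.<ᵇ k in eq
  ... | true = inj₁ (ℕₚ.<ᵇ⇒< u k (subst T (sym eq) _) , refl)
  ... | false = inj₂ (ℕₚ.≮⇒≥ (λ p → subst T eq (ℕₚ.<⇒<ᵇ p)) , refl)

  θ-< : ∀ {u k} → u ℕ.< k → θ u k ≡ 1ℤ
  θ-< {u} {k} p with θ-view u k
  ... | inj₁ (_ , e) = e
  ... | inj₂ (q , _) = ⊥-elim (ℕₚ.<⇒≱ p q)

  θ-≥ : ∀ {u k} → k ℕ.≤ u → θ u k ≡ 0ℤ
  θ-≥ {u} {k} p with θ-view u k
  ... | inj₁ (q , _) = ⊥-elim (ℕₚ.<⇒≱ q p)
  ... | inj₂ (_ , e) = e

  psum-cong : ∀ {f g} k → (∀ x → x ℕ.< k → f x ≡ g x) → psum f k ≡ psum g k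
  psum-cong zero h = refl
  psum-cong (suc k) h = cong₂ _+_ (psum-cong k (λ x p → h x (ℕₚ.m<n⇒m<1+n p))) (h k (ℕₚ.n<1+n k))

  psum-+ : ∀ f g k → psum (λ x → f x + g x) k ≡ psum f k + psum g k
  psum-+ f g zero = refl
  psum-+ f g (suc k) rewrite psum-+ f g k = interchange (psum f k) (psum g k) (f k) (g k)
    where
    interchange : ∀ a b c d → a + b + (c + d) ≡ a + c + (b + d)
    interchange = solve-∀

  psum-neg : ∀ f k → psum (λ x → - f x) k ≡ - psum f k
  psum-neg f zero = refl
  psum-neg f (suc k) rewrite psum-neg f k = sym (ℤₚ.neg-distrib-+ (psum f k) (f k))

  psum-− : ∀ f g k → psum (λ x → f x - g x) k ≡ psum f k - psum g k
  psum-− f g k = trans (psum-+ f (λ x → - g x) k) (cong (λ z → psum f k + z) (psum-neg g k))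

  psum-0 : ∀ k → psum (λ _ → 0ℤ) k ≡ 0ℤ
  psum-0 zero = refl
  psum-0 (suc k) rewrite psum-0 k = refl

  psum-1 : ∀ k → psum (λ _ → 1ℤ) k ≡ + k
  psum-1 zero = refl
  psum-1 (suc k) rewrite psum-1 k = cong +_ (ℕₚ.+-comm k 1)

  psum-unfoldˡ : ∀ f k → psum f (suc k) ≡ f 0 + psum (λ x → f (suc x)) k
  psum-unfoldˡ f zero = ℤₚ.+-comm 0ℤ (f 0)
  psum-unfoldˡ f (suc k) rewrite psum-unfoldˡ f k = ℤₚ.+-assoc (f 0) _ _

  psum-split : ∀ f a b → psum f (a ℕ.+ b) ≡ psum f a + psum (λ x → f (a ℕ.+ x)) b
  psum-split f a zero rewrite ℕₚ.+-identityʳ a = sym (ℤₚ.+-identityʳ (psum f a))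
  psum-split f a (suc b) rewrite ℕₚ.+-suc a b | psum-split f a b = ℤₚ.+-assoc (psum f a) _ _

  psum-δ : ∀ u k → psum (δ u) k ≡ θ u k
  psum-δ u zero = refl
  psum-δ u (suc k) rewrite psum-δ u k with θ-view u k | δ-view u k
  ... | inj₁ (p , _) | inj₁ (q , _) = ⊥-elim (ℕₚ.<-irrefl (sym q) p)
  ... | inj₁ (p , e) | inj₂ (_ , e′) rewrite e | e′ = sym (θ-< (ℕₚ.m<n⇒m<1+n p))
  ... | inj₂ (_ , e) | inj₁ (refl , e′) rewrite e | e′ = sym (θ-< (ℕₚ.n<1+n k))
  ... | inj₂ (p , e) | inj₂ (q , e′) rewrite e | e′ = sym (θ-≥ (ℕₚ.≤∧≢⇒< p q))

  psum-telescope : ∀ (g : ℕ → ℤ) k → psum (λ x → g (suc x) - g x) k ≡ g k - g 0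
  psum-telescope g zero = sym (ℤₚ.+-inverseʳ (g 0))
  psum-telescope g (suc k) =
    trans (cong (_+ (g (suc k) - g k)) (psum-telescope g k)) (cancel (g k) (g (suc k)) (g 0))
    where
    cancel : ∀ a b c → a - c + (b - a) ≡ b - c
    cancel = solve-∀

  psum-swap : ∀ (g : ℕ → ℕ → ℤ) B C →
              psum (λ b → psum (λ c → g b c) C) B ≡ psum (λ c → psum (λ b → g b c) B) C
  psum-swap g zero C = sym (psum-0 C)
  psum-swap g (suc B) C rewrite psum-swap g B C = sym (psum-+ (λ c → psum (λ b → g b c) B) (λ c → g B c) C)

  psum-vanishing-tail : ∀ f m k → (∀ x → m ℕ.≤ x → f x ≡ 0ℤ) → m ℕ.≤ k → psum f k ≡ psum f m
  psum-vanishing-tail f m zero h ℕ.z≤n = refl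
  psum-vanishing-tail f m (suc k) h p with ℕₚ.m≤n⇒m<n∨m≡n p
  ... | inj₂ refl = refl
  ... | inj₁ q rewrite h k (ℕₚ.≤-pred q) | psum-vanishing-tail f m k h (ℕₚ.≤-pred q) =
    ℤₚ.+-identityʳ (psum f m)

  psum-step : ∀ f x → f x ≡ psum f (suc x) - psum f x
  psum-step f x = b≡a+b-a (psum f x) (f x)
    where
    b≡a+b-a : ∀ a b → b ≡ a + b - a
    b≡a+b-a = solve-∀

  -- The prefix sums of every row and column of an ASM lie in {0,1}; this is
  -- the form in which the alternating sign condition is used throughout.
  PrefixBits : (ℕ → ℤ) → Set
  PrefixBits f = ∀ x → Bit (psum f x)

  psum-bits⇒trit : ∀ f x → Bit (psum f x) → Bit (psum f (suc x)) → Trit (f x)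
  psum-bits⇒trit f x b b′ = subst Trit (sym (psum-step f x)) (bit-difference b b′)

  bit-after-1 : ∀ {s x} → Bit s → Bit (s + x) → x ≡ 1ℤ → s + x ≡ 1ℤ
  bit-after-1 (inj₁ refl) b refl = refl
  bit-after-1 (inj₂ refl) (inj₁ ()) refl
  bit-after-1 (inj₂ refl) (inj₂ ()) refl

  bit-before-1 : ∀ {s x} → Bit s → Bit (s + x) → x ≡ 1ℤ → s ≡ 0ℤ
  bit-before-1 (inj₁ refl) b refl = refl
  bit-before-1 (inj₂ refl) (inj₁ ()) refl
  bit-before-1 (inj₂ refl) (inj₂ ()) refl

  bit-after-−1 : ∀ {s x} → Bit s → Bit (s + x) → x ≡ -1ℤ → s + x ≡ 0ℤ
  bit-after-−1 (inj₂ refl) b refl = refl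
  bit-after-−1 (inj₁ refl) (inj₁ ()) refl
  bit-after-−1 (inj₁ refl) (inj₂ ()) refl

  module _ {f : ℕ → ℤ} (bits : PrefixBits f) where

    psum-stays-1 : ∀ a b → psum f a ≡ 1ℤ → (∀ x → a ℕ.≤ x → x ℕ.< b → f x ≢ -1ℤ) →
                   a ℕ.≤ b → psum f b ≡ 1ℤ
    psum-stays-1 a zero e h ℕ.z≤n = e
    psum-stays-1 a (suc b) e h p with ℕₚ.m≤n⇒m<n∨m≡n p
    ... | inj₂ refl = e
    ... | inj₁ q with psum-stays-1 a b e (λ x u v → h x u (ℕₚ.m<n⇒m<1+n v)) (ℕₚ.≤-pred q)
    ... | e′ with psum-bits⇒trit f b (bits b) (bits (suc b)) | bits (suc b)
    ... | inj₁ z | _ = cong₂ _+_ e′ z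
    ... | inj₂ (inj₁ o) | inj₁ w = ⊥-elim (1+1≢0 (trans (sym (cong₂ _+_ e′ o)) w))
    ... | inj₂ (inj₁ o) | inj₂ w = ⊥-elim (1+1≢1 (trans (sym (cong₂ _+_ e′ o)) w))
    ... | inj₂ (inj₂ m) | _ = ⊥-elim (h b (ℕₚ.≤-pred q) (ℕₚ.n<1+n b) m)

    psum-stays-0 : ∀ a b → psum f a ≡ 0ℤ → (∀ x → a ℕ.≤ x → x ℕ.< b → f x ≢ 1ℤ) →
                   a ℕ.≤ b → psum f b ≡ 0ℤ
    psum-stays-0 a zero e h ℕ.z≤n = e
    psum-stays-0 a (suc b) e h p with ℕₚ.m≤n⇒m<n∨m≡n p
    ... | inj₂ refl = e
    ... | inj₁ q with psum-stays-0 a b e (λ x u v → h x u (ℕₚ.m<n⇒m<1+n v)) (ℕₚ.≤-pred q)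
    ... | e′ with psum-bits⇒trit f b (bits b) (bits (suc b)) | bits (suc b)
    ... | inj₁ z | _ = cong₂ _+_ e′ z
    ... | inj₂ (inj₁ o) | _ = ⊥-elim (h b (ℕₚ.≤-pred q) (ℕₚ.n<1+n b) o)
    ... | inj₂ (inj₂ m) | inj₁ w = ⊥-elim (-1≢0 (trans (sym (cong₂ _+_ e′ m)) w))
    ... | inj₂ (inj₂ m) | inj₂ w = ⊥-elim (1≢-1 (trans (sym w) (cong₂ _+_ e′ m)))

    psum-stays-0-backward : ∀ a b → psum f b ≡ 0ℤ → (∀ x → a ℕ.≤ x → x ℕ.< b → f x ≢ -1ℤ) →
                            a ℕ.≤ b → psum f a ≡ 0ℤ
    psum-stays-0-backward a zero e h ℕ.z≤n = e
    psum-stays-0-backward a (suc b) e h p with ℕₚ.m≤n⇒m<n∨m≡n p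
    ... | inj₂ refl = e
    ... | inj₁ q = psum-stays-0-backward a b e′ (λ x u v → h x u (ℕₚ.m<n⇒m<1+n v)) (ℕₚ.≤-pred q)
      where
      e′ : psum f b ≡ 0ℤ
      e′ with bits b | psum-bits⇒trit f b (bits b) (bits (suc b))
      ... | inj₁ w | _ = w
      ... | inj₂ w | inj₁ z = ⊥-elim (1≢0 (trans (sym (cong₂ _+_ w z)) e))
      ... | inj₂ w | inj₂ (inj₁ o) = ⊥-elim (1+1≢0 (trans (sym (cong₂ _+_ w o)) e))
      ... | inj₂ w | inj₂ (inj₂ m) = ⊥-elim (h b (ℕₚ.≤-pred q) (ℕₚ.n<1+n b) m)

  BitsBelow : ℕ → (ℕ → ℤ) → Set
  BitsBelow k f = ∀ x → x ℕ.< k → Bit (f x)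

  BitsBelow-pred : ∀ {k f} → BitsBelow (suc k) f → BitsBelow k f
  BitsBelow-pred h x p = h x (ℕₚ.m<n⇒m<1+n p)

  +-cancelʳ-≤ : ∀ c a b → a + c ℤ.≤ b + c → a ℤ.≤ b
  +-cancelʳ-≤ c a b le = subst₂ ℤ._≤_ (cancel a c) (cancel b c) (ℤₚ.+-monoˡ-≤ (- c) le)
    where
    cancel : ∀ x c → x + c + - c ≡ x
    cancel = solve-∀

  psum-bits-≤ : ∀ k f → BitsBelow k f → psum f k ℤ.≤ + k
  psum-bits-≤ zero f h = ℤₚ.≤-refl
  psum-bits-≤ (suc k) f h with h k (ℕₚ.n<1+n k)
  ... | inj₁ e = ℤₚ.≤-trans (ℤₚ.+-mono-≤ (psum-bits-≤ k f (BitsBelow-pred h)) (ℤₚ.≤-reflexive e))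
                   (ℤ.+≤+ (ℕₚ.≤-trans (ℕₚ.≤-reflexive (ℕₚ.+-identityʳ k)) (ℕₚ.n≤1+n k)))
  ... | inj₂ e = ℤₚ.≤-trans (ℤₚ.+-mono-≤ (psum-bits-≤ k f (BitsBelow-pred h)) (ℤₚ.≤-reflexive e))
                   (ℤₚ.≤-reflexive (cong +_ (ℕₚ.+-comm k 1)))

  psum-bits-≥0 : ∀ k f → BitsBelow k f → 0ℤ ℤ.≤ psum f k
  psum-bits-≥0 zero f h = ℤₚ.≤-refl
  psum-bits-≥0 (suc k) f h =
    ℤₚ.+-mono-≤ (psum-bits-≥0 k f (BitsBelow-pred h)) (bit-nonneg (h k (ℕₚ.n<1+n k)))

  psum-bits-< : ∀ k f a → BitsBelow k f → f a ≡ 0ℤ → a ℕ.< k → psum f k + 1ℤ ℤ.≤ + k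
  psum-bits-< (suc k) f a h e p with ℕₚ.m≤n⇒m<n∨m≡n p
  ... | inj₂ refl rewrite e | ℤₚ.+-identityʳ (psum f k) =
    ℤₚ.≤-trans (ℤₚ.+-mono-≤ (psum-bits-≤ k f (BitsBelow-pred h)) ℤₚ.≤-refl)
               (ℤₚ.≤-reflexive (cong +_ (ℕₚ.+-comm k 1)))
  ... | inj₁ q with h k (ℕₚ.n<1+n k)
  ... | inj₁ e′ rewrite e′ | ℤₚ.+-identityʳ (psum f k) =
    ℤₚ.≤-trans (psum-bits-< k f a (BitsBelow-pred h) e (ℕₚ.≤-pred q)) (ℤ.+≤+ (ℕₚ.n≤1+n k))
  ... | inj₂ e′ rewrite e′ =
    ℤₚ.≤-trans (ℤₚ.+-mono-≤ (psum-bits-< k f a (BitsBelow-pred h) e (ℕₚ.≤-pred q)) ℤₚ.≤-refl)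
               (ℤₚ.≤-reflexive (cong +_ (ℕₚ.+-comm k 1)))

  psum≢0⇒nonzero : ∀ k f → psum f k ≢ 0ℤ → ∃[ x ] (x ℕ.< k × f x ≢ 0ℤ)
  psum≢0⇒nonzero zero f ne = ⊥-elim (ne refl)
  psum≢0⇒nonzero (suc k) f ne with f k ℤ.≟ 0ℤ
  ... | no fk = k , ℕₚ.n<1+n k , fk
  ... | yes fk with psum≢0⇒nonzero k f (λ z → ne (cong₂ _+_ z fk))
  ... | x , p , q = x , ℕₚ.m<n⇒m<1+n p , q

  psum≥1⇒one : ∀ k f → BitsBelow k f → 1ℤ ℤ.≤ psum f k → ∃[ x ] (x ℕ.< k × f x ≡ 1ℤ)
  psum≥1⇒one k f h le with psum≢0⇒nonzero k f (λ e → 1≰0 (subst (1ℤ ℤ.≤_) e le))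
    where
    1≰0 : ¬ (1ℤ ℤ.≤ 0ℤ)
    1≰0 (ℤ.+≤+ ())
  ... | x , p , q = x , p , bit-≢0⇒1 (h x p) q

  psum≥2⇒two-ones : ∀ k f → BitsBelow k f → + 2 ℤ.≤ psum f k →
                    ∃[ x ] ∃[ y ] (x ℕ.< y × y ℕ.< k × f x ≡ 1ℤ × f y ≡ 1ℤ)
  psum≥2⇒two-ones zero f h (ℤ.+≤+ ())
  psum≥2⇒two-ones (suc k) f h le with h k (ℕₚ.n<1+n k)
  ... | inj₁ e with psum≥2⇒two-ones k f (BitsBelow-pred h)
                      (ℤₚ.≤-trans le (ℤₚ.≤-reflexive (trans (cong (λ z → psum f k + z) e) (ℤₚ.+-identityʳ _))))
  ... | x , y , p , q , r , s = x , y , p , ℕₚ.m<n⇒m<1+n q , r , s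
  psum≥2⇒two-ones (suc k) f h le | inj₂ e with psum≥1⇒one k f (BitsBelow-pred h) le′
    where
    le′ : 1ℤ ℤ.≤ psum f k
    le′ = +-cancelʳ-≤ 1ℤ 1ℤ (psum f k) (ℤₚ.≤-trans le (ℤₚ.≤-reflexive (cong (λ z → psum f k + z) e)))
  ... | x , p , q = x , k , p , ℕₚ.n<1+n k , q , e

  one⇒psum≥1 : ∀ k f x → BitsBelow k f → f x ≡ 1ℤ → x ℕ.< k → 1ℤ ℤ.≤ psum f k
  one⇒psum≥1 (suc k) f x h e p with ℕₚ.m≤n⇒m<n∨m≡n p
  ... | inj₂ refl rewrite e = ℤₚ.+-mono-≤ (psum-bits-≥0 k f (BitsBelow-pred h)) ℤₚ.≤-refl
  ... | inj₁ q = ℤₚ.+-mono-≤ (one⇒psum≥1 k f x (BitsBelow-pred h) e (ℕₚ.≤-pred q))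
      (bit-nonneg (h k (ℕₚ.n<1+n k)))

  two-ones⇒psum≥2 : ∀ k f x y → BitsBelow k f → f x ≡ 1ℤ → f y ≡ 1ℤ → x ℕ.< y → y ℕ.< k →
                    + 2 ℤ.≤ psum f k
  two-ones⇒psum≥2 (suc k) f x y h ex ey xy p with ℕₚ.m≤n⇒m<n∨m≡n p
  ... | inj₂ refl rewrite ey = ℤₚ.+-mono-≤ (one⇒psum≥1 k f x (BitsBelow-pred h) ex xy) ℤₚ.≤-refl
  ... | inj₁ q = ℤₚ.+-mono-≤ (two-ones⇒psum≥2 k f x y (BitsBelow-pred h) ex ey xy (ℕₚ.≤-pred q))
                             (bit-nonneg (h k (ℕₚ.n<1+n k)))

module PrefixSumForm where

  open import Data.Nat as ℕ using (ℕ; zero; suc)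
  import Data.Nat.Properties as ℕₚ
  open import Data.Integer as ℤ using (ℤ; 0ℤ; 1ℤ; -1ℤ; _+_; _-_; -_)
  import Data.Integer.Properties as ℤₚ
  open import Data.Integer.Tactic.RingSolver using (solve-∀)
  open import Data.Fin as Fin using (Fin; toℕ; fromℕ<)
  import Data.Fin.Properties as Finₚ
  open import Data.Vec as Vec using (Vec; []; _∷_; lookup; toList; transpose; replicate; map)
  import Data.Vec.Properties as Vecₚ
  open import Data.List as List using ([]; _∷_)
  open import Data.List.Relation.Unary.Linked as Linked using (Linked; []; [-]; _∷_)
  open import Data.Empty using (⊥-elim)
  open import Data.Sum using (inj₁; inj₂; [_,_]′)
  open import Data.Product using (_×_; _,_; proj₁; proj₂)
  open import Relation.Binary.PropositionalEquality
  open import Defs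
  open PrefixSums

  vget : ∀ {A : Set} {m} → A → Vec A m → ℕ → A
  vget d [] k = d
  vget d (x ∷ xs) zero = x
  vget d (x ∷ xs) (suc k) = vget d xs k

  vget-lookup : ∀ {A : Set} {m} (d : A) (v : Vec A m) (i : Fin m) → vget d v (toℕ i) ≡ lookup v i
  vget-lookup d (x ∷ v) Fin.zero = refl
  vget-lookup d (x ∷ v) (Fin.suc i) = vget-lookup d v i

  vget-outside : ∀ {A : Set} {m} (d : A) (v : Vec A m) k → m ℕ.≤ k → vget d v k ≡ d
  vget-outside d [] k p = refl
  vget-outside d (x ∷ v) (suc k) (ℕ.s≤s p) = vget-outside d v k p

  vget-replicate : ∀ {A : Set} {m} (d : A) k → vget d (replicate m d) k ≡ d
  vget-replicate {m = zero} d k = refl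
  vget-replicate {m = suc m} d zero = refl
  vget-replicate {m = suc m} d (suc k) = vget-replicate {m = m} d k

  data Index (n : ℕ) : ℕ → Set where
    inside : (i : Fin n) → Index n (toℕ i)
    outside : ∀ {b} → n ℕ.≤ b → Index n b

  index : ∀ n b → Index n b
  index n b with ℕₚ.<-≤-connex b n
  ... | inj₁ p = subst (Index n) (Finₚ.toℕ-fromℕ< p) (inside (fromℕ< p))
  ... | inj₂ p = outside p

  -- Matrix entries indexed by naturals, extended by 0 outside the matrix, so
  -- that row and column prefix sums can be taken to any length.
  entry : ∀ {n} → Matrix n → ℕ → ℕ → ℤ
  entry {n} M a b = vget 0ℤ (vget (replicate n 0ℤ) M a) b

  entry-at : ∀ {n} (M : Matrix n) i j → entry M (toℕ i) (toℕ j) ≡ at M i j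
  entry-at M i j rewrite vget-lookup (replicate _ 0ℤ) M i = vget-lookup 0ℤ (lookup M i) j

  entry-below : ∀ {n} (M : Matrix n) a b → n ℕ.≤ a → entry M a b ≡ 0ℤ
  entry-below {n} M a b p rewrite vget-outside (replicate n 0ℤ) M a p = vget-replicate {m = n} 0ℤ b

  entry-right : ∀ {n} (M : Matrix n) a b → n ℕ.≤ b → entry M a b ≡ 0ℤ
  entry-right {n} M a b p = vget-outside 0ℤ (vget (replicate n 0ℤ) M a) b p

  lookup-transpose : ∀ {m n} (A : Vec (Vec ℤ n) m) (j : Fin n) →
                     lookup (transpose A) j ≡ map (λ r → lookup r j) A
  lookup-transpose [] j = Vecₚ.lookup-replicate j []
  lookup-transpose {suc m} {n} (as ∷ ass) j = begin
    lookup (transpose (as ∷ ass)) j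
      ≡⟨ Vecₚ.lookup-⊛ j (conses Vec.⊛ as) (transpose ass) ⟩
    lookup (conses Vec.⊛ as) j (lookup (transpose ass) j)
      ≡⟨ cong (λ h → h (lookup (transpose ass) j)) (Vecₚ.lookup-⊛ j conses as) ⟩
    lookup conses j (lookup as j) (lookup (transpose ass) j)
      ≡⟨ cong (λ h → h (lookup as j) (lookup (transpose ass) j)) (Vecₚ.lookup-replicate j Vec._∷_) ⟩
    lookup as j ∷ lookup (transpose ass) j
      ≡⟨ cong (lookup as j ∷_) (lookup-transpose ass j) ⟩
    map (λ r → lookup r j) (as ∷ ass) ∎
    where
    open ≡-Reasoning
    conses : Vec (ℤ → Vec ℤ m → Vec ℤ (suc m)) n
    conses = replicate n Vec._∷_

  vget-map-lookup : ∀ {m n} (A : Vec (Vec ℤ n) m) (j : Fin n) a →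
                    vget 0ℤ (map (λ r → lookup r j) A) a ≡ vget 0ℤ (vget (replicate n 0ℤ) A a) (toℕ j)
  vget-map-lookup {n = n} [] j a = sym (vget-replicate {m = n} 0ℤ (toℕ j))
  vget-map-lookup (r ∷ A) j zero = sym (vget-lookup 0ℤ r j)
  vget-map-lookup (r ∷ A) j (suc a) = vget-map-lookup A j a

  row-psum : ∀ {n} (M : Matrix n) i k → psum (vget 0ℤ (lookup M i)) k ≡ psum (entry M (toℕ i)) k
  row-psum M i k rewrite vget-lookup (replicate _ 0ℤ) M i = refl

  col-psum : ∀ {n} (M : Matrix n) j k →
             psum (vget 0ℤ (lookup (transpose M) j)) k ≡ psum (λ a → entry M a (toℕ j)) k
  col-psum M j k rewrite lookup-transpose M j = psum-cong k (λ a _ → vget-map-lookup M j a)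

  at-transpose : ∀ {n} (M : Matrix n) i j → lookup (lookup (transpose M) j) i ≡ at M i j
  at-transpose M i j rewrite lookup-transpose M j = Vecₚ.lookup-map i (λ r → lookup r j) M

  sumℤ-toList : ∀ {m} (v : Vec ℤ m) → sumℤ (toList v) ≡ psum (vget 0ℤ v) m
  sumℤ-toList [] = refl
  sumℤ-toList {suc m} (x ∷ v) =
    trans (cong (x +_) (sumℤ-toList v)) (sym (psum-unfoldˡ (vget 0ℤ (x ∷ v)) m))

  Alt : ℤ → ℤ → Set
  Alt a b = b ≡ - a

  -- Reading a line after a virtual leading -1: s is the prefix sum so far and
  -- p the last nonzero entry read.
  data Phase : ℤ → ℤ → Set where
    even : Phase 0ℤ -1ℤ
    odd : Phase 1ℤ 1ℤ

  trits-∷ : ∀ {m x} {v : Vec ℤ m} → Trit x → (∀ i → Trit (lookup v i)) → ∀ i → Trit (lookup (x ∷ v) i)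
  trits-∷ t ts Fin.zero = t
  trits-∷ t ts (Fin.suc i) = ts i

  bits-∷ : ∀ {m s′} s x (v : Vec ℤ m) → s + x ≡ s′ →
           (∀ k → Bit (s′ + psum (vget 0ℤ v) k)) → ∀ k → Bit (s + psum (vget 0ℤ (x ∷ v)) (suc k))
  bits-∷ s x v e h k =
    subst Bit (trans (cong (_+ psum (vget 0ℤ v) k) (sym e))
                     (trans (ℤₚ.+-assoc s x _) (cong (s +_) (sym (psum-unfoldˡ (vget 0ℤ (x ∷ v)) k)))))
          (h k)

  bits-tail : ∀ {m s′} s x (v : Vec ℤ m) → s + x ≡ s′ →
              (∀ k → Bit (s + psum (vget 0ℤ (x ∷ v)) k)) → ∀ k → Bit (s′ + psum (vget 0ℤ v) k)
  bits-tail s x v e h k =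
    subst Bit (trans (cong (s +_) (psum-unfoldˡ (vget 0ℤ (x ∷ v)) k))
                     (trans (sym (ℤₚ.+-assoc s x _)) (cong (_+ psum (vget 0ℤ v) k) e)))
          (h (suc k))

  alternating⇒bits : ∀ {m} (v : Vec ℤ m) {s p} → Phase s p → (∀ i → Trit (lookup v i)) →
                     Linked Alt (p ∷ nonzeros (toList v)) → ∀ k → Bit (s + psum (vget 0ℤ v) k)
  alternating⇒bits v even ts lk zero = inj₁ refl
  alternating⇒bits v odd ts lk zero = inj₂ refl
  alternating⇒bits [] even ts lk (suc k) rewrite psum-0 (suc k) = inj₁ refl
  alternating⇒bits [] odd ts lk (suc k) rewrite psum-0 (suc k) = inj₂ refl
  alternating⇒bits (x ∷ v) ph ts lk (suc k) with ts Fin.zero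
  alternating⇒bits (x ∷ v) even ts lk (suc k) | inj₁ refl =
    bits-∷ 0ℤ 0ℤ v refl (alternating⇒bits v even (λ i → ts (Fin.suc i)) lk) k
  alternating⇒bits (x ∷ v) odd ts lk (suc k) | inj₁ refl =
    bits-∷ 1ℤ 0ℤ v refl (alternating⇒bits v odd (λ i → ts (Fin.suc i)) lk) k
  alternating⇒bits (x ∷ v) even ts (_ ∷ lk) (suc k) | inj₂ (inj₁ refl) =
    bits-∷ 0ℤ 1ℤ v refl (alternating⇒bits v odd (λ i → ts (Fin.suc i)) lk) k
  alternating⇒bits (x ∷ v) odd ts (() ∷ lk) (suc k) | inj₂ (inj₁ refl)
  alternating⇒bits (x ∷ v) even ts (() ∷ lk) (suc k) | inj₂ (inj₂ refl)
  alternating⇒bits (x ∷ v) odd ts (_ ∷ lk) (suc k) | inj₂ (inj₂ refl) =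
    bits-∷ 1ℤ -1ℤ v refl (alternating⇒bits v even (λ i → ts (Fin.suc i)) lk) k

  entry-solve : ∀ s x t → s + x ≡ t → x ≡ t - s
  entry-solve s x t e = trans (cancel s x) (cong (_- s) e)
    where
    cancel : ∀ s x → x ≡ s + x - s
    cancel = solve-∀

  bits⇒alternating : ∀ {m} (v : Vec ℤ m) {s p} → Phase s p → (∀ k → Bit (s + psum (vget 0ℤ v) k)) →
                     (∀ i → Trit (lookup v i)) × Linked Alt (p ∷ nonzeros (toList v))
  bits⇒alternating [] ph h = (λ ()) , [-]
  bits⇒alternating (x ∷ v) {s} ph h with ph | subst (λ t → Bit (s + t)) (ℤₚ.+-identityˡ x) (h 1)
  ... | even | inj₁ e with entry-solve 0ℤ x 0ℤ e
  ...   | refl = let (ts , lk) = bits⇒alternating v even (bits-tail 0ℤ 0ℤ v refl h)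
                 in trits-∷ (inj₁ refl) ts , lk
  bits⇒alternating (x ∷ v) ph h | even | inj₂ e with entry-solve 0ℤ x 1ℤ e
  ...   | refl = let (ts , lk) = bits⇒alternating v odd (bits-tail 0ℤ 1ℤ v refl h)
                 in trits-∷ (inj₂ (inj₁ refl)) ts , refl ∷ lk
  bits⇒alternating (x ∷ v) ph h | odd | inj₁ e with entry-solve 1ℤ x 0ℤ e
  ...   | refl = let (ts , lk) = bits⇒alternating v even (bits-tail 1ℤ -1ℤ v refl h)
                 in trits-∷ (inj₂ (inj₂ refl)) ts , refl ∷ lk
  bits⇒alternating (x ∷ v) ph h | odd | inj₂ e with entry-solve 1ℤ x 1ℤ e
  ...   | refl = let (ts , lk) = bits⇒alternating v odd (bits-tail 1ℤ 0ℤ v refl h)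
                 in trits-∷ (inj₁ refl) ts , lk

  -- A line of sum 1 cannot start with -1: reading it after a virtual leading 1
  -- would give the prefix sum 2.
  alternating-from-−1 : ∀ {m} (v : Vec ℤ m) → (∀ i → Trit (lookup v i)) → Alternating (toList v) →
                        sumℤ (toList v) ≡ 1ℤ → Linked Alt (-1ℤ ∷ nonzeros (toList v))
  alternating-from-−1 [] ts lk sum = [-]
  alternating-from-−1 {suc m} (x ∷ v) ts lk sum with ts Fin.zero
  ... | inj₁ refl = alternating-from-−1 v (λ i → ts (Fin.suc i)) lk (trans (sym (ℤₚ.+-identityˡ _)) sum)
  ... | inj₂ (inj₁ refl) = refl ∷ lk
  ... | inj₂ (inj₂ refl) =
    ⊥-elim ([ 1+1≢0 , 1+1≢1 ]′ (subst (λ t → Bit (1ℤ + t)) (trans (sym (sumℤ-toList (-1ℤ ∷ v))) sum)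
                                      (alternating⇒bits (-1ℤ ∷ v) odd ts (refl ∷ lk) (suc m))))

  alternating-line⇒bits : ∀ {m} (v : Vec ℤ m) → (∀ i → Trit (lookup v i)) → Alternating (toList v) →
                          sumℤ (toList v) ≡ 1ℤ → PrefixBits (vget 0ℤ v)
  alternating-line⇒bits v ts alt sum k =
    subst Bit (ℤₚ.+-identityˡ _) (alternating⇒bits v even ts (alternating-from-−1 v ts alt sum) k)

  bits⇒alternating-line : ∀ {m} (v : Vec ℤ m) → PrefixBits (vget 0ℤ v) →
                          (∀ i → Trit (lookup v i)) × Alternating (toList v)
  bits⇒alternating-line v bits =
    let (ts , lk) = bits⇒alternating v even (λ k → subst Bit (sym (ℤₚ.+-identityˡ _)) (bits k))
    in ts , Linked.tail lk

  record PrefixForm {n} (M : Matrix n) : Set where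
    field
      col-bits : ∀ c → PrefixBits (λ a → entry M a c)
      row-bits : ∀ a → PrefixBits (entry M a)
      col-total : ∀ c → c ℕ.< n → psum (λ a → entry M a c) n ≡ 1ℤ
      row-total : ∀ a → a ℕ.< n → psum (entry M a) n ≡ 1ℤ

  zero-bits : ∀ {f} → (∀ x → f x ≡ 0ℤ) → PrefixBits f
  zero-bits {f} z k = inj₁ (trans (psum-cong k (λ x _ → z x)) (psum-0 k))

  isASM⇒prefixForm : ∀ {n} (A : Matrix n) → IsASM A → PrefixForm A
  isASM⇒prefixForm {n} A asm = record
    { col-bits = col-bits ; row-bits = row-bits ; col-total = col-total ; row-total = row-total }
    where
    open IsASM asm
    col-trits : ∀ j i → Trit (lookup (lookup (transpose A) j) i)
    col-trits j i = subst Trit (sym (at-transpose A i j)) (entries i j)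
    row-bits : ∀ a → PrefixBits (entry A a)
    row-bits a k with index n a
    ... | inside i = subst Bit (row-psum A i k) (alternating-line⇒bits (lookup A i) (entries i) (rowAlt i)
        (rowSum i) k)
    ... | outside p = zero-bits (λ b → entry-below A a b p) k
    col-bits : ∀ c → PrefixBits (λ a → entry A a c)
    col-bits c k with index n c
    ... | inside j = subst Bit (col-psum A j k) (alternating-line⇒bits (lookup (transpose A) j) (col-trits j)
        (colAlt j) (colSum j) k)
    ... | outside p = zero-bits (λ a → entry-right A a c p) k
    row-total : ∀ a → a ℕ.< n → psum (entry A a) n ≡ 1ℤ
    row-total a a<n with index n a
    ... | inside i = trans (sym (row-psum A i n)) (trans (sym (sumℤ-toList (lookup A i))) (rowSum i))
    ... | outside p = ⊥-elim (ℕₚ.<⇒≱ a<n p)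
    col-total : ∀ c → c ℕ.< n → psum (λ a → entry A a c) n ≡ 1ℤ
    col-total c c<n with index n c
    ... | inside j =
      trans (sym (col-psum A j n)) (trans (sym (sumℤ-toList (lookup (transpose A) j))) (colSum j))
    ... | outside p = ⊥-elim (ℕₚ.<⇒≱ c<n p)

  prefixForm⇒isASM : ∀ {n} (A : Matrix n) → PrefixForm A → IsASM A
  prefixForm⇒isASM {n} A pf = record
    { entries = λ i j → proj₁ (row-line i) j ; rowSum = rowSum ; colSum = colSum
    ; rowAlt = λ i → proj₂ (row-line i) ; colAlt = λ j → proj₂ (col-line j) }
    where
    open PrefixForm pf
    row-line : ∀ i → (∀ j → Trit (lookup (lookup A i) j)) × Alternating (toList (lookup A i))
    row-line i = bits⇒alternating-line (lookup A i) (λ k → subst Bit (sym (row-psum A i k))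
        (row-bits (toℕ i) k))
    col-line : ∀ j → (∀ i → Trit (lookup (lookup (transpose A) j) i)) × Alternating
        (toList (lookup (transpose A) j))
    col-line j = bits⇒alternating-line (lookup (transpose A) j)
        (λ k → subst Bit (sym (col-psum A j k)) (col-bits (toℕ j) k))
    rowSum : ∀ i → sumℤ (toList (lookup A i)) ≡ 1ℤ
    rowSum i = trans (sumℤ-toList (lookup A i)) (trans (row-psum A i n) (row-total (toℕ i) (Finₚ.toℕ<n i)))
    colSum : ∀ j → sumℤ (toList (lookup (transpose A) j)) ≡ 1ℤ
    colSum j = trans (sumℤ-toList (lookup (transpose A) j))
                     (trans (col-psum A j n) (col-total (toℕ j) (Finₚ.toℕ<n j)))

module KeyInvariant where

  open import Data.Nat as ℕ using (ℕ; suc)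
  import Data.Nat.Properties as ℕₚ
  open import Data.Integer as ℤ using (ℤ; 0ℤ; 1ℤ; -1ℤ; +_; _+_; _-_; -_)
  import Data.Integer.Properties as ℤₚ
  open import Data.Fin as Fin using (Fin; toℕ)
  import Data.Fin.Properties as Finₚ
  open import Data.Empty using (⊥-elim)
  open import Data.Sum using (inj₁; inj₂; [_,_]′)
  open import Data.Product using (∃-syntax; _×_; _,_; proj₁; proj₂)
  open import Relation.Nullary using (¬_; yes; no; Dec)
  open import Relation.Nullary.Decidable using (_×-dec_; _→-dec_)
  open import Relation.Binary.PropositionalEquality
  open import Relation.Binary.Definitions using (tri<; tri≈; tri>)
  open import Relation.Binary.Construct.Closure.ReflexiveTransitive using (Star; ε; _◅_)
  open import Defs
  open PrefixSums
  open PrefixSumForm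
  open Search

  shift : ℕ → ℕ → ℕ → ℤ
  shift u w a = δ u a - δ w a

  psum-shift : ∀ u w k → psum (shift u w) k ≡ θ u k - θ w k
  psum-shift u w k = trans (psum-− (δ u) (δ w) k) (cong₂ _-_ (psum-δ u k) (psum-δ w k))

  bits-raise-zeros : ∀ (f : ℕ → ℤ) u w → u ℕ.< w → PrefixBits f → (∀ k → u ℕ.< k → k ℕ.≤ w → psum f k ≡ 0ℤ) →
         ∀ k → Bit (psum f k + (θ u k - θ w k))
  bits-raise-zeros f u w u<w bits z k with θ-view u k | θ-view w k
  ... | inj₁ (p , e1) | inj₁ (q , e2) rewrite e1 | e2 = subst Bit (sym (ℤₚ.+-identityʳ _)) (bits k)
  ... | inj₁ (p , e1) | inj₂ (q , e2) rewrite e1 | e2 | z k p q = inj₂ refl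
  ... | inj₂ (p , e1) | inj₁ (q , e2) = ⊥-elim (ℕₚ.<-asym u<w (ℕₚ.<-≤-trans q p))
  ... | inj₂ (p , e1) | inj₂ (q , e2) rewrite e1 | e2 = subst Bit (sym (ℤₚ.+-identityʳ _)) (bits k)

  bits-lower-ones : ∀ (f : ℕ → ℤ) u w → w ℕ.< u → PrefixBits f → (∀ k → w ℕ.< k → k ℕ.≤ u → psum f k ≡ 1ℤ) →
         ∀ k → Bit (psum f k + (θ u k - θ w k))
  bits-lower-ones f u w w<u bits z k with θ-view u k | θ-view w k
  ... | inj₁ (p , e1) | inj₁ (q , e2) rewrite e1 | e2 = subst Bit (sym (ℤₚ.+-identityʳ _)) (bits k)
  ... | inj₂ (p , e1) | inj₁ (q , e2) rewrite e1 | e2 | z k q p = inj₁ refl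
  ... | inj₁ (p , e1) | inj₂ (q , e2) = ⊥-elim (ℕₚ.<-asym w<u (ℕₚ.<-≤-trans p q))
  ... | inj₂ (p , e1) | inj₂ (q , e2) rewrite e1 | e2 = subst Bit (sym (ℤₚ.+-identityʳ _)) (bits k)

  OffBand : ∀ {n} → Matrix n → ℕ → Set
  OffBand {n} M r =
    ∃[ c ] (suc (suc r) ℕ.≤ c × c ℕ.< n × psum (λ a → entry M a c) (suc r) ≡ 1ℤ)

  module RemovalStep {n : ℕ} (M M′ : Matrix n) (pf : PrefixForm M) (i j j0 i0 : Fin n)
    (rem : Removable M i j) (nw : NearestWest M i j j0) (ns : NearestSouth M i j i0)
    (at-removed : ∀ p q → (p ≡ i × q ≡ j) → at M′ p q ≡ 0ℤ)
    (at-new : ∀ p q → NewOne M i j j0 i0 p q → at M′ p q ≡ 1ℤ)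
    (at-involved : ∀ p q → Involved M i j j0 i0 p q → ¬ NewOne M i j j0 i0 p q → at M′ p q ≡ 0ℤ)
    (at-other : ∀ p q → ¬ (p ≡ i × q ≡ j) → ¬ NewOne M i j j0 i0 p q → ¬ Involved M i j j0 i0 p q →
                at M′ p q ≡ at M p q)
    where

    open PrefixForm pf

    Iv : Fin n → Fin n → Set
    Iv = Involved M i j j0 i0

    Nw : Fin n → Fin n → Set
    Nw = NewOne M i j j0 i0

    j0<j : toℕ j0 ℕ.< toℕ j
    j0<j = proj₁ nw

    i<i0 : toℕ i ℕ.< toℕ i0
    i<i0 = proj₁ ns

    at-ij : at M i j ≡ -1ℤ
    at-ij = proj₁ rem

    no-−1-southwest : ∀ a b → toℕ i ℕ.≤ a → b ℕ.≤ toℕ j → ¬ (a ≡ toℕ i × b ≡ toℕ j) → entry M a b ≢ -1ℤ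
    no-−1-southwest a b ia bj ne e with index n a | index n b
    ... | outside p | _ = -1≢0 (trans (sym e) (entry-below M a b p))
    ... | inside _ | outside p = -1≢0 (trans (sym e) (entry-right M a b p))
    ... | inside p | inside q with proj₂ rem p q ia bj (trans (sym (entry-at M p q)) e)
    ...   | refl , refl = ne (refl , refl)

    iv-one : ∀ {a b} → Iv a b → at M a b ≡ 1ℤ
    iv-one ((o , _) , _) = o
    iv-maximal : ∀ {a b} → Iv a b → ∀ c d → at M c d ≡ 1ℤ → c Fin.≤ a → b Fin.≤ d → i Fin.≤ c → d Fin.≤ j →
        (c ≡ a × d ≡ b)
    iv-maximal ((_ , _ , _ , m) , _) = m
    iv-row≥i : ∀ {a b} → Iv a b → toℕ i ℕ.≤ toℕ a
    iv-row≥i (_ , x , _ , _ , _) = x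
    iv-row≤i0 : ∀ {a b} → Iv a b → toℕ a ℕ.≤ toℕ i0
    iv-row≤i0 (_ , _ , x , _ , _) = x
    iv-col≥j0 : ∀ {a b} → Iv a b → toℕ j0 ℕ.≤ toℕ b
    iv-col≥j0 (_ , _ , _ , x , _) = x
    iv-col≤j : ∀ {a b} → Iv a b → toℕ b ℕ.≤ toℕ j
    iv-col≤j (_ , _ , _ , _ , x) = x

    iv-antichain : ∀ {a b c d} → Iv a b → Iv c d → toℕ c ℕ.≤ toℕ a → toℕ b ℕ.≤ toℕ d → c ≡ a × d ≡ b
    iv-antichain {c = c} {d} ia ic p q = iv-maximal ia c d (iv-one ic) p q (iv-row≥i ic) (iv-col≤j ic)

    iv-same-row : ∀ {a b d} → Iv a b → Iv a d → b ≡ d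
    iv-same-row {a} {b} {d} x y with ℕₚ.≤-total (toℕ b) (toℕ d)
    ... | inj₁ p = sym (proj₂ (iv-antichain x y ℕₚ.≤-refl p))
    ... | inj₂ p = proj₂ (iv-antichain y x ℕₚ.≤-refl p)

    iv-same-col : ∀ {a b c} → Iv a b → Iv c b → a ≡ c
    iv-same-col {a} {b} {c} x y with ℕₚ.≤-total (toℕ a) (toℕ c)
    ... | inj₁ p = proj₁ (iv-antichain y x p ℕₚ.≤-refl)
    ... | inj₂ p = sym (proj₁ (iv-antichain x y p ℕₚ.≤-refl))

    iv-col<⇒row< : ∀ {a b c d} → Iv a b → Iv c d → toℕ b ℕ.< toℕ d → toℕ a ℕ.< toℕ c
    iv-col<⇒row< {a} {b} {c} {d} x y p with ℕₚ.<-≤-connex (toℕ a) (toℕ c)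
    ... | inj₁ q = q
    ... | inj₂ q = ⊥-elim (ℕₚ.<-irrefl (sym (cong toℕ (proj₂ (iv-antichain x y q (ℕₚ.<⇒≤ p))))) p)

    iv-west : Iv i j0
    iv-west = (proj₁ (proj₂ nw) , ℕₚ.≤-refl , ℕₚ.<⇒≤ j0<j , maximal) , ℕₚ.≤-refl , ℕₚ.<⇒≤ i<i0 , ℕₚ.≤-refl ,
        ℕₚ.<⇒≤ j0<j
      where
      maximal : ∀ c d → at M c d ≡ 1ℤ → c Fin.≤ i → j0 Fin.≤ d → i Fin.≤ c → d Fin.≤ j → (c ≡ i × d ≡ j0)
      maximal c d e ci jd ic dj with Finₚ.toℕ-injective (ℕₚ.≤-antisym ci ic)
      ... | refl with ℕₚ.m≤n⇒m<n∨m≡n jd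
      ...   | inj₂ q = refl , Finₚ.toℕ-injective (sym q)
      ...   | inj₁ q with ℕₚ.m≤n⇒m<n∨m≡n dj
      ...     | inj₁ r = ⊥-elim (proj₂ (proj₂ nw) d q r e)
      ...     | inj₂ r with Finₚ.toℕ-injective r
      ...       | refl = ⊥-elim (1≢-1 (trans (sym e) at-ij))

    iv-south : Iv i0 j
    iv-south = (proj₁ (proj₂ ns) , ℕₚ.<⇒≤ i<i0 , ℕₚ.≤-refl , maximal) , ℕₚ.<⇒≤ i<i0 , ℕₚ.≤-refl , ℕₚ.<⇒≤ j0<j ,
        ℕₚ.≤-refl
      where
      maximal : ∀ c d → at M c d ≡ 1ℤ → c Fin.≤ i0 → j Fin.≤ d → i Fin.≤ c → d Fin.≤ j → (c ≡ i0 × d ≡ j)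
      maximal c d e ci jd ic dj with Finₚ.toℕ-injective (ℕₚ.≤-antisym dj jd)
      ... | refl with ℕₚ.m≤n⇒m<n∨m≡n ci
      ...   | inj₂ q = Finₚ.toℕ-injective q , refl
      ...   | inj₁ q with ℕₚ.m≤n⇒m<n∨m≡n ic
      ...     | inj₁ r = ⊥-elim (proj₂ (proj₂ ns) c r q e)
      ...     | inj₂ r with Finₚ.toℕ-injective r
      ...       | refl = ⊥-elim (1≢-1 (trans (sym e) at-ij))

    iv? : ∀ a b → Dec (Iv a b)
    iv? a b = ((at M a b ℤₚ.≟ 1ℤ) ×-dec (i Finₚ.≤? a) ×-dec (b Finₚ.≤? j) ×-dec
                  Finₚ.all? (λ c → Finₚ.all? (λ d → (at M c d ℤₚ.≟ 1ℤ) →-dec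
                      ((c Finₚ.≤? a) →-dec ((b Finₚ.≤? d) →-dec
                    ((i Finₚ.≤? c) →-dec ((d Finₚ.≤? j) →-dec ((c Finₚ.≟ a) ×-dec (d Finₚ.≟ b))))))))) ×-dec
                (i Finₚ.≤? a) ×-dec (a Finₚ.≤? i0) ×-dec (j0 Finₚ.≤? b) ×-dec (b Finₚ.≤? j)

    nw-in-column : ∀ {p q} → Iv p q → toℕ q ℕ.< toℕ j → ∃[ p1 ] (Nw p1 q × toℕ p ℕ.< toℕ p1 × toℕ p1 ℕ.≤ toℕ i0)
    nw-in-column {p} {q} ivpq qj with least-Fin (λ d → (q Fin.< d) × ∃[ a ] Iv a d)
                                (λ d → (q Finₚ.<? d) ×-dec Finₚ.any? (λ a → iv? a d)) j (qj , i0 , iv-south)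
    ... | d , (qd , a , iva) , mn =
      a , ((p , ivpq) , (d , iva , qd , λ a' e iv qe ed → ℕₚ.<⇒≱ ed (mn e (qe , a' , iv)))) ,
      iv-col<⇒row< ivpq iva qd , iv-row≤i0 iva

    iv-col>j0 : ∀ {p q} → Iv p q → p ≢ i → toℕ j0 ℕ.< toℕ q
    iv-col>j0 {p} {q} ivpq pi with ℕₚ.m≤n⇒m<n∨m≡n (iv-col≥j0 ivpq)
    ... | inj₁ r = r
    ... | inj₂ r with Finₚ.toℕ-injective r
    ... | refl = ⊥-elim (pi (iv-same-col ivpq iv-west))

    nw-in-row : ∀ {p q} → Iv p q → p ≢ i → ∃[ q1 ] (Nw p q1 × toℕ q1 ℕ.< toℕ q)
    nw-in-row {p} {q} ivpq pi with greatest-Fin (λ e → (e Fin.< q) × ∃[ a ] Iv a e)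
                                (λ e → (e Finₚ.<? q) ×-dec Finₚ.any? (λ a → iv? a e)) j0
                                    (iv-col>j0 ivpq pi , i , iv-west)
    ... | e , (eq , a , iva) , maximal =
      e , ((a , iva) , (q , ivpq , eq , λ a' e' iv ee' e'q → ℕₚ.<⇒≱ ee' (maximal e' (e'q , a' , iv)))) , eq

    nw-involved-above : ∀ {p q} → Nw p q → ∃[ a ] (Iv a q × toℕ a ℕ.< toℕ p)
    nw-involved-above ((a , iva) , (d , ivd , qd , _)) = a , iva , iv-col<⇒row< iva ivd qd

    nw-involved-right : ∀ {p q} → Nw p q → ∃[ d ] (Iv p d × toℕ q ℕ.< toℕ d)
    nw-involved-right (_ , (d , ivd , qd , _)) = d , ivd , qd

    nw-same-col : ∀ {p p' q} → Nw p q → Nw p' q → p ≡ p'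
    nw-same-col ((a , iva) , (d , ivd , qd , md)) ((a' , iva') , (d' , ivd' , qd' , md'))
      with Finₚ.toℕ-injective {i = d} {j = d'} (ℕₚ.≤-antisym (ℕₚ.≮⇒≥ (md _ d' ivd' qd'))
          (ℕₚ.≮⇒≥ (md' _ d ivd qd)))
    ... | refl = iv-same-col ivd ivd'

    nw-same-row : ∀ {p q q'} → Nw p q → Nw p q' → q ≡ q'
    nw-same-row {p} {q} {q'} ((a , iva) , (d , ivd , qd , md)) ((a' , iva') , (d' , ivd' , qd' , md'))
      with iv-same-row ivd ivd'
    ... | refl with ℕₚ.<-cmp (toℕ q) (toℕ q')
    ... | tri< r _ _ = ⊥-elim (md a' q' iva' r qd')
    ... | tri≈ _ r _ = Finₚ.toℕ-injective r
    ... | tri> _ _ r = ⊥-elim (md' a q iva r qd)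

    entry-trit : ∀ a b → Trit (entry M a b)
    entry-trit a b = psum-bits⇒trit (entry M a) b (row-bits a b) (row-bits a (suc b))

    nw-was-0 : ∀ {p q} → Nw p q → at M p q ≡ 0ℤ
    nw-was-0 {p} {q} x with nw-involved-right x
    ... | d , ivd , qd with entry-trit (toℕ p) (toℕ q)
    ... | inj₁ e = trans (sym (entry-at M p q)) e
    ... | inj₂ (inj₂ e) = ⊥-elim (no-−1-southwest (toℕ p) (toℕ q) (iv-row≥i ivd)
        (ℕₚ.<⇒≤ (ℕₚ.<-≤-trans qd (iv-col≤j ivd)))
                           (λ (_ , r) → ℕₚ.<-irrefl r (ℕₚ.<-≤-trans qd (iv-col≤j ivd))) e)
    ... | inj₂ (inj₁ e) =
      ⊥-elim (1≢0 (trans (sym (bit-after-1 (row-bits (toℕ p) (toℕ q)) (row-bits (toℕ p) (suc (toℕ q))) e))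
          after-q))
      where
      before-d : psum (entry M (toℕ p)) (toℕ d) ≡ 0ℤ
      before-d = bit-before-1 (row-bits (toℕ p) (toℕ d)) (row-bits (toℕ p) (suc (toℕ d)))
                              (trans (entry-at M p d) (iv-one ivd))
      after-q : psum (entry M (toℕ p)) (suc (toℕ q)) ≡ 0ℤ
      after-q = psum-stays-0-backward (row-bits (toℕ p)) (suc (toℕ q)) (toℕ d) before-d
             (λ x u v → no-−1-southwest (toℕ p) x (iv-row≥i ivd) (ℕₚ.<⇒≤ (ℕₚ.<-≤-trans v (iv-col≤j ivd)))
                (λ (_ , r) → ℕₚ.<-irrefl r (ℕₚ.<-≤-trans v (iv-col≤j ivd)))) qd

    i≢i0 : i ≢ i0
    i≢i0 e = ℕₚ.<-irrefl (cong toℕ e) i<i0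

    j≢j0 : j ≢ j0
    j≢j0 e = ℕₚ.<-irrefl (sym (cong toℕ e)) j0<j

    toℕ-≢ : ∀ {a b : Fin n} → a ≢ b → toℕ a ≢ toℕ b
    toℕ-≢ ne e = ne (Finₚ.toℕ-injective e)

    no-nw-in-col-j : ∀ p → ¬ Nw p j
    no-nw-in-col-j p x with nw-involved-right x
    ... | d , ivd , jd = ℕₚ.<⇒≱ jd (iv-col≤j ivd)

    no-nw-in-row-i : ∀ q → ¬ Nw i q
    no-nw-in-row-i q x with nw-involved-above x
    ... | a , iva , ai = ℕₚ.<⇒≱ ai (iv-row≥i iva)

    col-j-change : ∀ p → at M′ p j ≡ at M p j + (δ (toℕ i) (toℕ p) - δ (toℕ i0) (toℕ p))
    col-j-change p with p Finₚ.≟ i | p Finₚ.≟ i0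
    ... | yes refl | _ rewrite at-removed i j (refl , refl) | at-ij | δ-refl (toℕ i) | δ-≢ (toℕ-≢ i≢i0) = refl
    ... | no _ | yes refl rewrite at-involved i0 j iv-south (no-nw-in-col-j i0) | iv-one iv-south
                                | δ-refl (toℕ i0) | δ-≢ (toℕ-≢ (λ e → i≢i0 (sym e))) = refl
    ... | no a | no b rewrite δ-≢ (toℕ-≢ a) | δ-≢ (toℕ-≢ b) =
      trans (at-other p j (λ (e , _) → a e) (no-nw-in-col-j p) (λ iv → b (iv-same-col iv iv-south)))
          (sym (ℤₚ.+-identityʳ _))

    involved-col-change : ∀ {p0 p1 q} → Iv p0 q → q ≢ j → Nw p1 q → toℕ p0 ℕ.< toℕ p1 →
                    ∀ p → at M′ p q ≡ at M p q + (δ (toℕ p1) (toℕ p) - δ (toℕ p0) (toℕ p))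
    involved-col-change {p0} {p1} {q} iv qj nwq p<p′ p with p Finₚ.≟ p0 | p Finₚ.≟ p1
    ... | yes refl | _ rewrite at-involved p0 q iv (λ x → ℕₚ.<-irrefl (cong toℕ (nw-same-col x nwq)) p<p′)
                             | iv-one iv | δ-refl (toℕ p0) | δ-≢ {toℕ p1} {toℕ p0}
                                 (λ e → ℕₚ.<-irrefl e p<p′) = refl
    ... | no _ | yes refl rewrite at-new p1 q nwq | nw-was-0 nwq | δ-refl (toℕ p1)
                                | δ-≢ {toℕ p0} {toℕ p1} (λ e → ℕₚ.<-irrefl (sym e) p<p′) = refl
    ... | no a | no b rewrite δ-≢ (toℕ-≢ a) | δ-≢ (toℕ-≢ b) =
      trans (at-other p q (λ (_ , e) → qj e) (λ x → b (nw-same-col x nwq)) (λ x → a (iv-same-col x iv)))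
          (sym (ℤₚ.+-identityʳ _))

    uninvolved-col-unchanged : ∀ {q} → (∀ a → ¬ Iv a q) → ∀ p → at M′ p q ≡ at M p q
    uninvolved-col-unchanged {q} nn p = at-other p q (λ { (_ , refl) → nn i0 iv-south })
        (λ x → nn _ (proj₁ (proj₂ (nw-involved-above x)))) (nn p)

    row-i-change : ∀ q → at M′ i q ≡ at M i q + (δ (toℕ j) (toℕ q) - δ (toℕ j0) (toℕ q))
    row-i-change q with q Finₚ.≟ j | q Finₚ.≟ j0
    ... | yes refl | _ rewrite at-removed i j (refl , refl) | at-ij | δ-refl (toℕ j) | δ-≢ (toℕ-≢ j≢j0) = refl
    ... | no _ | yes refl rewrite at-involved i j0 iv-west (no-nw-in-row-i j0) | iv-one iv-west
                                | δ-refl (toℕ j0) | δ-≢ (toℕ-≢ (λ e → j≢j0 (sym e))) = refl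
    ... | no a | no b rewrite δ-≢ (toℕ-≢ a) | δ-≢ (toℕ-≢ b) =
      trans (at-other i q (λ (_ , e) → a e) (no-nw-in-row-i q) (λ iv → b (sym (iv-same-row iv-west iv))))
          (sym (ℤₚ.+-identityʳ _))

    involved-row-change : ∀ {p q0 q1} → Iv p q0 → p ≢ i → Nw p q1 → toℕ q1 ℕ.< toℕ q0 →
                    ∀ q → at M′ p q ≡ at M p q + (δ (toℕ q1) (toℕ q) - δ (toℕ q0) (toℕ q))
    involved-row-change {p} {q0} {q1} iv pi nwp p<p′ q with q Finₚ.≟ q0 | q Finₚ.≟ q1
    ... | yes refl | _ rewrite at-involved p q0 iv (λ x → ℕₚ.<-irrefl (cong toℕ (nw-same-row nwp x)) p<p′)
                             | iv-one iv | δ-refl (toℕ q0) | δ-≢ {toℕ q1} {toℕ q0}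
                                 (λ e → ℕₚ.<-irrefl (sym e) p<p′) = refl
    ... | no _ | yes refl rewrite at-new p q1 nwp | nw-was-0 nwp | δ-refl (toℕ q1)
                                | δ-≢ {toℕ q0} {toℕ q1} (λ e → ℕₚ.<-irrefl e p<p′) = refl
    ... | no a | no b rewrite δ-≢ (toℕ-≢ a) | δ-≢ (toℕ-≢ b) =
      trans (at-other p q (λ (e , _) → pi e) (λ x → b (nw-same-row x nwp)) (λ x → a (iv-same-row x iv)))
          (sym (ℤₚ.+-identityʳ _))

    uninvolved-row-unchanged : ∀ {p} → (∀ b → ¬ Iv p b) → ∀ q → at M′ p q ≡ at M p q
    uninvolved-row-unchanged {p} nn q = at-other p q (λ { (refl , _) → nn j0 iv-west })
        (λ x → nn _ (proj₁ (proj₂ (nw-involved-right x)))) (nn q)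

    outside-≢ : ∀ {a} (x : Fin n) → n ℕ.≤ a → a ≢ toℕ x
    outside-≢ x n≤a refl = ℕₚ.<⇒≱ (Finₚ.toℕ<n x) n≤a

    shift-outside : ∀ (u w : Fin n) a → n ℕ.≤ a → shift (toℕ u) (toℕ w) a ≡ 0ℤ
    shift-outside u w a n≤a rewrite δ-≢ (outside-≢ u n≤a) | δ-≢ (outside-≢ w n≤a) = refl

    entry-col-change : ∀ (q : Fin n) (g : ℕ → ℤ) → (∀ p → at M′ p q ≡ at M p q + g (toℕ p)) →
                       (∀ a → n ℕ.≤ a → g a ≡ 0ℤ) → ∀ a → entry M′ a (toℕ q) ≡ entry M a (toℕ q) + g a
    entry-col-change q g h out a with index n a
    ... | inside p = trans (entry-at M′ p q) (trans (h p) (cong (_+ g (toℕ p)) (sym (entry-at M p q))))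
    ... | outside p rewrite entry-below M′ a (toℕ q) p | entry-below M a (toℕ q) p | out a p = refl

    entry-row-change : ∀ (p : Fin n) (g : ℕ → ℤ) → (∀ q → at M′ p q ≡ at M p q + g (toℕ q)) →
                       (∀ a → n ℕ.≤ a → g a ≡ 0ℤ) → ∀ a → entry M′ (toℕ p) a ≡ entry M (toℕ p) a + g a
    entry-row-change p g h out a with index n a
    ... | inside q = trans (entry-at M′ p q) (trans (h q) (cong (_+ g (toℕ q)) (sym (entry-at M p q))))
    ... | outside q rewrite entry-right M′ (toℕ p) a q | entry-right M (toℕ p) a q | out a q = refl

    col-psum-change : ∀ (q u w : Fin n) → (∀ p → at M′ p q ≡ at M p q + shift (toℕ u) (toℕ w) (toℕ p)) →
                      ∀ k → psum (λ a → entry M′ a (toℕ q)) k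
                            ≡ psum (λ a → entry M a (toℕ q)) k + (θ (toℕ u) k - θ (toℕ w) k)
    col-psum-change q u w h k =
      trans (psum-cong k (λ a _ → entry-col-change q (shift (toℕ u) (toℕ w)) h (shift-outside u w) a))
            (trans (psum-+ (λ a → entry M a (toℕ q)) (shift (toℕ u) (toℕ w)) k)
                   (cong (λ z → psum (λ a → entry M a (toℕ q)) k + z) (psum-shift (toℕ u) (toℕ w) k)))

    row-psum-change : ∀ (p u w : Fin n) → (∀ q → at M′ p q ≡ at M p q + shift (toℕ u) (toℕ w) (toℕ q)) →
                      ∀ k → psum (entry M′ (toℕ p)) k ≡ psum (entry M (toℕ p)) k + (θ (toℕ u) k - θ (toℕ w) k)
    row-psum-change p u w h k =
      trans (psum-cong k (λ a _ → entry-row-change p (shift (toℕ u) (toℕ w)) h (shift-outside u w) a))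
            (trans (psum-+ (entry M (toℕ p)) (shift (toℕ u) (toℕ w)) k)
                   (cong (λ z → psum (entry M (toℕ p)) k + z) (psum-shift (toℕ u) (toℕ w) k)))

    col-psum-unchanged : ∀ (q : Fin n) → (∀ p → at M′ p q ≡ at M p q) →
                         ∀ k → psum (λ a → entry M′ a (toℕ q)) k ≡ psum (λ a → entry M a (toℕ q)) k
    col-psum-unchanged q h k = psum-cong k (λ a _ → trans
        (entry-col-change q (λ _ → 0ℤ) (λ p → trans (h p) (sym (ℤₚ.+-identityʳ _))) (λ _ _ → refl) a)
        (ℤₚ.+-identityʳ _))

    row-psum-unchanged : ∀ (p : Fin n) → (∀ q → at M′ p q ≡ at M p q) →
                         ∀ k → psum (entry M′ (toℕ p)) k ≡ psum (entry M (toℕ p)) k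
    row-psum-unchanged p h k = psum-cong k (λ a _ → trans
        (entry-row-change p (λ _ → 0ℤ) (λ q → trans (h q) (sym (ℤₚ.+-identityʳ _))) (λ _ _ → refl) a)
        (ℤₚ.+-identityʳ _))

    shift-total : ∀ (s : ℤ) (u w : Fin n) → s + (θ (toℕ u) n - θ (toℕ w) n) ≡ s
    shift-total s u w rewrite θ-< (Finₚ.toℕ<n u) | θ-< (Finₚ.toℕ<n w) = ℤₚ.+-identityʳ s

    col-j-no-1 : ∀ x → toℕ i ℕ.< x → x ℕ.< toℕ i0 → entry M x (toℕ j) ≢ 1ℤ
    col-j-no-1 x ix xi0 e with index n x
    ... | inside p = proj₂ (proj₂ ns) p ix xi0 (trans (sym (entry-at M p j)) e)
    ... | outside p = 1≢0 (trans (sym e) (entry-below M x (toℕ j) p))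

    col-j-psum-0 : ∀ k → toℕ i ℕ.< k → k ℕ.≤ toℕ i0 → psum (λ a → entry M a (toℕ j)) k ≡ 0ℤ
    col-j-psum-0 k ik ki0 = psum-stays-0 (col-bits (toℕ j)) (suc (toℕ i)) k after-i
      (λ x ix xk → col-j-no-1 x ix (ℕₚ.<-≤-trans xk ki0)) ik
      where
      after-i : psum (λ a → entry M a (toℕ j)) (suc (toℕ i)) ≡ 0ℤ
      after-i = bit-after-−1 (col-bits (toℕ j) (toℕ i)) (col-bits (toℕ j) (suc (toℕ i)))
          (trans (entry-at M i j) at-ij)

    involved-col-psum-1 : ∀ {p0 q} → Iv p0 q → q ≢ j → ∀ k → toℕ p0 ℕ.< k → psum
        (λ a → entry M a (toℕ q)) k ≡ 1ℤ
    involved-col-psum-1 {p0} {q} iv qj k pk = psum-stays-1 (col-bits (toℕ q)) (suc (toℕ p0)) k s1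
        (λ x u v → no-−1-southwest x (toℕ q) (ℕₚ.≤-trans (iv-row≥i iv) (ℕₚ.<⇒≤ u)) (iv-col≤j iv)
            (λ (_ , e) → qj (Finₚ.toℕ-injective e))) pk
      where
      f = λ a → entry M a (toℕ q)
      s1 : psum f (suc (toℕ p0)) ≡ 1ℤ
      s1 = bit-after-1 (col-bits (toℕ q) (toℕ p0)) (col-bits (toℕ q) (suc (toℕ p0)))
          (trans (entry-at M p0 q) (iv-one iv))

    row-i-psum-1 : ∀ k → toℕ j0 ℕ.< k → k ℕ.≤ toℕ j → psum (entry M (toℕ i)) k ≡ 1ℤ
    row-i-psum-1 k jk kj = psum-stays-1 (row-bits (toℕ i)) (suc (toℕ j0)) k s1
        (λ x u v → no-−1-southwest (toℕ i) x ℕₚ.≤-refl (ℕₚ.<⇒≤ (ℕₚ.<-≤-trans v kj))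
            (λ (_ , e) → ℕₚ.<-irrefl e (ℕₚ.<-≤-trans v kj))) jk
      where
      f = entry M (toℕ i)
      s1 : psum f (suc (toℕ j0)) ≡ 1ℤ
      s1 = bit-after-1 (row-bits (toℕ i) (toℕ j0)) (row-bits (toℕ i) (suc (toℕ j0)))
          (trans (entry-at M i j0) (proj₁ (proj₂ nw)))

    involved-row-psum-0 : ∀ {p q0} → Iv p q0 → ∀ k → k ℕ.≤ toℕ q0 → psum (entry M (toℕ p)) k ≡ 0ℤ
    involved-row-psum-0 {p} {q0} iv k kq = psum-stays-0-backward (row-bits (toℕ p)) k (toℕ q0) s1
        (λ x u v → no-−1-southwest (toℕ p) x (iv-row≥i iv) (ℕₚ.<⇒≤ (ℕₚ.<-≤-trans v (iv-col≤j iv)))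
            (λ (_ , e) → ℕₚ.<-irrefl e (ℕₚ.<-≤-trans v (iv-col≤j iv)))) kq
      where
      f = entry M (toℕ p)
      s1 : psum f (toℕ q0) ≡ 0ℤ
      s1 = bit-before-1 (row-bits (toℕ p) (toℕ q0)) (row-bits (toℕ p) (suc (toℕ q0)))
          (trans (entry-at M p q0) (iv-one iv))

    iv-col<j : ∀ {p0 q} → Iv p0 q → q ≢ j → toℕ q ℕ.< toℕ j
    iv-col<j iv qj = ℕₚ.≤∧≢⇒< (iv-col≤j iv) (toℕ-≢ qj)

    data ColumnChange (q : Fin n) : Set where
      col-j : q ≡ j → ColumnChange q
      col-unchanged : (∀ p → at M′ p q ≡ at M p q) → ColumnChange q
      col-moved : ∀ p0 p1 → Iv p0 q → q ≢ j → Nw p1 q → toℕ p0 ℕ.< toℕ p1 → toℕ p1 ℕ.≤ toℕ i0 → ColumnChange q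

    column-change : ∀ q → ColumnChange q
    column-change q with q Finₚ.≟ j
    ... | yes e = col-j e
    ... | no qj with Finₚ.any? (λ a → iv? a q)
    ...   | no nn = col-unchanged (uninvolved-col-unchanged (λ a iv → nn (a , iv)))
    ...   | yes (p0 , iv) with nw-in-column iv (iv-col<j iv qj)
    ...     | p1 , nwq , p<p′ , le = col-moved p0 p1 iv qj nwq p<p′ le

    data RowChange (p : Fin n) : Set where
      row-i : p ≡ i → RowChange p
      row-unchanged : (∀ q → at M′ p q ≡ at M p q) → RowChange p
      row-moved : ∀ q0 q1 → Iv p q0 → p ≢ i → Nw p q1 → toℕ q1 ℕ.< toℕ q0 → RowChange p

    row-change : ∀ p → RowChange p
    row-change p with p Finₚ.≟ i
    ... | yes e = row-i e
    ... | no pi with Finₚ.any? (λ b → iv? p b)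
    ...   | no nn = row-unchanged (uninvolved-row-unchanged (λ b iv → nn (b , iv)))
    ...   | yes (q0 , iv) with nw-in-row iv pi
    ...     | q1 , nwp , p<p′ = row-moved q0 q1 iv pi nwp p<p′

    col-bits′ : ∀ q → PrefixBits (λ a → entry M′ a (toℕ q))
    col-bits′ q k with column-change q
    ... | col-j refl = subst Bit (sym (col-psum-change j i i0 col-j-change k))
                      (bits-raise-zeros (λ a → entry M a (toℕ j)) (toℕ i) (toℕ i0) i<i0 (col-bits (toℕ j))
                          col-j-psum-0 k)
    ... | col-unchanged h = subst Bit (sym (col-psum-unchanged q h k)) (col-bits (toℕ q) k)
    ... | col-moved p0 p1 iv qj nwq p<p′ le =
      subst Bit (sym (col-psum-change q p1 p0 (involved-col-change iv qj nwq p<p′) k))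
        (bits-lower-ones (λ a → entry M a (toℕ q)) (toℕ p1) (toℕ p0) p<p′ (col-bits (toℕ q))
            (λ k a _ → involved-col-psum-1 iv qj k a) k)

    row-bits′ : ∀ p → PrefixBits (entry M′ (toℕ p))
    row-bits′ p k with row-change p
    ... | row-i refl = subst Bit (sym (row-psum-change i j j0 row-i-change k))
                      (bits-lower-ones (entry M (toℕ i)) (toℕ j) (toℕ j0) j0<j (row-bits (toℕ i))
                          row-i-psum-1 k)
    ... | row-unchanged h = subst Bit (sym (row-psum-unchanged p h k)) (row-bits (toℕ p) k)
    ... | row-moved q0 q1 iv pi nwp p<p′ =
      subst Bit (sym (row-psum-change p q1 q0 (involved-row-change iv pi nwp p<p′) k))
        (bits-raise-zeros (entry M (toℕ p)) (toℕ q1) (toℕ q0) p<p′ (row-bits (toℕ p))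
            (λ k _ b → involved-row-psum-0 iv k b) k)

    col-total′ : ∀ q → psum (λ a → entry M′ a (toℕ q)) n ≡ 1ℤ
    col-total′ q with column-change q
    ... | col-j refl = trans (col-psum-change j i i0 col-j-change n)
                     (trans (shift-total _ i i0) (col-total (toℕ j) (Finₚ.toℕ<n j)))
    ... | col-unchanged h = trans (col-psum-unchanged q h n) (col-total (toℕ q) (Finₚ.toℕ<n q))
    ... | col-moved p0 p1 iv qj nwq p<p′ le = trans (col-psum-change q p1 p0
        (involved-col-change iv qj nwq p<p′) n)
                     (trans (shift-total _ p1 p0) (col-total (toℕ q) (Finₚ.toℕ<n q)))

    row-total′ : ∀ p → psum (entry M′ (toℕ p)) n ≡ 1ℤ
    row-total′ p with row-change p
    ... | row-i refl = trans (row-psum-change i j j0 row-i-change n)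
                     (trans (shift-total _ j j0) (row-total (toℕ i) (Finₚ.toℕ<n i)))
    ... | row-unchanged h = trans (row-psum-unchanged p h n) (row-total (toℕ p) (Finₚ.toℕ<n p))
    ... | row-moved q0 q1 iv pi nwp p<p′ = trans (row-psum-change p q1 q0
        (involved-row-change iv pi nwp p<p′) n)
                     (trans (shift-total _ q1 q0) (row-total (toℕ p) (Finₚ.toℕ<n p)))

    prefixForm′ : PrefixForm M′
    prefixForm′ = record { col-bits = cB ; row-bits = rB ; col-total = cT ; row-total = rT }
      where
      cB : ∀ c → PrefixBits (λ a → entry M′ a c)
      cB c with index n c
      ... | inside q = col-bits′ q
      ... | outside p = zero-bits (λ a → entry-right M′ a c p)
      rB : ∀ b → PrefixBits (entry M′ b)
      rB b with index n b
      ... | inside p = row-bits′ p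
      ... | outside p = zero-bits (λ a → entry-below M′ b a p)
      cT : ∀ c → c ℕ.< n → psum (λ a → entry M′ a c) n ≡ 1ℤ
      cT c c<n with index n c
      ... | inside q = col-total′ q
      ... | outside p = ⊥-elim (ℕₚ.<⇒≱ c<n p)
      rT : ∀ b → b ℕ.< n → psum (entry M′ b) n ≡ 1ℤ
      rT b b<n with index n b
      ... | inside p = row-total′ p
      ... | outside p = ⊥-elim (ℕₚ.<⇒≱ b<n p)

    col-j-stays-1 : ∀ k → psum (λ a → entry M a (toℕ j)) k ≡ 1ℤ → psum (λ a → entry M′ a (toℕ j)) k ≡ 1ℤ
    col-j-stays-1 k e with θ-view (toℕ i) k | θ-view (toℕ i0) k | col-psum-change j i i0 col-j-change k
    ... | inj₁ (_ , e₁) | inj₁ (_ , e₂) | change rewrite e₁ | e₂ = trans change (trans (ℤₚ.+-identityʳ _) e)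
    ... | inj₂ (_ , e₁) | inj₂ (_ , e₂) | change rewrite e₁ | e₂ = trans change (trans (ℤₚ.+-identityʳ _) e)
    ... | inj₂ (k≤i , _) | inj₁ (i0<k , _) | _ = ⊥-elim (ℕₚ.<-asym i<i0 (ℕₚ.<-≤-trans i0<k k≤i))
    ... | inj₁ (_ , e₁) | inj₂ (_ , e₂) | change rewrite e₁ | e₂ | e =
      ⊥-elim ([ 1+1≢0 , 1+1≢1 ]′ (subst Bit change (col-bits′ j k)))

    col-j-gains-1 : ∀ k → toℕ i ℕ.< k → k ℕ.≤ toℕ i0 → psum (λ a → entry M′ a (toℕ j)) k ≡ 1ℤ
    col-j-gains-1 k i<k k≤i0 = trans change′ (bit-after-1 (col-bits (toℕ j) k)
        (subst Bit change′ (col-bits′ j k)) refl)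
      where
      change′ : psum (λ a → entry M′ a (toℕ j)) k ≡ psum (λ a → entry M a (toℕ j)) k + 1ℤ
      change′ = trans (col-psum-change j i i0 col-j-change k)
                      (cong (λ z → psum (λ a → entry M a (toℕ j)) k + z) (cong₂ _-_ (θ-< i<k) (θ-≥ k≤i0)))

    -- A 1 leaving the first r + 1 rows of an involved column q < j moves from
    -- row p₀ ≥ i to row p₁ ≤ i0, so column j gains a 1 in these rows.
    offBand-col : ∀ r (q : Fin n) → suc (suc r) ℕ.≤ toℕ q → psum (λ a → entry M a (toℕ q)) (suc r) ≡ 1ℤ →
                  OffBand M′ r
    offBand-col r q r+2≤q e with column-change q
    ... | col-j refl = toℕ j , r+2≤q , Finₚ.toℕ<n j , col-j-stays-1 (suc r) e
    ... | col-unchanged h = toℕ q , r+2≤q , Finₚ.toℕ<n q , trans (col-psum-unchanged q h (suc r)) e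
    ... | col-moved p₀ p₁ iv q≢j nw p₀<p₁ p₁≤i0
      with θ-view (toℕ p₁) (suc r) | θ-view (toℕ p₀) (suc r) | col-psum-change q p₁ p₀
          (involved-col-change iv q≢j nw p₀<p₁) (suc r)
    ...   | inj₁ (_ , e₁) | inj₁ (_ , e₂) | change rewrite e₁ | e₂ =
      toℕ q , r+2≤q , Finₚ.toℕ<n q , trans change (trans (ℤₚ.+-identityʳ _) e)
    ...   | inj₂ (_ , e₁) | inj₂ (_ , e₂) | change rewrite e₁ | e₂ =
      toℕ q , r+2≤q , Finₚ.toℕ<n q , trans change (trans (ℤₚ.+-identityʳ _) e)
    ...   | inj₁ (p₁≤r , _) | inj₂ (r<p₀ , _) | _ = ⊥-elim (ℕₚ.<-asym p₀<p₁ (ℕₚ.<-≤-trans p₁≤r r<p₀))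
    ...   | inj₂ (r<p₁ , _) | inj₁ (p₀≤r , _) | _ =
      toℕ j , ℕₚ.≤-trans r+2≤q (ℕₚ.<⇒≤ (iv-col<j iv q≢j)) , Finₚ.toℕ<n j ,
      col-j-gains-1 (suc r) (ℕₚ.≤-<-trans (iv-row≥i iv) p₀≤r) (ℕₚ.≤-trans r<p₁ p₁≤i0)

    offBand′ : ∀ r → OffBand M r → OffBand M′ r
    offBand′ r (c , rc , c<n , e) with index n c
    ... | inside q = offBand-col r q rc e
    ... | outside p = ⊥-elim (ℕₚ.<⇒≱ c<n p)

  step-preserves : ∀ {n} {M M′ : Matrix n} → Step M M′ → PrefixForm M → ∀ r →
                   OffBand M r → PrefixForm M′ × OffBand M′ r
  step-preserves {M = M} {M′} (i , j , j0 , i0 , rem , nw , ns , removed , new , involved , other) pf r off =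
    prefixForm′ , offBand′ r off
    where open RemovalStep M M′ pf i j j0 i0 rem nw ns removed new involved other

  steps-preserve : ∀ {n} {M K : Matrix n} → Star StepRel M K → PrefixForm M → ∀ r →
                   OffBand M r → PrefixForm K × OffBand K r
  steps-preserve ε pf r off = pf , off
  steps-preserve (s ◅ ss) pf r off =
    let (pf′ , off′) = step-preserves s pf r off in steps-preserve ss pf′ r off′

module CountedAreBand where

  open import Data.Nat as ℕ using (ℕ; zero; suc; s≤s)
  import Data.Nat.Properties as ℕₚ
  open import Data.Integer as ℤ using (ℤ; 0ℤ; 1ℤ; -1ℤ; +_; _+_)
  import Data.Integer.Properties as ℤₚ
  open import Data.Integer.Tactic.RingSolver using (solve-∀)
  open import Data.Fin as Fin using (Fin; toℕ)
  import Data.Fin.Properties as Finₚ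
  open import Data.Vec using (lookup)
  open import Data.Empty using (⊥; ⊥-elim)
  open import Data.Sum using (_⊎_; inj₁; inj₂; [_,_]′)
  open import Data.Product using (∃-syntax; _×_; _,_)
  open import Relation.Nullary using (¬_)
  open import Relation.Nullary.Decidable using (decidable-stable)
  open import Relation.Binary.PropositionalEquality
  open import Relation.Binary.Definitions using (tri<; tri≈; tri>)
  open import Function.Bundles using (_⇔_; mk⇔)
  open import Defs
  open PrefixSums
  open PrefixSumForm
  open KeyInvariant

  module Occurrence {n : ℕ} (K : Matrix n) (r0 r1 r2 c0 c1 c2 : Fin n)
    (o01 : toℕ r0 ℕ.< toℕ r1) (o12 : toℕ r1 ℕ.< toℕ r2)
    (e0 : at K r0 c0 ≡ 1ℤ) (e1 : at K r1 c1 ≡ 1ℤ) (e2 : at K r2 c2 ≡ 1ℤ)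
    (l10 : toℕ c1 ℕ.< toℕ c0) (l20 : toℕ c2 ℕ.< toℕ c0) where

    rr : Fin 3 → Fin n
    rr Fin.zero = r0
    rr (Fin.suc Fin.zero) = r1
    rr (Fin.suc (Fin.suc Fin.zero)) = r2

    cc : Fin 3 → Fin n
    cc Fin.zero = c0
    cc (Fin.suc Fin.zero) = c1
    cc (Fin.suc (Fin.suc Fin.zero)) = c2

    rows : ∀ a b → a Fin.< b → rr a Fin.< rr b
    rows Fin.zero (Fin.suc Fin.zero) _ = o01
    rows Fin.zero (Fin.suc (Fin.suc Fin.zero)) _ = ℕₚ.<-trans o01 o12
    rows (Fin.suc Fin.zero) (Fin.suc (Fin.suc Fin.zero)) _ = o12
    rows Fin.zero Fin.zero ()
    rows (Fin.suc Fin.zero) Fin.zero ()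
    rows (Fin.suc Fin.zero) (Fin.suc Fin.zero) (s≤s ())
    rows (Fin.suc (Fin.suc Fin.zero)) Fin.zero ()
    rows (Fin.suc (Fin.suc Fin.zero)) (Fin.suc Fin.zero) (s≤s ())
    rows (Fin.suc (Fin.suc Fin.zero)) (Fin.suc (Fin.suc Fin.zero)) (s≤s (s≤s ()))

    ents : ∀ a → at K (rr a) (cc a) ≡ 1ℤ
    ents Fin.zero = e0
    ents (Fin.suc Fin.zero) = e1
    ents (Fin.suc (Fin.suc Fin.zero)) = e2

    irrefl : ∀ {x} → ¬ (x ℕ.< x)
    irrefl = ℕₚ.<-irrefl refl

    both-false : ∀ {A B : Set} → ¬ A → ¬ B → A ⇔ B
    both-false na nb = mk⇔ (λ a → ⊥-elim (na a)) (λ b → ⊥-elim (nb b))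

    both-true : ∀ {A B : Set} → A → B → A ⇔ B
    both-true a b = mk⇔ (λ _ → b) (λ _ → a)

    asym : ∀ {x y} → x ℕ.< y → ¬ (y ℕ.< x)
    asym p q = ℕₚ.<-asym p q

    contains-312 : toℕ c1 ℕ.< toℕ c2 → Contains K p312
    contains-312 l12 = rr , cc , rows , ents , cmp
      where
      cmp : ∀ a b → (cc a Fin.< cc b) ⇔ (lookup p312 a ℕ.< lookup p312 b)
      cmp Fin.zero Fin.zero = both-false irrefl irrefl
      cmp Fin.zero (Fin.suc Fin.zero) = both-false (asym l10) (λ { (s≤s ()) })
      cmp Fin.zero (Fin.suc (Fin.suc Fin.zero)) = both-false (asym l20) (λ { (s≤s (s≤s ())) })
      cmp (Fin.suc Fin.zero) Fin.zero = both-true l10 (s≤s (s≤s ℕ.z≤n))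
      cmp (Fin.suc Fin.zero) (Fin.suc Fin.zero) = both-false irrefl irrefl
      cmp (Fin.suc Fin.zero) (Fin.suc (Fin.suc Fin.zero)) = both-true l12 (s≤s (s≤s ℕ.z≤n))
      cmp (Fin.suc (Fin.suc Fin.zero)) Fin.zero = both-true l20 (s≤s (s≤s (s≤s ℕ.z≤n)))
      cmp (Fin.suc (Fin.suc Fin.zero)) (Fin.suc Fin.zero) = both-false (asym l12) (λ { (s≤s ()) })
      cmp (Fin.suc (Fin.suc Fin.zero)) (Fin.suc (Fin.suc Fin.zero)) = both-false irrefl irrefl

    contains-321 : toℕ c2 ℕ.< toℕ c1 → Contains K p321
    contains-321 l21 = rr , cc , rows , ents , cmp
      where
      cmp : ∀ a b → (cc a Fin.< cc b) ⇔ (lookup p321 a ℕ.< lookup p321 b)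
      cmp Fin.zero Fin.zero = both-false irrefl irrefl
      cmp Fin.zero (Fin.suc Fin.zero) = both-false (asym l10) (λ { (s≤s (s≤s ())) })
      cmp Fin.zero (Fin.suc (Fin.suc Fin.zero)) = both-false (asym l20) (λ { (s≤s ()) })
      cmp (Fin.suc Fin.zero) Fin.zero = both-true l10 (s≤s (s≤s (s≤s ℕ.z≤n)))
      cmp (Fin.suc Fin.zero) (Fin.suc Fin.zero) = both-false irrefl irrefl
      cmp (Fin.suc Fin.zero) (Fin.suc (Fin.suc Fin.zero)) = both-false (asym l21) (λ { (s≤s ()) })
      cmp (Fin.suc (Fin.suc Fin.zero)) Fin.zero = both-true l20 (s≤s (s≤s ℕ.z≤n))
      cmp (Fin.suc (Fin.suc Fin.zero)) (Fin.suc Fin.zero) = both-true l21 (s≤s (s≤s ℕ.z≤n))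
      cmp (Fin.suc (Fin.suc Fin.zero)) (Fin.suc (Fin.suc Fin.zero)) = both-false irrefl irrefl

  module PermutationMatrix {n : ℕ} (K : Matrix n) (pf : PrefixForm K) (no-−1 : ∀ i j → at K i j ≢ -1ℤ) where
    open PrefixForm pf

    entry-bit : ∀ a b → Bit (entry K a b)
    entry-bit a b with index n a | index n b
    ... | outside p | _ = inj₁ (entry-below K a b p)
    ... | inside _ | outside p = inj₁ (entry-right K a b p)
    ... | inside i | inside j with psum-bits⇒trit (entry K a) b (row-bits a b) (row-bits a (suc b))
    ...   | inj₁ e = inj₁ e
    ...   | inj₂ (inj₁ e) = inj₂ e
    ...   | inj₂ (inj₂ e) = ⊥-elim (no-−1 i j (trans (sym (entry-at K i j)) e))

    two-ones-in-column : ∀ {b₁ b₂ c} → b₁ ℕ.< b₂ → entry K b₁ c ≡ 1ℤ → entry K b₂ c ≡ 1ℤ → ⊥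
    two-ones-in-column {b₁} {b₂} {c} b₁<b₂ e₁ e₂ =
      [ 1+1≢0 , 1+1≢1 ]′ (subst Bit (cong₂ _+_ before-b₂ e₂) (col-bits c (suc b₂)))
      where
      before-b₂ : psum (λ a → entry K a c) b₂ ≡ 1ℤ
      before-b₂ = psum-stays-1 (col-bits c) (suc b₁) b₂ (bit-after-1 (col-bits c b₁) (col-bits c (suc b₁)) e₁)
                    (λ a _ _ → bit≢-1 (entry-bit a c)) b₁<b₂

    at-one : ∀ {i j} → entry K (toℕ i) (toℕ j) ≡ 1ℤ → at K i j ≡ 1ℤ
    at-one {i} {j} e = trans (sym (entry-at K i j)) e

    three-ones⇒pattern : ∀ {a b₁ b₂ c₀ c₁ c₂} → a ℕ.< b₁ → b₁ ℕ.< b₂ → c₁ ℕ.< c₀ → c₂ ℕ.< c₀ →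
                         entry K a c₀ ≡ 1ℤ → entry K b₁ c₁ ≡ 1ℤ → entry K b₂ c₂ ≡ 1ℤ →
                         Contains K p312 ⊎ Contains K p321
    three-ones⇒pattern {a} {b₁} {b₂} {c₀} {c₁} {c₂} a<b₁ b₁<b₂ c₁<c₀ c₂<c₀ e₀ e₁ e₂
      with index n a | index n b₁ | index n b₂ | index n c₀ | index n c₁ | index n c₂
    ... | inside r₀ | inside r₁ | inside r₂ | inside k₀ | inside k₁ | inside k₂ with ℕₚ.<-cmp (toℕ k₁) (toℕ k₂)
    ...   | tri< k₁<k₂ _ _ = inj₁ (O.contains-312 k₁<k₂)
      where module O = Occurrence K r₀ r₁ r₂ k₀ k₁ k₂ a<b₁ b₁<b₂ (at-one e₀) (at-one e₁) (at-one e₂) c₁<c₀ c₂<c₀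
    ...   | tri> _ _ k₂<k₁ = inj₂ (O.contains-321 k₂<k₁)
      where module O = Occurrence K r₀ r₁ r₂ k₀ k₁ k₂ a<b₁ b₁<b₂ (at-one e₀) (at-one e₁) (at-one e₂) c₁<c₀ c₂<c₀
    ...   | tri≈ _ k₁≡k₂ _ = ⊥-elim (two-ones-in-column b₁<b₂ e₁
        (subst (λ c → entry K _ c ≡ 1ℤ) (sym k₁≡k₂) e₂))
    three-ones⇒pattern _ _ _ _ e₀ _ _ | outside p | _ | _ | _ | _ | _ = ⊥-elim
        (1≢0 (trans (sym e₀) (entry-below K _ _ p)))
    three-ones⇒pattern _ _ _ _ _ e₁ _ | _ | outside p | _ | _ | _ | _ = ⊥-elim
        (1≢0 (trans (sym e₁) (entry-below K _ _ p)))
    three-ones⇒pattern _ _ _ _ _ _ e₂ | _ | _ | outside p | _ | _ | _ = ⊥-elim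
        (1≢0 (trans (sym e₂) (entry-below K _ _ p)))
    three-ones⇒pattern _ _ _ _ e₀ _ _ | _ | _ | _ | outside p | _ | _ = ⊥-elim
        (1≢0 (trans (sym e₀) (entry-right K _ _ p)))
    three-ones⇒pattern _ _ _ _ _ e₁ _ | _ | _ | _ | _ | outside p | _ = ⊥-elim
        (1≢0 (trans (sym e₁) (entry-right K _ _ p)))
    three-ones⇒pattern _ _ _ _ _ _ e₂ | _ | _ | _ | _ | _ | outside p = ⊥-elim
        (1≢0 (trans (sym e₂) (entry-right K _ _ p)))


    -- The first r + 2 columns contain r + 2 ones, and rows 0..r contain at most
    -- r of them because row a has its 1 in column c₀.
    two-low-ones-below : ∀ r a c₀ → suc (suc r) ℕ.≤ c₀ → c₀ ℕ.< n → a ℕ.≤ r → entry K a c₀ ≡ 1ℤ →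
      ∃[ x ] ∃[ y ] (x ℕ.< y × y ℕ.< n ℕ.∸ suc r ×
                     psum (entry K (suc r ℕ.+ x)) (suc (suc r)) ≡ 1ℤ × psum (entry K (suc r ℕ.+ y))
                         (suc (suc r)) ≡ 1ℤ)
    two-low-ones-below r a c₀ r+2≤c₀ c₀<n a≤r e₀ =
      psum≥2⇒two-ones (n ℕ.∸ suc r) (λ x → low (suc r ℕ.+ x)) (λ x _ → row-bits (suc r ℕ.+ x) C) below≥2
      where
      C = suc (suc r)
      C≤n : C ℕ.≤ n
      C≤n = ℕₚ.≤-trans r+2≤c₀ (ℕₚ.<⇒≤ c₀<n)
      low : ℕ → ℤ
      low b = psum (entry K b) C
      split : suc r ℕ.+ (n ℕ.∸ suc r) ≡ n
      split = ℕₚ.m+[n∸m]≡n (ℕₚ.≤-trans (ℕₚ.n≤1+n (suc r)) C≤n)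
      above = psum low (suc r)
      below = psum (λ x → low (suc r ℕ.+ x)) (n ℕ.∸ suc r)
      total : above + below ≡ + C
      total = begin
        above + below ≡⟨ psum-split low (suc r) _ ⟨
        psum low (suc r ℕ.+ (n ℕ.∸ suc r)) ≡⟨ cong (psum low) split ⟩
        psum low n ≡⟨ psum-swap (entry K) n C ⟩
        psum (λ c → psum (λ b → entry K b c) n) C ≡⟨ psum-cong C
            (λ c c<C → col-total c (ℕₚ.<-≤-trans c<C C≤n)) ⟩
        psum (λ _ → 1ℤ) C ≡⟨ psum-1 C ⟩
        + C ∎
        where open ≡-Reasoning
      low-a : low a ≡ 0ℤ
      low-a = psum-stays-0-backward (row-bits a) C c₀ (bit-before-1 (row-bits a c₀) (row-bits a (suc c₀)) e₀)
                (λ x _ _ → bit≢-1 (entry-bit a x)) r+2≤c₀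
      above+1≤r+1 : above + 1ℤ ℤ.≤ + suc r
      above+1≤r+1 = psum-bits-< (suc r) low a (λ x _ → row-bits x C) low-a (ℕ.s≤s a≤r)
      below≥2 : + 2 ℤ.≤ below
      below≥2 = +-cancelʳ-≤ (+ suc r) (+ 2) below (begin
        + 2 + + suc r ≡⟨ cong +_ (trans (ℕₚ.+-comm 2 (suc r)) (cong suc (ℕₚ.+-suc r 1))) ⟩
        + C + 1ℤ ≡⟨ cong (_+ 1ℤ) total ⟨
        above + below + 1ℤ ≡⟨ regroup above below ⟩
        above + 1ℤ + below ≤⟨ ℤₚ.+-monoˡ-≤ below above+1≤r+1 ⟩
        + suc r + below ≡⟨ ℤₚ.+-comm (+ suc r) below ⟩
        below + + suc r ∎)
        where
        open ℤₚ.≤-Reasoning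
        regroup : ∀ y t → y + t + 1ℤ ≡ y + 1ℤ + t
        regroup = solve-∀

    offBand⇒pattern : ∀ r → OffBand K r → Contains K p312 ⊎ Contains K p321
    offBand⇒pattern r (c₀ , r+2≤c₀ , c₀<n , e) with psum≥1⇒one (suc r) (λ x → entry K x c₀)
        (λ x _ → entry-bit x c₀) (ℤₚ.≤-reflexive (sym e))
    ... | a , a≤r , e₀ with two-low-ones-below r a c₀ r+2≤c₀ c₀<n (ℕₚ.≤-pred a≤r) e₀
    ... | x , y , x<y , _ , low-x , low-y
      with psum≥1⇒one (suc (suc r)) (entry K (suc r ℕ.+ x)) (λ c _ → entry-bit _ c) (ℤₚ.≤-reflexive (sym low-x))
         | psum≥1⇒one (suc (suc r)) (entry K (suc r ℕ.+ y)) (λ c _ → entry-bit _ c) (ℤₚ.≤-reflexive (sym low-y))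
    ... | c₁ , c₁<r+2 , e₁ | c₂ , c₂<r+2 , e₂ =
      three-ones⇒pattern (ℕₚ.<-≤-trans a≤r (ℕₚ.m≤m+n (suc r) x)) (ℕₚ.+-monoʳ-< (suc r) x<y)
        (ℕₚ.<-≤-trans c₁<r+2 r+2≤c₀) (ℕₚ.<-≤-trans c₂<r+2 r+2≤c₀) e₀ e₁ e₂

  Band : ∀ {n} → Matrix n → Set
  Band {n} A = ∀ (a c : Fin n) → suc (suc (toℕ a)) ℕ.≤ toℕ c → at A a c ≡ 0ℤ

  nonzero-off-band⇒OffBand : ∀ {n} (A : Matrix n) → PrefixForm A → ∀ (a c : Fin n) →
                             suc (suc (toℕ a)) ℕ.≤ toℕ c → at A a c ≢ 0ℤ → ∃[ r ] OffBand A r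
  nonzero-off-band⇒OffBand A pf a c a+2≤c a≢0
    with PrefixForm.col-bits pf (toℕ c) (suc (toℕ a)) | PrefixForm.col-bits pf (toℕ c) (toℕ a)
  ... | inj₂ through-a≡1 | _ = toℕ a , toℕ c , a+2≤c , Finₚ.toℕ<n c , through-a≡1
  ... | inj₁ through-a≡0 | inj₁ before-a≡0 =
    ⊥-elim (a≢0 (trans (sym (entry-at A a c)) (trans (psum-step _ (toℕ a))
        (cong₂ ℤ._-_ through-a≡0 before-a≡0))))
  ... | inj₁ _ | inj₂ before-a≡1 = previous-row (toℕ a) a+2≤c before-a≡1
    where
    previous-row : ∀ a′ → suc (suc a′) ℕ.≤ toℕ c → psum (λ x → entry A x (toℕ c)) a′ ≡ 1ℤ → ∃[ r ] OffBand A r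
    previous-row zero _ ()
    previous-row (suc r) r+3≤c e = r , toℕ c , ℕₚ.≤-trans (ℕₚ.n≤1+n _) r+3≤c , Finₚ.toℕ<n c , e

  counted⇒band : ∀ {n} (A : Matrix n) → Counted A → Band A
  counted⇒band A (asm , K , (steps , no-−1) , avoids-312 , avoids-321) a c a+2≤c =
    decidable-stable (at A a c ℤₚ.≟ 0ℤ) λ a≢0 →
      let pf = isASM⇒prefixForm A asm
          (r , off) = nonzero-off-band⇒OffBand A pf a c a+2≤c a≢0
          (pfK , offK) = steps-preserve steps pf r off
      in [ avoids-312 , avoids-321 ]′ (PermutationMatrix.offBand⇒pattern K pfK no-−1 r offK)

module BandMatrices where

  open import Data.Nat as ℕ using (ℕ; zero; suc; z≤n; s≤s)
  import Data.Nat.Properties as ℕₚ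
  open import Data.Integer as ℤ using (ℤ; 0ℤ; 1ℤ; _+_; _-_)
  import Data.Integer.Properties as ℤₚ
  open import Data.Integer.Tactic.RingSolver using (solve-∀)
  open import Data.Fin using (Fin; toℕ)
  import Data.Fin.Properties as Finₚ
  open import Data.Vec using (replicate; tabulate)
  import Data.Vec.Properties as Vecₚ
  open import Data.Empty using (⊥-elim)
  open import Data.Sum using (inj₁; inj₂)
  open import Data.Product using (_,_)
  open import Relation.Binary.PropositionalEquality
  open import Defs
  open PrefixSums
  open PrefixSumForm

  bandEntry : (ℕ → ℕ) → ℕ → ℕ → ℤ
  bandEntry ν a c = δ (ν a) c - δ (ν (suc a)) c + δ (suc a) c

  bandMatrix : ∀ n → (ℕ → ℕ) → Matrix n
  bandMatrix n ν = tabulate (λ i → tabulate (λ j → bandEntry ν (toℕ i) (toℕ j)))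

  record BandSequence (n : ℕ) (ν : ℕ → ℕ) : Set where
    field
      starts-at-0 : ν 0 ≡ 0
      monotone : ∀ k → k ℕ.< n → ν k ℕ.≤ ν (suc k)
      ν≤id : ∀ k → k ℕ.< n → ν k ℕ.≤ k
      ends-at-n : ν n ≡ n

  vget-tabulate : ∀ {A : Set} {m} (d : A) (g : ℕ → A) k → k ℕ.< m →
                  vget d (tabulate {n = m} (λ i → g (toℕ i))) k ≡ g k
  vget-tabulate {m = suc m} d g zero h = refl
  vget-tabulate {m = suc m} d g (suc k) (s≤s h) = vget-tabulate d (λ x → g (suc x)) k h

  entry-bandMatrix : ∀ n ν a c → a ℕ.< n → c ℕ.< n → entry (bandMatrix n ν) a c ≡ bandEntry ν a c
  entry-bandMatrix n ν a c a<n c<n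
    rewrite vget-tabulate (replicate n 0ℤ) (λ x → tabulate {n = n} (λ j → bandEntry ν x (toℕ j))) a a<n =
    vget-tabulate 0ℤ (bandEntry ν a) c c<n

  at-bandMatrix : ∀ n ν (p q : Fin n) → at (bandMatrix n ν) p q ≡ bandEntry ν (toℕ p) (toℕ q)
  at-bandMatrix n ν p q =
    trans (sym (entry-at (bandMatrix n ν) p q)) (entry-bandMatrix n ν (toℕ p) (toℕ q) (Finₚ.toℕ<n p)
        (Finₚ.toℕ<n q))

  θ-suc : ∀ c m → θ c (suc m) ≡ θ c m + δ m c
  θ-suc c m with θ-view c (suc m) | θ-view c m | δ-view m c
  ... | inj₁ _ | inj₁ (p , _) | inj₁ (q , _) = ⊥-elim (ℕₚ.<-irrefl q p)
  ... | inj₁ (_ , e₁) | inj₁ (_ , e₂) | inj₂ (_ , e₃) rewrite e₁ | e₂ | e₃ = refl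
  ... | inj₁ (_ , e₁) | inj₂ (_ , e₂) | inj₁ (_ , e₃) rewrite e₁ | e₂ | e₃ = refl
  ... | inj₁ (p , _) | inj₂ (q , _) | inj₂ (r , _) = ⊥-elim (r (ℕₚ.≤-antisym (ℕₚ.≤-pred p) q))
  ... | inj₂ (p , _) | inj₁ (q , _) | _ = ⊥-elim (ℕₚ.<-irrefl refl (ℕₚ.<-≤-trans (ℕₚ.<-trans q (ℕₚ.n<1+n m)) p))
  ... | inj₂ (p , _) | inj₂ _ | inj₁ (q , _) = ⊥-elim (ℕₚ.<-irrefl (sym q) p)
  ... | inj₂ (_ , e₁) | inj₂ (_ , e₂) | inj₂ (_ , e₃) rewrite e₁ | e₂ | e₃ = refl

  -- The sum of the first k rows of the band matrix is the indicator of
  -- {0, …, k} with the point ν k removed.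
  colPrefix : (ℕ → ℕ) → ℕ → ℕ → ℤ
  colPrefix ν k c = θ c (suc k) - δ (ν k) c

  bandEntry-colPrefix : ∀ ν a c → bandEntry ν a c ≡ colPrefix ν (suc a) c - colPrefix ν a c
  bandEntry-colPrefix ν a c rewrite θ-suc c (suc a) =
    rearrange (δ (ν a) c) (δ (ν (suc a)) c) (δ (suc a) c) (θ c (suc a))
    where
    rearrange : ∀ x y z w → x - y + z ≡ w + z - y - (w - x)
    rearrange = solve-∀

  colPrefix-0 : ∀ ν → ν 0 ≡ 0 → ∀ c → colPrefix ν 0 c ≡ 0ℤ
  colPrefix-0 ν e c rewrite e | θ-suc c 0 | θ-≥ {c} {0} z≤n =
    trans (cong (_- δ 0 c) (ℤₚ.+-identityˡ (δ 0 c))) (ℤₚ.+-inverseʳ (δ 0 c))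

  colPrefix-bit : ∀ ν k c → ν k ℕ.≤ k → Bit (colPrefix ν k c)
  colPrefix-bit ν k c νk≤k with θ-view c (suc k) | δ-view (ν k) c
  ... | inj₁ (_ , e₁) | inj₁ (_ , e₂) rewrite e₁ | e₂ = inj₁ refl
  ... | inj₁ (_ , e₁) | inj₂ (_ , e₂) rewrite e₁ | e₂ = inj₂ refl
  ... | inj₂ (p , _) | inj₁ (refl , _) = ⊥-elim (ℕₚ.<-irrefl refl (ℕₚ.<-≤-trans (s≤s νk≤k) p))
  ... | inj₂ (_ , e₁) | inj₂ (_ , e₂) rewrite e₁ | e₂ = inj₁ refl

  θ-bit : ∀ x y z C → x ℕ.≤ y → y ℕ.≤ z → Bit (θ x C - θ y C + θ z C)
  θ-bit x y z C x≤y y≤z with θ-view x C | θ-view y C | θ-view z C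
  ... | inj₁ (_ , a) | inj₁ (_ , b) | inj₁ (_ , c) rewrite a | b | c = inj₂ refl
  ... | inj₁ (_ , a) | inj₁ (_ , b) | inj₂ (_ , c) rewrite a | b | c = inj₁ refl
  ... | inj₁ _ | inj₂ (p , _) | inj₁ (q , _) = ⊥-elim (ℕₚ.<-irrefl refl (ℕₚ.<-≤-trans q (ℕₚ.≤-trans p y≤z)))
  ... | inj₁ (_ , a) | inj₂ (_ , b) | inj₂ (_ , c) rewrite a | b | c = inj₂ refl
  ... | inj₂ (p , _) | inj₁ (q , _) | _ = ⊥-elim (ℕₚ.<-irrefl refl (ℕₚ.<-≤-trans q (ℕₚ.≤-trans p x≤y)))
  ... | inj₂ _ | inj₂ (p , _) | inj₁ (q , _) = ⊥-elim (ℕₚ.<-irrefl refl (ℕₚ.<-≤-trans q (ℕₚ.≤-trans p y≤z)))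
  ... | inj₂ (_ , a) | inj₂ (_ , b) | inj₂ (_ , c) rewrite a | b | c = inj₁ refl

  psum-bandEntry-row : ∀ ν a C → psum (bandEntry ν a) C ≡ θ (ν a) C - θ (ν (suc a)) C + θ (suc a) C
  psum-bandEntry-row ν a C =
    trans (psum-+ (λ c → δ (ν a) c - δ (ν (suc a)) c) (δ (suc a)) C)
          (cong₂ _+_ (trans (psum-− (δ (ν a)) (δ (ν (suc a))) C)
              (cong₂ _-_ (psum-δ (ν a) C) (psum-δ (ν (suc a)) C)))
                     (psum-δ (suc a) C))

  psum-bandEntry-col : ∀ ν → ν 0 ≡ 0 → ∀ c k → psum (λ a → bandEntry ν a c) k ≡ colPrefix ν k c
  psum-bandEntry-col ν ν0≡0 c k = begin
    psum (λ a → bandEntry ν a c) k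
      ≡⟨ psum-cong k (λ a _ → bandEntry-colPrefix ν a c) ⟩
    psum (λ a → colPrefix ν (suc a) c - colPrefix ν a c) k
      ≡⟨ psum-telescope (λ a → colPrefix ν a c) k ⟩
    colPrefix ν k c - colPrefix ν 0 c
      ≡⟨ cong (colPrefix ν k c -_) (colPrefix-0 ν ν0≡0 c) ⟩
    colPrefix ν k c - 0ℤ
      ≡⟨ ℤₚ.+-identityʳ _ ⟩
    colPrefix ν k c ∎
    where open ≡-Reasoning

  module BandMatrixOf {n : ℕ} {ν : ℕ → ℕ} (seq : BandSequence n ν) where
    open BandSequence seq
    private M = bandMatrix n ν

    ν≤id′ : ∀ k → k ℕ.≤ n → ν k ℕ.≤ k
    ν≤id′ k k≤n with ℕₚ.m≤n⇒m<n∨m≡n k≤n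
    ... | inj₁ k<n = ν≤id k k<n
    ... | inj₂ refl = ℕₚ.≤-reflexive ends-at-n

    col-prefix : ∀ c → c ℕ.< n → ∀ k → k ℕ.≤ n → psum (λ a → entry M a c) k ≡ colPrefix ν k c
    col-prefix c c<n k k≤n =
      trans (psum-cong k (λ a a<k → entry-bandMatrix n ν a c (ℕₚ.<-≤-trans a<k k≤n) c<n))
            (psum-bandEntry-col ν starts-at-0 c k)

    row-prefix : ∀ a → a ℕ.< n → ∀ C → C ℕ.≤ n → psum (entry M a) C ≡ θ (ν a) C - θ (ν (suc a)) C + θ (suc a) C
    row-prefix a a<n C C≤n =
      trans (psum-cong C (λ c c<C → entry-bandMatrix n ν a c a<n (ℕₚ.<-≤-trans c<C C≤n)))
          (psum-bandEntry-row ν a C)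

    col-bits : ∀ c → PrefixBits (λ a → entry M a c)
    col-bits c k with index n c | ℕₚ.≤-total k n
    ... | outside p | _ = zero-bits (λ a → entry-right M a c p) k
    ... | inside j | inj₁ k≤n =
      subst Bit (sym (col-prefix (toℕ j) (Finₚ.toℕ<n j) k k≤n)) (colPrefix-bit ν k (toℕ j) (ν≤id′ k k≤n))
    ... | inside j | inj₂ n≤k =
      subst Bit (sym (trans (psum-vanishing-tail _ n k (λ x p → entry-below M x (toℕ j) p) n≤k)
                            (col-prefix (toℕ j) (Finₚ.toℕ<n j) n ℕₚ.≤-refl)))
            (colPrefix-bit ν n (toℕ j) (ν≤id′ n ℕₚ.≤-refl))

    row-bits : ∀ a → PrefixBits (entry M a)
    row-bits a C with index n a | ℕₚ.≤-total C n
    ... | outside p | _ = zero-bits (λ c → entry-below M a c p) C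
    ... | inside i | inj₁ C≤n =
      subst Bit (sym (row-prefix (toℕ i) (Finₚ.toℕ<n i) C C≤n))
            (θ-bit _ _ _ C (monotone _ (Finₚ.toℕ<n i)) (ν≤id′ _ (Finₚ.toℕ<n i)))
    ... | inside i | inj₂ n≤C =
      subst Bit (sym (trans (psum-vanishing-tail _ n C (λ x p → entry-right M (toℕ i) x p) n≤C)
                            (row-prefix (toℕ i) (Finₚ.toℕ<n i) n ℕₚ.≤-refl)))
            (θ-bit _ _ _ n (monotone _ (Finₚ.toℕ<n i)) (ν≤id′ _ (Finₚ.toℕ<n i)))

    col-total : ∀ c → c ℕ.< n → psum (λ a → entry M a c) n ≡ 1ℤ
    col-total c c<n rewrite col-prefix c c<n n ℕₚ.≤-refl | ends-at-n | θ-< (ℕₚ.m<n⇒m<1+n c<n)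
                          | δ-≢ {n} {c} (λ e → ℕₚ.<-irrefl e c<n) = refl

    row-total : ∀ a → a ℕ.< n → psum (entry M a) n ≡ 1ℤ
    row-total a a<n rewrite row-prefix a a<n n ℕₚ.≤-refl | θ-< (ℕₚ.≤-<-trans (ν≤id a a<n) a<n)
      with ℕₚ.m≤n⇒m<n∨m≡n a<n
    ... | inj₁ a+1<n rewrite θ-< (ℕₚ.≤-<-trans (ν≤id′ (suc a) a<n) a+1<n) | θ-< a+1<n = refl
    ... | inj₂ refl rewrite ends-at-n | θ-≥ {suc a} {suc a} ℕₚ.≤-refl = refl

    prefixForm : PrefixForm M
    prefixForm = record { col-bits = col-bits ; row-bits = row-bits ; col-total = col-total ; row-total =
        row-total }

    isASM : IsASM M
    isASM = prefixForm⇒isASM M prefixForm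

  bandMatrix-cong : ∀ n {ν ν′} → (∀ x → x ℕ.≤ n → ν x ≡ ν′ x) → bandMatrix n ν ≡ bandMatrix n ν′
  bandMatrix-cong n {ν} {ν′} ν≗ν′ =
    Vecₚ.tabulate-cong (λ i → Vecₚ.tabulate-cong (λ j → same-entry (toℕ i) (toℕ j) (Finₚ.toℕ<n i)))
    where
    same-entry : ∀ a c → a ℕ.< n → bandEntry ν a c ≡ bandEntry ν′ a c
    same-entry a c a<n rewrite ν≗ν′ a (ℕₚ.<⇒≤ a<n) | ν≗ν′ (suc a) a<n = refl

  -- ν x is the only column c ≤ x with colPrefix ν x c = 0.
  bandMatrix-injective : ∀ n {ν ν′} → BandSequence n ν → BandSequence n ν′ →
                         bandMatrix n ν ≡ bandMatrix n ν′ → ∀ x → x ℕ.≤ n → ν x ≡ ν′ x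
  bandMatrix-injective n {ν} {ν′} seq seq′ eq x x≤n with ℕₚ.m≤n⇒m<n∨m≡n x≤n
  ... | inj₂ refl = trans (BandSequence.ends-at-n seq) (sym (BandSequence.ends-at-n seq′))
  ... | inj₁ x<n with δ-view (ν′ x) (ν x)
  ...   | inj₁ (νx≡ν′x , _) = νx≡ν′x
  ...   | inj₂ (_ , δ≡0) = ⊥-elim (1≢0 (trans (sym prefix′≡1) (trans (sym same-prefix) prefix≡0)))
    where
    νx≤x = BandSequence.ν≤id seq x x<n
    c<n = ℕₚ.≤-<-trans νx≤x x<n
    same-prefix : colPrefix ν x (ν x) ≡ colPrefix ν′ x (ν x)
    same-prefix = trans (sym (BandMatrixOf.col-prefix seq (ν x) c<n x x≤n))
                        (trans (cong (λ M → psum (λ a → entry M a (ν x)) x) eq)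
                            (BandMatrixOf.col-prefix seq′ (ν x) c<n x x≤n))
    prefix≡0 : colPrefix ν x (ν x) ≡ 0ℤ
    prefix≡0 rewrite θ-< {ν x} {suc x} (ℕ.s≤s νx≤x) | δ-refl (ν x) = refl
    prefix′≡1 : colPrefix ν′ x (ν x) ≡ 1ℤ
    prefix′≡1 rewrite θ-< {ν x} {suc x} (ℕ.s≤s νx≤x) | δ≡0 = refl

module KeyOfBandMatrix where

  open import Data.Nat as ℕ using (ℕ; zero; suc; z≤n; s≤s)
  import Data.Nat.Properties as ℕₚ
  open import Data.Integer as ℤ using (0ℤ; 1ℤ; -1ℤ; +_; _+_; _-_; -_)
  import Data.Integer.Properties as ℤₚ
  open import Data.Integer.Tactic.RingSolver using (solve-∀)
  open import Data.Fin as Fin using (Fin; toℕ; fromℕ<)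
  import Data.Fin.Properties as Finₚ
  open import Data.Vec as Vec using (Vec; lookup)
  open import Data.Empty using (⊥; ⊥-elim)
  open import Data.Sum using (_⊎_; inj₁; inj₂)
  open import Data.Product using (∃-syntax; _×_; _,_; proj₁; proj₂)
  open import Relation.Nullary using (¬_; ¬?; yes; no; Dec)
  open import Relation.Nullary.Decidable using (_⊎-dec_; decidable-stable)
  open import Relation.Binary.PropositionalEquality
  open import Function.Bundles using (Equivalence)
  open import Relation.Binary.Definitions using (tri<; tri≈; tri>)
  open import Relation.Binary.Construct.Closure.ReflexiveTransitive using (Star; ε; _◅_)
  open import Defs
  open PrefixSums
  open PrefixSumForm
  open BandMatrices
  open Search

  sumℕ : (ℕ → ℕ) → ℕ → ℕ
  sumℕ f zero = 0
  sumℕ f (suc k) = sumℕ f k ℕ.+ f k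

  sumℕ-mono : ∀ f g k → (∀ x → x ℕ.< k → f x ℕ.≤ g x) → sumℕ f k ℕ.≤ sumℕ g k
  sumℕ-mono f g zero h = z≤n
  sumℕ-mono f g (suc k) h = ℕₚ.+-mono-≤ (sumℕ-mono f g k (λ x p → h x (ℕₚ.m<n⇒m<1+n p))) (h k (ℕₚ.n<1+n k))

  sumℕ-strict : ∀ f g k x₀ → (∀ x → x ℕ.< k → f x ℕ.≤ g x) → x₀ ℕ.< k → f x₀ ℕ.< g x₀ → sumℕ f k ℕ.< sumℕ g k
  sumℕ-strict f g (suc k) x₀ h x₀<k+1 fx₀<gx₀ with ℕₚ.m≤n⇒m<n∨m≡n (ℕₚ.≤-pred x₀<k+1)
  ... | inj₁ x₀<k =
    ℕₚ.+-mono-<-≤ (sumℕ-strict f g k x₀ (λ x u → h x (ℕₚ.m<n⇒m<1+n u)) x₀<k fx₀<gx₀) (h k (ℕₚ.n<1+n k))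
  ... | inj₂ refl = ℕₚ.+-mono-≤-< (sumℕ-mono f g x₀ (λ x u → h x (ℕₚ.m<n⇒m<1+n u))) fx₀<gx₀

  -- Row a of the band matrix has no -1 exactly when ν does not move strictly
  -- between a and a + 1; the row is then the unit vector at a + 1 or at ν a.
  NoNegRow : (ℕ → ℕ) → ℕ → Set
  NoNegRow ν a = ν (suc a) ≡ ν a ⊎ ν (suc a) ≡ suc a

  noNegRow? : ∀ ν a → Dec (NoNegRow ν a)
  noNegRow? ν a = (ν (suc a) ℕₚ.≟ ν a) ⊎-dec (ν (suc a) ℕₚ.≟ suc a)

  bandEntry-stay : ∀ ν a q → ν (suc a) ≡ ν a → bandEntry ν a q ≡ δ (suc a) q
  bandEntry-stay ν a q e rewrite e =
    trans (cong (_+ δ (suc a) q) (ℤₚ.+-inverseʳ (δ (ν a) q))) (ℤₚ.+-identityˡ _)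

  bandEntry-jump : ∀ ν a q → ν (suc a) ≡ suc a → bandEntry ν a q ≡ δ (ν a) q
  bandEntry-jump ν a q e rewrite e = cancel (δ (ν a) q) (δ (suc a) q)
    where
    cancel : ∀ x y → x - y + y ≡ x
    cancel = solve-∀

  noNegRow-bit : ∀ ν a q → NoNegRow ν a → Bit (bandEntry ν a q)
  noNegRow-bit ν a q (inj₁ e) = subst Bit (sym (bandEntry-stay ν a q e)) (δ-bit (suc a) q)
  noNegRow-bit ν a q (inj₂ e) = subst Bit (sym (bandEntry-jump ν a q e)) (δ-bit (ν a) q)

  bits-without-middle : ∀ {x y} → Bit x → Bit y → x - 0ℤ + y ≢ -1ℤ
  bits-without-middle (inj₁ refl) (inj₁ refl) ()
  bits-without-middle (inj₁ refl) (inj₂ refl) ()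
  bits-without-middle (inj₂ refl) (inj₁ refl) ()
  bits-without-middle (inj₂ refl) (inj₂ refl) ()

  only-middle : ∀ {x} → Bit x → 0ℤ - x + 0ℤ ≢ 1ℤ
  only-middle (inj₁ refl) ()
  only-middle (inj₂ refl) ()

  -- Let r be the last row with a -1; it sits in column j = ν (r + 1), the
  -- nearest 1 to its west is in column j₀ = ν r and the nearest 1 below it is
  -- in the first row i₀ > r where ν jumps.  The key step lowers ν to j₀ on
  -- rows r + 1 .. i₀.
  module RemoveLastNegative {n : ℕ} (ν : ℕ → ℕ) (seq : BandSequence n ν) (r : ℕ) (r<n : r ℕ.< n)
    (neg : ¬ NoNegRow ν r) (later : ∀ b → r ℕ.< b → b ℕ.< n → NoNegRow ν b) where
    open BandSequence seq
    open BandMatrixOf seq using (ν≤id′)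

    j = ν (suc r)
    j₀ = ν r

    j₀<j : j₀ ℕ.< j
    j₀<j = ℕₚ.≤∧≢⇒< (monotone r r<n) (λ e → neg (inj₁ (sym e)))

    j<r+1 : j ℕ.< suc r
    j<r+1 = ℕₚ.≤∧≢⇒< (ν≤id′ (suc r) r<n) (λ e → neg (inj₂ e))

    r+1<n : suc r ℕ.< n
    r+1<n = ℕₚ.≤∧≢⇒< r<n (λ e → neg (inj₂ (trans (cong ν e) (trans ends-at-n (sym e)))))

    JumpAfter : ℕ → Set
    JumpAfter a = r ℕ.< a × ν (suc a) ≡ suc a

    jumpAfter? : ∀ a → Dec (JumpAfter a)
    jumpAfter? a with r ℕ.<? a | ν (suc a) ℕₚ.≟ suc a
    ... | yes p | yes q = yes (p , q)
    ... | no p | _ = no (λ z → p (proj₁ z))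
    ... | _ | no q = no (λ z → q (proj₂ z))

    first-jump : ∃[ a ] (a ℕ.< n × JumpAfter a × (∀ b → b ℕ.< a → ¬ JumpAfter b))
    first-jump with least-below jumpAfter? n | r+1<n
    ... | inj₁ x | _ = x
    ... | inj₂ none | ℕ.s≤s {n = m} r<m = ⊥-elim (none m ℕₚ.≤-refl (r<m , ends-at-n))

    i₀ = proj₁ first-jump
    i₀<n : i₀ ℕ.< n
    i₀<n = proj₁ (proj₂ first-jump)
    r<i₀ : r ℕ.< i₀
    r<i₀ = proj₁ (proj₁ (proj₂ (proj₂ first-jump)))
    jump-at-i₀ : ν (suc i₀) ≡ suc i₀
    jump-at-i₀ = proj₂ (proj₁ (proj₂ (proj₂ first-jump)))
    no-earlier-jump : ∀ b → b ℕ.< i₀ → ¬ JumpAfter b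
    no-earlier-jump = proj₂ (proj₂ (proj₂ first-jump))

    stays-between : ∀ a → r ℕ.< a → a ℕ.< i₀ → ν (suc a) ≡ ν a
    stays-between a ra ai with later a ra (ℕₚ.<-trans ai i₀<n)
    ... | inj₁ e = e
    ... | inj₂ e = ⊥-elim (no-earlier-jump a ai (ra , e))

    ν≡j-from : ∀ k → suc r ℕ.+ k ℕ.≤ i₀ → ν (suc r ℕ.+ k) ≡ j
    ν≡j-from zero h = cong ν (ℕₚ.+-identityʳ (suc r))
    ν≡j-from (suc k) h rewrite ℕₚ.+-suc (suc r) k =
      trans (stays-between (suc r ℕ.+ k) (ℕₚ.<-≤-trans (ℕₚ.n<1+n r) (ℕₚ.m≤m+n (suc r) k)) h)
          (ν≡j-from k (ℕₚ.<⇒≤ h))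

    ν≡j-between : ∀ a → r ℕ.< a → a ℕ.≤ i₀ → ν a ≡ j
    ν≡j-between a ra ai = trans (cong ν (sym (ℕₚ.m+[n∸m]≡n ra)))
        (ν≡j-from (a ℕ.∸ suc r) (subst (ℕ._≤ i₀) (sym (ℕₚ.m+[n∸m]≡n ra)) ai))

    ν′ : ℕ → ℕ
    ν′ k with suc r ℕ.≤? k | k ℕ.≤? i₀
    ... | yes _ | yes _ = ν r
    ... | _ | _ = ν k

    ν′-block : ∀ k → suc r ℕ.≤ k → k ℕ.≤ i₀ → ν′ k ≡ ν r
    ν′-block k a b with suc r ℕ.≤? k | k ℕ.≤? i₀
    ... | yes _ | yes _ = refl
    ... | no p | _ = ⊥-elim (p a)
    ... | yes _ | no q = ⊥-elim (q b)

    ν′-before : ∀ k → k ℕ.≤ r → ν′ k ≡ ν k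
    ν′-before k a with suc r ℕ.≤? k | k ℕ.≤? i₀
    ... | yes p | yes _ = ⊥-elim (ℕₚ.<-irrefl refl (ℕₚ.<-≤-trans p a))
    ... | no _ | _ = refl
    ... | yes _ | no _ = refl

    ν′-after : ∀ k → i₀ ℕ.< k → ν′ k ≡ ν k
    ν′-after k a with suc r ℕ.≤? k | k ℕ.≤? i₀
    ... | yes _ | yes q = ⊥-elim (ℕₚ.<-irrefl refl (ℕₚ.<-≤-trans a q))
    ... | no _ | _ = refl
    ... | yes _ | no _ = refl

    data Position (k : ℕ) : Set where
      before : k ℕ.≤ r → Position k
      block : suc r ℕ.≤ k → k ℕ.≤ i₀ → Position k
      after : i₀ ℕ.< k → Position k

    position : ∀ k → Position k
    position k with k ℕ.≤? r | k ℕ.≤? i₀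
    ... | yes p | _ = before p
    ... | no p | yes q = block (ℕₚ.≰⇒> p) q
    ... | no p | no q = after (ℕₚ.≰⇒> q)

    ν′-band : BandSequence n ν′
    ν′-band = record { starts-at-0 = starts-at-0′ ; monotone = monotone′ ; ν≤id = ν′≤id ; ends-at-n =
        ends-at-n′ }
      where
      starts-at-0′ : ν′ 0 ≡ 0
      starts-at-0′ = trans (ν′-before 0 z≤n) starts-at-0
      monotone′ : ∀ k → k ℕ.< n → ν′ k ℕ.≤ ν′ (suc k)
      monotone′ k kn with position k | position (suc k)
      ... | before a | before b rewrite ν′-before k a | ν′-before (suc k) b = monotone k kn
      ... | before a | block b c rewrite ν′-before k a | ν′-block (suc k) b c | ℕₚ.≤-antisym a (ℕₚ.≤-pred b) =
          ℕₚ.≤-refl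
      ... | before a | after b = ⊥-elim (ℕₚ.<-irrefl refl
          (ℕₚ.<-≤-trans r<i₀ (ℕₚ.≤-pred (ℕₚ.<-≤-trans b (s≤s a)))))
      ... | block a b | before c = ⊥-elim (ℕₚ.<-irrefl refl (ℕₚ.<-≤-trans a (ℕₚ.≤-trans (ℕₚ.n≤1+n k) c)))
      ... | block a b | block c d rewrite ν′-block k a b | ν′-block (suc k) c d = ℕₚ.≤-refl
      ... | block a b | after c rewrite ν′-block k a b | ν′-after (suc k) c =
            ℕₚ.≤-trans (ν≤id r r<n) (ℕₚ.≤-trans (ℕₚ.n≤1+n r) (ℕₚ.≤-trans a (ℕₚ.≤-trans (ℕₚ.n≤1+n k)
              (ℕₚ.≤-reflexive (sym (subst (λ z → ν (suc z) ≡ suc z) (sym (ℕₚ.≤-antisym b (ℕₚ.≤-pred c)))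
                  jump-at-i₀))))))
      ... | after a | before c = ⊥-elim (ℕₚ.<-irrefl refl
          (ℕₚ.<-≤-trans r<i₀ (ℕₚ.≤-trans (ℕₚ.<⇒≤ a) (ℕₚ.≤-trans (ℕₚ.n≤1+n k) c))))
      ... | after a | block c d = ⊥-elim (ℕₚ.<-irrefl refl (ℕₚ.<-≤-trans a (ℕₚ.≤-trans (ℕₚ.n≤1+n k) d)))
      ... | after a | after c rewrite ν′-after k a | ν′-after (suc k) c = monotone k kn
      ν′≤id : ∀ k → k ℕ.< n → ν′ k ℕ.≤ k
      ν′≤id k kn with position k
      ... | before a rewrite ν′-before k a = ν≤id k kn
      ... | block a b rewrite ν′-block k a b = ℕₚ.≤-trans (ν≤id r r<n) (ℕₚ.≤-trans (ℕₚ.n≤1+n r) a)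
      ... | after a rewrite ν′-after k a = ν≤id k kn
      ends-at-n′ : ν′ n ≡ n
      ends-at-n′ = trans (ν′-after n i₀<n) ends-at-n

    ν′≤ν : ∀ x → x ℕ.≤ n → ν′ x ℕ.≤ ν x
    ν′≤ν x xn with position x
    ... | before a rewrite ν′-before x a = ℕₚ.≤-refl
    ... | block a b rewrite ν′-block x a b | ν≡j-between x a b = ℕₚ.<⇒≤ j₀<j
    ... | after a rewrite ν′-after x a = ℕₚ.≤-refl

    sum-decreases : sumℕ ν′ (suc n) ℕ.< sumℕ ν (suc n)
    sum-decreases = sumℕ-strict ν′ ν (suc n) (suc r) (λ x p → ν′≤ν x (ℕₚ.≤-pred p)) (s≤s (ℕₚ.<⇒≤ r+1<n))
                (subst (ℕ._< ν (suc r)) (sym (ν′-block (suc r) ℕₚ.≤-refl r<i₀)) j₀<j)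

    entry-between : ∀ p q → r ℕ.< p → p ℕ.< i₀ → bandEntry ν p q ≡ δ (suc p) q
    entry-between p q a b = bandEntry-stay ν p q (stays-between p a b)

    entry′-between : ∀ p q → r ℕ.< p → p ℕ.< i₀ → bandEntry ν′ p q ≡ δ (suc p) q
    entry′-between p q a b = bandEntry-stay ν′ p q (trans (ν′-block (suc p) (ℕₚ.<⇒≤ (s≤s a)) b)
        (sym (ν′-block p a (ℕₚ.<⇒≤ b))))

    entry′-r : ∀ q → bandEntry ν′ r q ≡ δ (suc r) q
    entry′-r q = bandEntry-stay ν′ r q (trans (ν′-block (suc r) ℕₚ.≤-refl r<i₀) (sym (ν′-before r ℕₚ.≤-refl)))

    entry-i₀ : ∀ q → bandEntry ν i₀ q ≡ δ j q
    entry-i₀ q = trans (bandEntry-jump ν i₀ q jump-at-i₀) (cong (λ z → δ z q) (ν≡j-between i₀ r<i₀ ℕₚ.≤-refl))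

    entry′-i₀ : ∀ q → bandEntry ν′ i₀ q ≡ δ j₀ q
    entry′-i₀ q = trans (bandEntry-jump ν′ i₀ q (trans (ν′-after (suc i₀) (ℕₚ.n<1+n i₀)) jump-at-i₀))
        (cong (λ z → δ z q) (ν′-block i₀ r<i₀ ℕₚ.≤-refl))

    entry′-outside : ∀ p q → (p ℕ.< r ⊎ i₀ ℕ.< p) → bandEntry ν′ p q ≡ bandEntry ν p q
    entry′-outside p q (inj₁ a) rewrite ν′-before p (ℕₚ.<⇒≤ a) | ν′-before (suc p) a = refl
    entry′-outside p q (inj₂ a) rewrite ν′-after p a | ν′-after (suc p) (ℕₚ.<-trans a (ℕₚ.n<1+n p)) = refl

    ones-in-rectangle : ∀ a b → r ℕ.≤ a → a ℕ.≤ i₀ → b ℕ.≤ j → bandEntry ν a b ≡ 1ℤ → (a ≡ r × b ≡ j₀) ⊎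
        (a ≡ i₀ × b ≡ j)
    ones-in-rectangle a b ra ai bj e with ℕₚ.m≤n⇒m<n∨m≡n ra
    ... | inj₂ refl = inj₁ (refl , b≡j₀)
      where
      b≡j₀ : b ≡ j₀
      b≡j₀ with δ-view j₀ b
      ... | inj₁ (p , _) = p
      ... | inj₂ (_ , z) = ⊥-elim (only-middle (δ-bit j b) (subst (λ w → w - δ j b + 0ℤ ≡ 1ℤ) z
                              (trans (cong (λ w → δ j₀ b - δ j b + w)
                                  (sym (δ-≢ (λ h → ℕₚ.<-irrefl h (ℕₚ.≤-<-trans bj j<r+1))))) e)))
    ... | inj₁ ra' with ℕₚ.m≤n⇒m<n∨m≡n ai
    ...   | inj₂ refl = inj₂ (refl , δ≡1⇒≡ (trans (sym (entry-i₀ b)) e))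
    ...   | inj₁ ai' = ⊥-elim (ℕₚ.<-irrefl (δ≡1⇒≡ (trans (sym (entry-between a b ra' ai')) e))
                         (ℕₚ.≤-<-trans bj (ℕₚ.<-trans j<r+1 (s≤s ra'))))

    tf : ∀ {x} (h : x ℕ.< n) → toℕ (fromℕ< h) ≡ x
    tf h = Finₚ.toℕ-fromℕ< h

    j<n : j ℕ.< n
    j<n = ℕₚ.<-trans j<r+1 r+1<n
    j₀<n : j₀ ℕ.< n
    j₀<n = ℕₚ.<-trans j₀<j j<n

    fi = fromℕ< r<n
    fj = fromℕ< j<n
    fj₀ = fromℕ< j₀<n
    fi₀ = fromℕ< i₀<n

    M = bandMatrix n ν
    M′ = bandMatrix n ν′

    at-M : ∀ p q → at M p q ≡ bandEntry ν (toℕ p) (toℕ q)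
    at-M = at-bandMatrix n ν
    at-M′ : ∀ p q → at M′ p q ≡ bandEntry ν′ (toℕ p) (toℕ q)
    at-M′ = at-bandMatrix n ν′

    fin-≡ : ∀ {p : Fin n} {x} (h : x ℕ.< n) → toℕ p ≡ x → p ≡ fromℕ< h
    fin-≡ h e = Finₚ.toℕ-injective (trans e (sym (tf h)))

    entry-r-j : bandEntry ν r j ≡ -1ℤ
    entry-r-j rewrite δ-≢ {j₀} {j} (λ h → ℕₚ.<-irrefl (sym h) j₀<j) | δ-refl j | δ-≢ {suc r} {j}
        (λ h → ℕₚ.<-irrefl h j<r+1) = refl

    removable : Removable M fi fj
    removable = trans (at-M fi fj) (subst₂ (λ u v → bandEntry ν u v ≡ -1ℤ) (sym (tf r<n)) (sym (tf j<n))
        entry-r-j) , rm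
      where
      rm : ∀ a b → fi Fin.≤ a → b Fin.≤ fj → at M a b ≡ -1ℤ → (a ≡ fi × b ≡ fj)
      rm a b ia bj e with ℕₚ.m≤n⇒m<n∨m≡n (subst (ℕ._≤ toℕ a) (tf r<n) ia)
      ... | inj₁ ra = ⊥-elim (bit≢-1 (noNegRow-bit ν (toℕ a) (toℕ b) (later (toℕ a) ra (Finₚ.toℕ<n a)))
          (trans (sym (at-M a b)) e))
      ... | inj₂ ra with δ-view j (toℕ b)
      ...   | inj₁ (p , _) = fin-≡ r<n (sym ra) , fin-≡ j<n p
      ...   | inj₂ (_ , z) = ⊥-elim (bits-without-middle (δ-bit j₀ (toℕ b)) (δ-bit (suc r) (toℕ b))
                                (trans (cong (λ w → δ j₀ (toℕ b) - w + δ (suc r) (toℕ b)) (sym z))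
                                  (trans (cong (λ u → bandEntry ν u (toℕ b)) ra) (trans (sym (at-M a b)) e))))

    nearest-west : NearestWest M fi fj fj₀
    nearest-west = subst₂ ℕ._<_ (sym (tf j₀<n)) (sym (tf j<n)) j₀<j ,
            trans (at-M fi fj₀) (subst₂ (λ u v → bandEntry ν u v ≡ 1ℤ) (sym (tf r<n)) (sym (tf j₀<n)) e1) , nb
      where
      e1 : bandEntry ν r j₀ ≡ 1ℤ
      e1 rewrite δ-refl j₀ | δ-≢ {j} {j₀} (λ h → ℕₚ.<-irrefl h j₀<j) | δ-≢ {suc r} {j₀}
          (λ h → ℕₚ.<-irrefl h (ℕₚ.<-trans j₀<j j<r+1)) = refl
      nb : ∀ b → fj₀ Fin.< b → b Fin.< fj → at M fi b ≢ 1ℤ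
      nb b p q e = 1≢0 (trans (sym e) (trans (at-M fi b)
          (trans (cong (λ u → bandEntry ν u (toℕ b)) (tf r<n)) entry-r)))
        where
        p' : j₀ ℕ.< toℕ b
        p' = subst (ℕ._< toℕ b) (tf j₀<n) p
        q' : toℕ b ℕ.< j
        q' = subst (toℕ b ℕ.<_) (tf j<n) q
        entry-r : bandEntry ν r (toℕ b) ≡ 0ℤ
        entry-r rewrite δ-≢ {j₀} {toℕ b} (λ h → ℕₚ.<-irrefl (sym h) p') | δ-≢ {j} {toℕ b}
            (λ h → ℕₚ.<-irrefl h q')
                 | δ-≢ {suc r} {toℕ b} (λ h → ℕₚ.<-irrefl h (ℕₚ.<-trans q' j<r+1)) = refl

    nearest-south : NearestSouth M fi fj fi₀
    nearest-south = subst₂ ℕ._<_ (sym (tf r<n)) (sym (tf i₀<n)) r<i₀ ,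
             trans (at-M fi₀ fj) (subst₂ (λ u v → bandEntry ν u v ≡ 1ℤ) (sym (tf i₀<n)) (sym (tf j<n))
                 (trans (entry-i₀ j) (δ-refl j))) , nb
      where
      nb : ∀ a → fi Fin.< a → a Fin.< fi₀ → at M a fj ≢ 1ℤ
      nb a p q e = 1≢0 (trans (sym e) (trans (at-M a fj) (trans (cong (bandEntry ν (toℕ a)) (tf j<n))
                     (trans (entry-between (toℕ a) j p' q')
                         (δ-≢ (λ h → ℕₚ.<-irrefl h (ℕₚ.<-trans j<r+1 (s≤s p'))))))))
        where
        p' : r ℕ.< toℕ a
        p' = subst (ℕ._< toℕ a) (tf r<n) p
        q' : toℕ a ℕ.< i₀
        q' = subst (toℕ a ℕ.<_) (tf i₀<n) q

    Iv : Fin n → Fin n → Set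
    Iv = Involved M fi fj fj₀ fi₀
    Nw : Fin n → Fin n → Set
    Nw = NewOne M fi fj fj₀ fi₀

    tfi : toℕ fi ≡ r
    tfi = tf r<n
    tfi₀ : toℕ fi₀ ≡ i₀
    tfi₀ = tf i₀<n
    tfj : toℕ fj ≡ j
    tfj = tf j<n
    tfj₀ : toℕ fj₀ ≡ j₀
    tfj₀ = tf j₀<n

    involved-cases : ∀ {a b} → Iv a b → (toℕ a ≡ r × toℕ b ≡ j₀) ⊎ (toℕ a ≡ i₀ × toℕ b ≡ j)
    involved-cases {a} {b} ((o , _ , _ , _) , ia , ai0 , j0b , bj) =
      ones-in-rectangle (toℕ a) (toℕ b) (subst (ℕ._≤ toℕ a) tfi ia) (subst (toℕ a ℕ.≤_) tfi₀ ai0)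
          (subst (toℕ b ℕ.≤_) tfj bj)
        (trans (sym (at-M a b)) o)

    fj₀≤fj : toℕ fj₀ ℕ.≤ toℕ fj
    fj₀≤fj = subst₂ ℕ._≤_ (sym tfj₀) (sym tfj) (ℕₚ.<⇒≤ j₀<j)
    fi≤fi₀ : toℕ fi ℕ.≤ toℕ fi₀
    fi≤fi₀ = subst₂ ℕ._≤_ (sym tfi) (sym tfi₀) (ℕₚ.<⇒≤ r<i₀)

    involved-west : Iv fi fj₀
    involved-west = (proj₁ (proj₂ nearest-west) , ℕₚ.≤-refl , fj₀≤fj , maximal) , ℕₚ.≤-refl , fi≤fi₀ ,
        ℕₚ.≤-refl , fj₀≤fj
      where
      maximal : ∀ c d → at M c d ≡ 1ℤ → c Fin.≤ fi → fj₀ Fin.≤ d → fi Fin.≤ c → d Fin.≤ fj → (c ≡ fi × d ≡ fj₀)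
      maximal c d e ci jd ic dj with ℕₚ.≤-antisym ci ic
      ... | ce with ones-in-rectangle (toℕ c) (toℕ d) (ℕₚ.≤-reflexive (trans (sym tfi) (sym ce)))
          (ℕₚ.≤-trans (ℕₚ.≤-reflexive (trans ce tfi)) (ℕₚ.<⇒≤ r<i₀))
                     (subst (toℕ d ℕ.≤_) tfj dj) (trans (sym (at-M c d)) e)
      ...   | inj₁ (x , y) = fin-≡ r<n x , fin-≡ j₀<n y
      ...   | inj₂ (x , y) = ⊥-elim (ℕₚ.<-irrefl (trans (sym (trans ce tfi)) x) r<i₀)

    involved-south : Iv fi₀ fj
    involved-south = (proj₁ (proj₂ nearest-south) , fi≤fi₀ , ℕₚ.≤-refl , maximal) , fi≤fi₀ , ℕₚ.≤-refl , fj₀≤fj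
        , ℕₚ.≤-refl
      where
      maximal : ∀ c d → at M c d ≡ 1ℤ → c Fin.≤ fi₀ → fj Fin.≤ d → fi Fin.≤ c → d Fin.≤ fj → (c ≡ fi₀ × d ≡ fj)
      maximal c d e ci jd ic dj with ℕₚ.≤-antisym dj jd
      ... | de with ones-in-rectangle (toℕ c) (toℕ d) (subst (ℕ._≤ toℕ c) tfi ic) (subst (toℕ c ℕ.≤_) tfi₀ ci)
                     (ℕₚ.≤-reflexive (trans de tfj)) (trans (sym (at-M c d)) e)
      ...   | inj₂ (x , y) = fin-≡ i₀<n x , fin-≡ j<n y
      ...   | inj₁ (x , y) = ⊥-elim (ℕₚ.<-irrefl (trans (sym y) (trans de tfj)) j₀<j)

    new-one-cases : ∀ {p q} → Nw p q → toℕ p ≡ i₀ × toℕ q ≡ j₀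
    new-one-cases ((a , iva) , (d , ivd , qd , _)) with involved-cases iva | involved-cases ivd
    ... | inj₁ (_ , x) | inj₂ (y , _) = y , x
    ... | inj₁ (_ , x) | inj₁ (_ , z) = ⊥-elim (ℕₚ.<-irrefl (trans x (sym z)) qd)
    ... | inj₂ (_ , x) | inj₁ (_ , z) = ⊥-elim (ℕₚ.<-irrefl refl (ℕₚ.<-trans (subst₂ ℕ._<_ x z qd) j₀<j))
    ... | inj₂ (_ , x) | inj₂ (_ , z) = ⊥-elim (ℕₚ.<-irrefl (trans x (sym z)) qd)

    new-one : Nw fi₀ fj₀
    new-one = (fi , involved-west) , (fj , involved-south , subst₂ ℕ._<_ (sym tfj₀) (sym tfj) j₀<j ,
        least-beyond)
      where
      least-beyond : ∀ a' e → Iv a' e → fj₀ Fin.< e → ¬ (e Fin.< fj)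
      least-beyond a' e iv p q with involved-cases iv
      ... | inj₁ (_ , x) = ℕₚ.<-irrefl (trans tfj₀ (sym x)) p
      ... | inj₂ (_ , x) = ℕₚ.<-irrefl (trans x (sym tfj)) q

    removed : ∀ p q → (p ≡ fi × q ≡ fj) → at M′ p q ≡ 0ℤ
    removed p q (refl , refl) rewrite at-M′ fi fj | tfi | tfj | entry′-r j = δ-≢ (λ h → ℕₚ.<-irrefl h j<r+1)

    new : ∀ p q → Nw p q → at M′ p q ≡ 1ℤ
    new p q x with new-one-cases x
    ... | a , b rewrite at-M′ p q | a | b | entry′-i₀ j₀ = δ-refl j₀

    involved : ∀ p q → Iv p q → ¬ Nw p q → at M′ p q ≡ 0ℤ
    involved p q iv _ with involved-cases iv
    ... | inj₁ (a , b) rewrite at-M′ p q | a | b | entry′-r j₀ = δ-≢ {suc r} {j₀}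
        (λ h → ℕₚ.<-irrefl h (ℕₚ.<-trans j₀<j j<r+1))
    ... | inj₂ (a , b) rewrite at-M′ p q | a | b | entry′-i₀ j = δ-≢ {j₀} {j} (λ h → ℕₚ.<-irrefl (sym h) j₀<j)

    unchanged-entry : ∀ p q → ¬ (p ≡ fi × q ≡ fj) → ¬ Nw p q → ¬ Iv p q → bandEntry ν′ (toℕ p) (toℕ q) ≡
        bandEntry ν (toℕ p) (toℕ q)
    unchanged-entry p q ¬removed ¬new ¬involved with ℕₚ.<-cmp (toℕ p) r
    ... | tri< a _ _ = entry′-outside (toℕ p) (toℕ q) (inj₁ a)
    ... | tri≈ _ a _ = trans (cong (λ u → bandEntry ν′ u (toℕ q)) a)
        (trans (entry′-r (toℕ q)) (sym (trans (cong (λ u → bandEntry ν u (toℕ q)) a) entry-r)))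
      where
      p≡fi : p ≡ fi
      p≡fi = fin-≡ r<n a
      q≢j : toℕ q ≢ j
      q≢j h = ¬removed (p≡fi , fin-≡ j<n h)
      q≢j₀ : toℕ q ≢ j₀
      q≢j₀ h = ¬involved (subst₂ Iv (sym p≡fi) (sym (fin-≡ j₀<n h)) involved-west)
      entry-r : bandEntry ν r (toℕ q) ≡ δ (suc r) (toℕ q)
      entry-r rewrite δ-≢ {j₀} {toℕ q} q≢j₀ | δ-≢ {j} {toℕ q} q≢j = ℤₚ.+-identityˡ _
    ... | tri> _ _ a with ℕₚ.<-cmp (toℕ p) i₀
    ...   | tri< b _ _ = trans (entry′-between (toℕ p) (toℕ q) a b) (sym (entry-between (toℕ p) (toℕ q) a b))
    ...   | tri> _ _ b = entry′-outside (toℕ p) (toℕ q) (inj₂ b)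
    ...   | tri≈ _ b _ = trans (cong (λ u → bandEntry ν′ u (toℕ q)) b) (trans (entry′-i₀ (toℕ q))
                           (trans (trans (δ-≢ q≢j₀) (sym (δ-≢ q≢j)))
                               (sym (trans (cong (λ u → bandEntry ν u (toℕ q)) b) (entry-i₀ (toℕ q))))))
      where
      p≡fi₀ : p ≡ fi₀
      p≡fi₀ = fin-≡ i₀<n b
      q≢j : toℕ q ≢ j
      q≢j h = ¬involved (subst₂ Iv (sym p≡fi₀) (sym (fin-≡ j<n h)) involved-south)
      q≢j₀ : toℕ q ≢ j₀
      q≢j₀ h = ¬new (subst₂ Nw (sym p≡fi₀) (sym (fin-≡ j₀<n h)) new-one)

    other : ∀ p q → ¬ (p ≡ fi × q ≡ fj) → ¬ Nw p q → ¬ Iv p q → at M′ p q ≡ at M p q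
    other p q ¬removed ¬new ¬involved = trans (at-M′ p q)
        (trans (unchanged-entry p q ¬removed ¬new ¬involved) (sym (at-M p q)))

    step : Step M M′
    step = fi , fj , fj₀ , fi₀ , removable , nearest-west , nearest-south , removed , new , involved , other

  key-chain : ∀ {n} fuel (ν : ℕ → ℕ) → BandSequence n ν → sumℕ ν (suc n) ℕ.< fuel →
              ∃[ μ ] (BandSequence n μ × (∀ a → a ℕ.< n → NoNegRow μ a) ×
                      Star StepRel (bandMatrix n ν) (bandMatrix n μ))
  key-chain {n} (suc fuel) ν seq bound with greatest-below (λ a → ¬? (noNegRow? ν a)) n
  ... | inj₂ none = ν , seq , (λ a a<n → decidable-stable (noNegRow? ν a) (none a a<n)) , ε
  ... | inj₁ (r , r<n , neg , later) =
    let (μ , seqμ , noNeg , steps) = key-chain fuel R.ν′ R.ν′-band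
          (ℕₚ.<-≤-trans R.sum-decreases (ℕₚ.≤-pred bound))
    in μ , seqμ , noNeg , (R.step ◅ steps)
    where
    module R = RemoveLastNegative ν seq r r<n neg (λ b r<b b<n → decidable-stable (noNegRow? ν b)
        (later b r<b b<n))

  -- In the permutation matrix of a band sequence without negative rows, a 1
  -- in row a lies in column a + 1 or at μ a, and μ only grows; so of two 1s
  -- below row a and left of its 1, the lower one lies to the right of the upper.
  module PermutationBand {n : ℕ} {μ : ℕ → ℕ} (seq : BandSequence n μ)
      (no-neg : ∀ a → a ℕ.< n → NoNegRow μ a) where
    open BandSequence seq
    private K = bandMatrix n μ

    no-−1 : ∀ i j → at K i j ≢ -1ℤ
    no-−1 i j e = bit≢-1 (noNegRow-bit μ (toℕ i) (toℕ j) (no-neg (toℕ i) (Finₚ.toℕ<n i)))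
                         (trans (sym (at-bandMatrix n μ i j)) e)

    monotone′ : ∀ x y → x ℕ.≤ y → y ℕ.≤ n → μ x ℕ.≤ μ y
    monotone′ x zero z≤n _ = ℕₚ.≤-refl
    monotone′ x (suc y) x≤y+1 y+1≤n with ℕₚ.m≤n⇒m<n∨m≡n x≤y+1
    ... | inj₂ refl = ℕₚ.≤-refl
    ... | inj₁ x<y+1 = ℕₚ.≤-trans (monotone′ x y (ℕₚ.≤-pred x<y+1) (ℕₚ.<⇒≤ y+1≤n)) (monotone y y+1≤n)

    data OneAt (a c : ℕ) : Set where
      stay : μ (suc a) ≡ μ a → c ≡ suc a → OneAt a c
      jump : μ (suc a) ≡ suc a → c ≡ μ a → OneAt a c

    one-at : ∀ a c → a ℕ.< n → bandEntry μ a c ≡ 1ℤ → OneAt a c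
    one-at a c a<n e with no-neg a a<n
    ... | inj₁ s = stay s (δ≡1⇒≡ (trans (sym (bandEntry-stay μ a c s)) e))
    ... | inj₂ j = jump j (δ≡1⇒≡ (trans (sym (bandEntry-jump μ a c j)) e))

    μ≤one : ∀ a c → a ℕ.< n → bandEntry μ a c ≡ 1ℤ → μ a ℕ.≤ c
    μ≤one a c a<n e with one-at a c a<n e
    ... | stay _ refl = ℕₚ.≤-trans (ν≤id a a<n) (ℕₚ.n≤1+n a)
    ... | jump _ refl = ℕₚ.≤-refl

    right-of-jump : ∀ a b c → a ℕ.< b → b ℕ.< n → μ (suc a) ≡ suc a → bandEntry μ b c ≡ 1ℤ → suc a ℕ.≤ c
    right-of-jump a b c a<b b<n j e =
      ℕₚ.≤-trans (ℕₚ.≤-reflexive (sym j)) (ℕₚ.≤-trans (monotone′ (suc a) b a<b (ℕₚ.<⇒≤ b<n)) (μ≤one b c b<n e))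

    no-two-ones-left-below : ∀ {r₀ r₁ r₂ c₀ c₁ c₂} → r₀ ℕ.< r₁ → r₁ ℕ.< r₂ → r₂ ℕ.< n →
           bandEntry μ r₀ c₀ ≡ 1ℤ → bandEntry μ r₁ c₁ ≡ 1ℤ → bandEntry μ r₂ c₂ ≡ 1ℤ → c₁ ℕ.< c₀ → c₂ ℕ.< c₀ → ⊥
    no-two-ones-left-below {r₀} {r₁} {r₂} {c₀} {c₁} {c₂} r₀<r₁ r₁<r₂ r₂<n e₀ e₁ e₂ c₁<c₀ c₂<c₀
      with one-at r₀ c₀ (ℕₚ.<-trans r₀<r₁ (ℕₚ.<-trans r₁<r₂ r₂<n)) e₀
    ... | jump j refl =
      ℕₚ.<-irrefl refl (ℕₚ.<-≤-trans c₁<c₀ (ℕₚ.≤-trans (ℕₚ.≤-trans (ν≤id r₀ r₀<n) (ℕₚ.n≤1+n r₀))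
                                                       (right-of-jump r₀ r₁ c₁ r₀<r₁ r₁<n j e₁)))
      where
      r₁<n = ℕₚ.<-trans r₁<r₂ r₂<n
      r₀<n = ℕₚ.<-trans r₀<r₁ r₁<n
    ... | stay _ refl with one-at r₁ c₁ (ℕₚ.<-trans r₁<r₂ r₂<n) e₁
    ...   | stay _ refl = ℕₚ.<-asym r₀<r₁ (ℕₚ.≤-pred c₁<c₀)
    ...   | jump j refl =
      ℕₚ.<-irrefl refl (ℕₚ.<-≤-trans c₂<c₀ (ℕₚ.≤-trans r₀<r₁ (ℕₚ.≤-trans (ℕₚ.n≤1+n r₁)
                                                       (right-of-jump r₁ r₂ c₂ r₁<r₂ r₂<n j e₂))))

    avoids : ∀ (π : Vec ℕ 3) → lookup π (Fin.suc Fin.zero) ℕ.< lookup π Fin.zero →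
             lookup π (Fin.suc (Fin.suc Fin.zero)) ℕ.< lookup π Fin.zero → Avoids K π
    avoids π π₁<π₀ π₂<π₀ (rows , cols , rows-increase , ones , same-order) =
      no-two-ones-left-below (rows-increase z₀ z₁ (s≤s z≤n)) (rows-increase z₁ z₂ (s≤s (s≤s z≤n)))
          (Finₚ.toℕ<n (rows z₂))
        (one z₀) (one z₁) (one z₂)
        (Equivalence.from (same-order z₁ z₀) π₁<π₀) (Equivalence.from (same-order z₂ z₀) π₂<π₀)
      where
      z₀ z₁ z₂ : Fin 3
      z₀ = Fin.zero
      z₁ = Fin.suc Fin.zero
      z₂ = Fin.suc (Fin.suc Fin.zero)
      one : ∀ a → bandEntry μ (toℕ (rows a)) (toℕ (cols a)) ≡ 1ℤ
      one a = trans (sym (at-bandMatrix n μ (rows a) (cols a))) (ones a)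

    avoids-312 : Avoids K p312
    avoids-312 = avoids p312 (s≤s (s≤s z≤n)) (s≤s (s≤s (s≤s z≤n)))

    avoids-321 : Avoids K p321
    avoids-321 = avoids p321 (s≤s (s≤s (s≤s z≤n))) (s≤s (s≤s z≤n))

  bandMatrix-counted : ∀ {n ν} → BandSequence n ν → Counted (bandMatrix n ν)
  bandMatrix-counted {n} {ν} seq =
    let (μ , seqμ , no-neg , steps) = key-chain (suc (sumℕ ν (suc n))) ν seq ℕₚ.≤-refl
        open PermutationBand seqμ no-neg
    in BandMatrixOf.isASM seq , bandMatrix n μ , (steps , no-−1) , avoids-312 , avoids-321

module BallotNumbers where

  open import Data.Nat as ℕ using (ℕ; zero; suc; s≤s; _+_; _*_)
  import Data.Nat.Properties as ℕₚ
  open import Data.Nat.Combinatorics using (_C_; nCk+nC[k+1]≡[n+1]C[k+1]; nCk≡nC[n∸k]; nC1≡n)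
  open import Data.Nat.DivMod using (_/_; m*n/n≡m)
  open import Data.Nat.Tactic.RingSolver using (solve-∀)
  open import Relation.Binary.PropositionalEquality
  open import Defs using (catalan)

  Cpred : ℕ → ℕ → ℕ
  Cpred a zero = 0
  Cpred a (suc k) = a C k

  pascal : ∀ a k → suc a C suc k ≡ a C k + a C suc k
  pascal a k = sym (nCk+nC[k+1]≡[n+1]C[k+1] a k)

  pascal′ : ∀ a k → suc a C k ≡ Cpred a k + a C k
  pascal′ a zero = refl
  pascal′ a (suc k) = pascal a k

  absorption : ∀ a j → suc j * (suc a C suc j) ≡ suc a * (a C j)
  absorption zero zero = refl
  absorption zero (suc j) = ℕₚ.*-zeroʳ (suc (suc j))
  absorption (suc a) zero = trans (ℕₚ.+-identityʳ _)
      (trans (nC1≡n (suc (suc a))) (sym (ℕₚ.*-identityʳ (suc (suc a)))))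
  absorption (suc a) (suc j) =
    begin
      suc (suc j) * (suc (suc a) C suc (suc j))
    ≡⟨ cong (suc (suc j) *_) (pascal (suc a) (suc j)) ⟩
      suc (suc j) * (P + Q2)
    ≡⟨ lem (suc j) P Q2 ⟩
      suc j * P + P + suc (suc j) * Q2
    ≡⟨ cong₂ (λ z w → z + P + w) (absorption a j) (absorption a (suc j)) ⟩
      suc a * Aj + P + suc a * Asj
    ≡⟨ fin (suc a) Aj Asj P (pascal a j) ⟩
      suc (suc a) * P
    ∎
    where
    open ≡-Reasoning
    P = suc a C suc j
    Q2 = suc a C suc (suc j)
    Aj = a C j
    Asj = a C suc j
    lem : ∀ x y z → suc x * (y + z) ≡ x * y + y + suc x * z
    lem = solve-∀
    fin : ∀ s x y p → p ≡ x + y → s * x + p + s * y ≡ suc s * p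
    fin s x y p refl = lem2 s x y
      where
      lem2 : ∀ s x y → s * x + (x + y) + s * y ≡ suc s * (x + y)
      lem2 = solve-∀

  absorption-sum : ∀ a j → suc j * (a C suc j) + j * (a C j) ≡ a * (a C j)
  absorption-sum zero zero = refl
  absorption-sum zero (suc j) = cong₂ _+_ (ℕₚ.*-zeroʳ (suc (suc j))) (ℕₚ.*-zeroʳ (suc j))
  absorption-sum (suc a) zero = trans (ℕₚ.+-identityʳ _) (absorption a 0)
  absorption-sum (suc a) (suc j) =
    begin
      suc (suc j) * (suc a C suc (suc j)) + suc j * (suc a C suc j)
    ≡⟨ cong₂ _+_ (absorption a (suc j)) (absorption a j) ⟩
      suc a * (a C suc j) + suc a * (a C j)
    ≡⟨ sym (ℕₚ.*-distribˡ-+ (suc a) (a C suc j) (a C j)) ⟩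
      suc a * ((a C suc j) + (a C j))
    ≡⟨ cong (suc a *_) (trans (ℕₚ.+-comm (a C suc j) (a C j)) (sym (pascal a j))) ⟩
      suc a * (suc a C suc j)
    ∎
    where
    open ≡-Reasoning

  -- ballot l c counts the vectors of BallotVec of length l whose first entry
  -- has c + 1 possible values.
  ballot : ℕ → ℕ → ℕ
  ballotSum : ℕ → ℕ → ℕ
  ballot zero c = 1
  ballot (suc l) c = ballotSum l c
  ballotSum l zero = ballot l 1
  ballotSum l (suc c) = ballot l (suc (suc c)) + ballotSum l c

  width : ℕ → ℕ → ℕ
  width l c = l + l + c

  width-sucˡ : ∀ l c → width (suc l) c ≡ suc (suc (width l c))
  width-sucˡ l c = lem l c
    where
    lem : ∀ l c → suc l + suc l + c ≡ suc (suc (l + l + c))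
    lem = solve-∀

  width-sucʳ : ∀ l c → width l (suc c) ≡ suc (width l c)
  width-sucʳ l c = ℕₚ.+-suc (l + l) c

  central-binomial-sym : ∀ k → suc (k + k) C suc k ≡ suc (k + k) C k
  central-binomial-sym k = trans (nCk≡nC[n∸k] (s≤s (ℕₚ.m≤n+m k k))) (cong (suc (k + k) C_) (ℕₚ.m+n∸n≡m k k))

  ballot-closed-form : ∀ l c → ballot l c + Cpred (width l c) l ≡ width l c C l
  ballotSum-closed-form : ∀ l c → ballotSum l c + suc (suc (width l c)) C l ≡ suc (suc (width l c)) C suc l

  ballot-closed-form zero c = refl
  ballot-closed-form (suc l) c = subst (λ z → ballotSum l c + Cpred z (suc l) ≡ z C suc l)
      (sym (width-sucˡ l c)) (ballotSum-closed-form l c)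

  ballotSum-closed-form l zero =
    begin
      ballot l 1 + suc a C l
    ≡⟨ cong (ballot l 1 +_) (pascal′ a l) ⟩
      ballot l 1 + (Cpred a l + a C l)
    ≡⟨ sym (ℕₚ.+-assoc (ballot l 1) (Cpred a l) (a C l)) ⟩
      ballot l 1 + Cpred a l + a C l
    ≡⟨ cong (_+ a C l) cl ⟩
      a C l + a C l
    ≡⟨ cong (a C l +_) (sym sy) ⟩
      a C l + a C suc l
    ≡⟨ sym (pascal a l) ⟩
      suc a C suc l
    ∎
    where
    open ≡-Reasoning
    a = suc (width l 0)
    cl : ballot l 1 + Cpred a l ≡ a C l
    cl = subst (λ z → ballot l 1 + Cpred z l ≡ z C l) (width-sucʳ l 0) (ballot-closed-form l 1)
    sy : a C suc l ≡ a C l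
    sy = subst (λ z → suc z C suc l ≡ suc z C l) (sym (ℕₚ.+-identityʳ (l + l))) (central-binomial-sym l)
  ballotSum-closed-form l (suc c) =
    begin
      ballot l (suc (suc c)) + ballotSum l c + suc (suc (width l (suc c))) C l
    ≡⟨ cong (λ z → ballot l (suc (suc c)) + ballotSum l c + suc (suc z) C l) (width-sucʳ l c) ⟩
      ballot l (suc (suc c)) + ballotSum l c + suc (suc (suc d)) C l
    ≡⟨ cong (ballot l (suc (suc c)) + ballotSum l c +_) (pascal′ (suc (suc d)) l) ⟩
      ballot l (suc (suc c)) + ballotSum l c + (Cpred (suc (suc d)) l + suc (suc d) C l)
    ≡⟨ lem (ballot l (suc (suc c))) (ballotSum l c) (Cpred (suc (suc d)) l) (suc (suc d) C l) ⟩
      (ballot l (suc (suc c)) + Cpred (suc (suc d)) l) + (ballotSum l c + suc (suc d) C l)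
    ≡⟨ cong₂ _+_ cl (ballotSum-closed-form l c) ⟩
      suc (suc d) C l + suc (suc d) C suc l
    ≡⟨ sym (pascal (suc (suc d)) l) ⟩
      suc (suc (suc d)) C suc l
    ≡⟨ cong (λ z → suc (suc z) C suc l) (sym (width-sucʳ l c)) ⟩
      suc (suc (width l (suc c))) C suc l
    ∎
    where
    open ≡-Reasoning
    d = width l c
    lem : ∀ x y z w → x + y + (z + w) ≡ (x + z) + (y + w)
    lem = solve-∀
    e2 : width l (suc (suc c)) ≡ suc (suc d)
    e2 = trans (width-sucʳ l (suc c)) (cong suc (width-sucʳ l c))
    cl : ballot l (suc (suc c)) + Cpred (suc (suc d)) l ≡ suc (suc d) C l
    cl = subst (λ z → ballot l (suc (suc c)) + Cpred z l ≡ z C l) e2 (ballot-closed-form l (suc (suc c)))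

  binomial-ratio : ∀ k → suc (suc k) * Cpred (suc (k + k)) k ≡ k * (suc (k + k) C k)
  binomial-ratio zero = refl
  binomial-ratio (suc k) = ℕₚ.+-cancelʳ-≡ (k * X) (suc (suc (suc k)) * X) (suc k * Y)
      (trans (lem k X) (trans (cong (_* X) (ea k)) (sym (absorption-sum a k))))
    where
    a = suc (suc k + suc k)
    X = a C k
    Y = a C suc k
    lem : ∀ k X → suc (suc (suc k)) * X + k * X ≡ suc (suc (suc (k + k))) * X
    lem = solve-∀
    ea : ∀ k → suc (suc (suc (k + k))) ≡ suc (suc k + suc k)
    ea = solve-∀

  ballot-doubled : ∀ k → ballot k 1 * suc (suc k) ≡ suc (k + k) C k + suc (k + k) C k
  ballot-doubled k = ℕₚ.+-cancelʳ-≡ (k * Y) (ballot k 1 * suc (suc k)) (Y + Y) e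
    where
    Y = suc (k + k) C k
    X = Cpred (suc (k + k)) k
    a1 : width k 1 ≡ suc (k + k)
    a1 = trans (width-sucʳ k 0) (cong suc (ℕₚ.+-identityʳ (k + k)))
    cl : ballot k 1 + X ≡ Y
    cl = subst (λ z → ballot k 1 + Cpred z k ≡ z C k) a1 (ballot-closed-form k 1)
    e : ballot k 1 * suc (suc k) + k * Y ≡ Y + Y + k * Y
    e = begin
        ballot k 1 * suc (suc k) + k * Y
      ≡⟨ cong (ballot k 1 * suc (suc k) +_) (sym (binomial-ratio k)) ⟩
        ballot k 1 * suc (suc k) + suc (suc k) * X
      ≡⟨ l1 (ballot k 1) X k ⟩
        suc (suc k) * (ballot k 1 + X)
      ≡⟨ cong (suc (suc k) *_) cl ⟩
        suc (suc k) * Y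
      ≡⟨ l2 k Y ⟩
        Y + Y + k * Y
      ∎
      where
      open ≡-Reasoning
      l1 : ∀ b x k → b * suc (suc k) + suc (suc k) * x ≡ suc (suc k) * (b + x)
      l1 = solve-∀
      l2 : ∀ k y → suc (suc k) * y ≡ y + y + k * y
      l2 = solve-∀

  catalan≡ballot : ∀ k → catalan (suc k) ≡ ballot k 1
  catalan≡ballot k = begin
      catalan (suc k)
    ≡⟨ cong (λ z → (z C suc k) / suc (suc k)) (e2k k) ⟩
      (suc (suc (k + k)) C suc k) / suc (suc k)
    ≡⟨ cong (_/ suc (suc k)) (trans (pascal (suc (k + k)) k) (cong (Y +_) (central-binomial-sym k))) ⟩
      (Y + Y) / suc (suc k)
    ≡⟨ cong (_/ suc (suc k)) (sym (ballot-doubled k)) ⟩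
      (ballot k 1 * suc (suc k)) / suc (suc k)
    ≡⟨ m*n/n≡m (ballot k 1) (suc (suc k)) ⟩
      ballot k 1
    ∎
    where
    open ≡-Reasoning
    e2k : ∀ k → 2 * suc k ≡ suc (suc (k + k))
    e2k = solve-∀
    Y = suc (k + k) C k

module BallotEnumeration where

  open import Data.Nat as ℕ using (ℕ; zero; suc; z≤n; s≤s; _+_; _∸_)
  import Data.Nat.Properties as ℕₚ
  open import Data.Fin as Fin using (Fin; _↑ˡ_; _↑ʳ_)
  import Data.Fin.Properties as Finₚ
  open import Data.Vec as Vec using (Vec; []; _∷_)
  import Data.Vec.Properties as Vecₚ
  open import Data.Unit using (⊤; tt)
  open import Data.Empty using (⊥-elim)
  open import Data.Sum using (inj₁; inj₂)
  open import Data.Product using (Σ; ∃-syntax; _×_; _,_; proj₁; proj₂)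
  open import Relation.Nullary using (yes; no)
  open import Relation.Binary.PropositionalEquality
  open import Defs using (catalan)
  open BallotNumbers using (ballot; ballotSum; catalan≡ballot)

  sumFrom : (ℕ → ℕ) → ℕ → ℕ → ℕ
  sumFrom h lo zero = 0
  sumFrom h lo (suc m) = h lo + sumFrom h (suc lo) m

  ballotCount : ℕ → ℕ → ℕ → ℕ
  ballotCount zero lo top = 1
  ballotCount (suc len) lo top = sumFrom (λ w → ballotCount len w (suc top)) lo (suc top ∸ lo)

  sumFrom-ballotCount : ∀ l top → (∀ w → w ℕ.≤ suc top → ballotCount l w (suc top) ≡ ballot l (suc top ∸ w)) →
        ∀ m lo → lo + m ≡ top → sumFrom (λ w → ballotCount l w (suc top)) lo (suc m) ≡ ballotSum l m
  sumFrom-ballotCount l top ih zero lo e rewrite ℕₚ.+-identityʳ lo | e =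
    trans (ℕₚ.+-identityʳ _) (trans (ih top (ℕₚ.n≤1+n top)) (cong (ballot l) (ℕₚ.m+n∸n≡m 1 top)))
  sumFrom-ballotCount l top ih (suc m) lo e =
    cong₂ _+_ (trans (ih lo lo≤) (cong (ballot l) d))
        (sumFrom-ballotCount l top ih m (suc lo) (trans (sym (ℕₚ.+-suc lo m)) e))
    where
    lo≤ : lo ℕ.≤ suc top
    lo≤ = ℕₚ.≤-trans (ℕₚ.m≤m+n lo (suc m)) (ℕₚ.≤-trans (ℕₚ.≤-reflexive e) (ℕₚ.n≤1+n top))
    d : suc top ∸ lo ≡ suc (suc m)
    d = trans (cong (λ z → suc z ∸ lo) (sym e)) (trans (ℕₚ.+-∸-assoc 1 (ℕₚ.m≤m+n lo (suc m)))
        (cong suc (ℕₚ.m+n∸m≡n lo (suc m))))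

  ballotCount≡ballot : ∀ len lo top → lo ℕ.≤ top → ballotCount len lo top ≡ ballot len (top ∸ lo)
  ballotCount≡ballot zero lo top h = refl
  ballotCount≡ballot (suc l) lo top h =
    trans (cong (sumFrom (λ w → ballotCount l w (suc top)) lo) (ℕₚ.+-∸-assoc 1 h))
      (sumFrom-ballotCount l top (λ w p → ballotCount≡ballot l w (suc top) p) (top ∸ lo) lo (ℕₚ.m+[n∸m]≡n h))

  catalan≡ballotCount : ∀ k → catalan (suc k) ≡ ballotCount k 0 1
  catalan≡ballotCount k = trans (catalan≡ballot k) (sym (ballotCount≡ballot k 0 1 z≤n))

  data SplitView (a b : ℕ) (x : Fin (a + b)) : Set where
    isL : ∀ z → x ≡ z ↑ˡ b → SplitView a b x
    isR : ∀ y → x ≡ a ↑ʳ y → SplitView a b x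

  splitView : ∀ a b x → SplitView a b x
  splitView a b x with Fin.splitAt a x in eq
  ... | inj₁ z = isL z (trans (sym (Finₚ.join-splitAt a b x)) (cong (Fin.join a b) eq))
  ... | inj₂ y = isR y (trans (sym (Finₚ.join-splitAt a b x)) (cong (Fin.join a b) eq))

  fromSumFin : ∀ (h : ℕ → ℕ) lo m → Fin (sumFrom h lo m) → Σ ℕ (λ w → Fin (h w))
  fromSumFin h lo (suc m) x with Fin.splitAt (h lo) x
  ... | inj₁ z = lo , z
  ... | inj₂ y = fromSumFin h (suc lo) m y

  fromSumFin-↑ˡ : ∀ h lo m z → fromSumFin h lo (suc m) (z ↑ˡ sumFrom h (suc lo) m) ≡ (lo , z)
  fromSumFin-↑ˡ h lo m z rewrite Finₚ.splitAt-↑ˡ (h lo) z (sumFrom h (suc lo) m) = refl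

  fromSumFin-↑ʳ : ∀ h lo m y → fromSumFin h lo (suc m) (h lo ↑ʳ y) ≡ fromSumFin h (suc lo) m y
  fromSumFin-↑ʳ h lo m y rewrite Finₚ.splitAt-↑ʳ (h lo) (sumFrom h (suc lo) m) y = refl

  fromSumFin-range : ∀ h lo m x → lo ℕ.≤ proj₁ (fromSumFin h lo m x) × proj₁ (fromSumFin h lo m x) ℕ.< lo + m
  fromSumFin-range h lo (suc m) x with splitView (h lo) (sumFrom h (suc lo) m) x
  ... | isL z refl rewrite fromSumFin-↑ˡ h lo m z = ℕₚ.≤-refl , ℕₚ.m<m+n lo (s≤s z≤n)
  ... | isR y refl rewrite fromSumFin-↑ʳ h lo m y with fromSumFin-range h (suc lo) m y
  ...   | a , b = ℕₚ.<⇒≤ a , subst (proj₁ (fromSumFin h (suc lo) m y) ℕ.<_) (sym (ℕₚ.+-suc lo m)) b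

  fromSumFin-injective : ∀ h lo m x x' → fromSumFin h lo m x ≡ fromSumFin h lo m x' → x ≡ x'
  fromSumFin-injective h lo (suc m) x x' e with splitView (h lo) (sumFrom h (suc lo) m) x | splitView (h lo)
      (sumFrom h (suc lo) m) x'
  ... | isL z refl | isL z' refl rewrite fromSumFin-↑ˡ h lo m z | fromSumFin-↑ˡ h lo m z' with e
  ...   | refl = refl
  fromSumFin-injective h lo (suc m) x x' e | isL z refl | isR y' refl rewrite fromSumFin-↑ˡ h lo m z |
      fromSumFin-↑ʳ h lo m y' =
    ⊥-elim (ℕₚ.<-irrefl (cong proj₁ e) (proj₁ (fromSumFin-range h (suc lo) m y')))
  fromSumFin-injective h lo (suc m) x x' e | isR y refl | isL z' refl rewrite fromSumFin-↑ˡ h lo m z' |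
      fromSumFin-↑ʳ h lo m y =
    ⊥-elim (ℕₚ.<-irrefl (sym (cong proj₁ e)) (proj₁ (fromSumFin-range h (suc lo) m y)))
  fromSumFin-injective h lo (suc m) x x' e | isR y refl | isR y' refl rewrite fromSumFin-↑ʳ h lo m y |
      fromSumFin-↑ʳ h lo m y' =
    cong (h lo ↑ʳ_) (fromSumFin-injective h (suc lo) m y y' e)

  toSumFin : ∀ h lo m w → lo ℕ.≤ w → w ℕ.< lo + m → Fin (h w) → Fin (sumFrom h lo m)
  toSumFin h lo zero w p q z = ⊥-elim (ℕₚ.<-irrefl refl (ℕₚ.<-≤-trans (subst (w ℕ.<_) (ℕₚ.+-identityʳ lo) q) p))
  toSumFin h lo (suc m) w p q z with lo ℕₚ.≟ w
  ... | yes refl = z ↑ˡ sumFrom h (suc lo) m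
  ... | no ne = h lo ↑ʳ toSumFin h (suc lo) m w (ℕₚ.≤∧≢⇒< p ne) (subst (w ℕ.<_) (ℕₚ.+-suc lo m) q) z

  fromSumFin-toSumFin : ∀ h lo m w p q z → fromSumFin h lo m (toSumFin h lo m w p q z) ≡ (w , z)
  fromSumFin-toSumFin h lo zero w p q z = ⊥-elim (ℕₚ.<-irrefl refl
      (ℕₚ.<-≤-trans (subst (w ℕ.<_) (ℕₚ.+-identityʳ lo) q) p))
  fromSumFin-toSumFin h lo (suc m) w p q z with lo ℕₚ.≟ w
  ... | yes refl = fromSumFin-↑ˡ h lo m z
  ... | no ne = trans (fromSumFin-↑ʳ h lo m _) (fromSumFin-toSumFin h (suc lo) m w _ _ z)

  decode : ∀ len lo top → Fin (ballotCount len lo top) → Vec ℕ len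
  decode zero lo top x = []
  decode (suc len) lo top x = proj₁ u ∷ decode len (proj₁ u) (suc top) (proj₂ u)
    where
    u = fromSumFin (λ w → ballotCount len w (suc top)) lo (suc top ∸ lo) x

  BallotVec : ∀ {len} → ℕ → ℕ → Vec ℕ len → Set
  BallotVec lo top [] = ⊤
  BallotVec lo top (w ∷ ws) = lo ℕ.≤ w × w ℕ.≤ top × BallotVec w (suc top) ws

  range-top : ∀ lo top w → lo ℕ.≤ w → w ℕ.< lo + (suc top ∸ lo) → w ℕ.≤ top
  range-top lo top w p q with ℕₚ.≤-total lo (suc top)
  ... | inj₁ h = ℕₚ.≤-pred (subst (w ℕ.<_) (ℕₚ.m+[n∸m]≡n h) q)
  ... | inj₂ h = ⊥-elim (ℕₚ.<-irrefl refl (ℕₚ.<-≤-trans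
      (subst (w ℕ.<_) (trans (cong (lo +_) (ℕₚ.m≤n⇒m∸n≡0 h)) (ℕₚ.+-identityʳ lo)) q) p))

  decode-ballotVec : ∀ len lo top x → BallotVec lo top (decode len lo top x)
  decode-ballotVec zero lo top x = tt
  decode-ballotVec (suc len) lo top x =
    proj₁ r , range-top lo top _ (proj₁ r) (proj₂ r) , decode-ballotVec len _ (suc top) _
    where
    r = fromSumFin-range (λ w → ballotCount len w (suc top)) lo (suc top ∸ lo) x

  decode-injective : ∀ len lo top x x' → decode len lo top x ≡ decode len lo top x' → x ≡ x'
  decode-injective zero lo top x x' e with x
  ... | Fin.zero with x'
  ...   | Fin.zero = refl
  decode-injective (suc len) lo top x x' e =
    fromSumFin-injective h lo (suc top ∸ lo) x x' (pairEq (fromSumFin h lo (suc top ∸ lo) x)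
        (fromSumFin h lo (suc top ∸ lo) x') (Vecₚ.∷-injectiveˡ e) (Vecₚ.∷-injectiveʳ e))
    where
    h = λ w → ballotCount len w (suc top)
    pairEq : ∀ (p p' : Σ ℕ (λ w → Fin (h w))) → proj₁ p ≡ proj₁ p' →
             decode len (proj₁ p) (suc top) (proj₂ p) ≡ decode len (proj₁ p') (suc top) (proj₂ p') → p ≡ p'
    pairEq (w , z) (.w , z') refl e2 rewrite decode-injective len w (suc top) z z' e2 = refl

  decode-surjective : ∀ len lo top (v : Vec ℕ len) → BallotVec lo top v → ∃[ x ] (decode len lo top x ≡ v)
  decode-surjective zero lo top [] _ = Fin.zero , refl
  decode-surjective (suc len) lo top (w ∷ ws) (p , q , vl) with decode-surjective len w (suc top) ws vl
  ... | z , ez = x , trans (cong (λ pr → proj₁ pr ∷ decode len (proj₁ pr) (suc top) (proj₂ pr))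
      (fromSumFin-toSumFin h lo (suc top ∸ lo) w p q' z))
                       (cong (w ∷_) ez)
    where
    h = λ w → ballotCount len w (suc top)
    q' : w ℕ.< lo + (suc top ∸ lo)
    q' = subst (w ℕ.<_) (sym (ℕₚ.m+[n∸m]≡n (ℕₚ.≤-trans p (ℕₚ.≤-trans q (ℕₚ.n≤1+n top))))) (s≤s q)
    x = toSumFin h lo (suc top ∸ lo) w p q' z

module BandDecomposition where

  open import Data.Nat as ℕ using (ℕ; zero; suc; z≤n; s≤s)
  import Data.Nat.Properties as ℕₚ
  open import Data.Integer as ℤ using (ℤ; 0ℤ; 1ℤ; -1ℤ; +_; _+_; _-_; -_)
  import Data.Integer.Properties as ℤₚ
  open import Data.Integer.Tactic.RingSolver using (solve-∀)
  open import Data.Fin as Fin using (toℕ)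
  import Data.Fin.Properties as Finₚ
  open import Data.Vec as Vec using (lookup)
  import Data.Vec.Properties as Vecₚ
  open import Data.Empty using (⊥-elim)
  open import Data.Sum using (inj₁; inj₂)
  open import Data.Product using (∃-syntax; _×_; _,_; proj₁; proj₂)
  open import Relation.Nullary using (¬_; yes; no)
  open import Relation.Binary.PropositionalEquality
  open import Relation.Binary.Definitions using (tri<; tri≈; tri>)
  open import Defs
  open PrefixSums
  open PrefixSumForm
  open BandMatrices
  open CountedAreBand using (Band)

  -- The first x rows of a band ASM have partial column sums in {0,1}, zero
  -- beyond column x and of total x, so exactly one column ν x ≤ x has partial
  -- sum 0; then A is the band matrix of ν.
  module BandASM {n : ℕ} (A : Matrix n) (asm : IsASM A) (band : Band A) where
    open PrefixForm (isASM⇒prefixForm A asm)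

    upper : ℕ → ℕ → ℤ
    upper x c = psum (λ a → entry A a c) x

    band-entry : ∀ a c → suc (suc a) ℕ.≤ c → entry A a c ≡ 0ℤ
    band-entry a c a+2≤c with index n a | index n c
    ... | outside p | _ = entry-below A a c p
    ... | inside _ | outside p = entry-right A a c p
    ... | inside i | inside j = trans (entry-at A i j) (band i j a+2≤c)

    upper-right : ∀ x c → x ℕ.< c → upper x c ≡ 0ℤ
    upper-right x c h = trans (psum-cong x (λ a p → band-entry a c (ℕₚ.≤-trans (s≤s p) h))) (psum-0 x)

    upper-total : ∀ x → x ℕ.≤ n → psum (λ c → upper x c) n ≡ + x
    upper-total x h = trans (sym (psum-swap (λ a c → entry A a c) x n))
        (trans (psum-cong x (λ a p → row-total a (ℕₚ.<-≤-trans p h))) (psum-1 x))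

    gaps-total : ∀ x → suc x ℕ.≤ n → psum (λ c → 1ℤ - upper x c) (suc x) ≡ 1ℤ
    gaps-total x x<n = begin
      psum (λ c → 1ℤ - upper x c) (suc x)        ≡⟨ psum-− (λ _ → 1ℤ) (upper x) (suc x) ⟩
      psum (λ _ → 1ℤ) (suc x) - psum (upper x) (suc x)
        ≡⟨ cong₂ _-_ (psum-1 (suc x)) (sym (psum-vanishing-tail (upper x) (suc x) n (upper-right x) x<n)) ⟩
      + suc x - psum (upper x) n                  ≡⟨ cong (λ t → + suc x - t) (upper-total x (ℕₚ.<⇒≤ x<n)) ⟩
      + suc x - + x                               ≡⟨ cong (_- + x) (cong +_ (ℕₚ.+-comm 1 x)) ⟩
      + x + 1ℤ - + x                              ≡⟨ cancel (+ x) ⟩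
      1ℤ                                          ∎
      where
      open ≡-Reasoning
      cancel : ∀ z → z + 1ℤ - z ≡ 1ℤ
      cancel = solve-∀

    gap-bit : ∀ x c → Bit (1ℤ - upper x c)
    gap-bit x c with col-bits c x
    ... | inj₁ e rewrite e = inj₂ refl
    ... | inj₂ e rewrite e = inj₁ refl

    gap⇒upper-0 : ∀ {x c} → 1ℤ - upper x c ≡ 1ℤ → upper x c ≡ 0ℤ
    gap⇒upper-0 {x} {c} e with col-bits c x
    ... | inj₁ z = z
    ... | inj₂ o rewrite o with e
    ...   | ()

    upper-0⇒gap : ∀ {x c} → upper x c ≡ 0ℤ → 1ℤ - upper x c ≡ 1ℤ
    upper-0⇒gap e rewrite e = refl

    unique-gap : ∀ x → suc x ℕ.≤ n → ∃[ c0 ] (c0 ℕ.≤ x × upper x c0 ≡ 0ℤ ×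
        (∀ c → c ℕ.≤ x → upper x c ≡ 0ℤ → c ≡ c0))
    unique-gap x h with psum≥1⇒one (suc x) (λ c → 1ℤ - upper x c) (λ c _ → gap-bit x c)
        (ℤₚ.≤-reflexive (sym (gaps-total x h)))
    ... | c0 , p , e = c0 , ℕₚ.≤-pred p , gap⇒upper-0 {x} {c0} e , uniq
      where
      bad : ¬ (+ 2 ℤ.≤ psum (λ c → 1ℤ - upper x c) (suc x))
      bad le with ℤₚ.≤-trans le (ℤₚ.≤-reflexive (gaps-total x h))
      ... | ℤ.+≤+ (s≤s ())
      uniq : ∀ c → c ℕ.≤ x → upper x c ≡ 0ℤ → c ≡ c0
      uniq c cx pc with ℕₚ.<-cmp c c0
      ... | tri≈ _ q _ = q
      ... | tri< q _ _ = ⊥-elim (bad (two-ones⇒psum≥2 (suc x) (λ c → 1ℤ - upper x c) c c0 (λ c _ → gap-bit x c)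
          (upper-0⇒gap {x} {c} pc) e q p))
      ... | tri> _ _ q = ⊥-elim (bad (two-ones⇒psum≥2 (suc x) (λ c → 1ℤ - upper x c) c0 c (λ c _ → gap-bit x c)
          e (upper-0⇒gap {x} {c} pc) q (s≤s cx)))

    ν : ℕ → ℕ
    ν zero = 0
    ν (suc x) with suc x ℕ.<? n
    ... | yes h = proj₁ (unique-gap (suc x) h)
    ... | no _ = n

    ν-spec : ∀ x → suc x ℕ.< n → ν (suc x) ℕ.≤ suc x × upper (suc x) (ν (suc x)) ≡ 0ℤ ×
           (∀ c → c ℕ.≤ suc x → upper (suc x) c ≡ 0ℤ → c ≡ ν (suc x))
    ν-spec x h with suc x ℕ.<? n
    ... | yes h' = proj₂ (unique-gap (suc x) h')
    ... | no nh = ⊥-elim (nh h)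

    ν-at-last : ∀ m → m ≡ n → ν m ≡ m
    ν-at-last zero e = refl
    ν-at-last (suc m) e with suc m ℕ.<? n
    ... | yes h = ⊥-elim (ℕₚ.<-irrefl e h)
    ... | no _ = sym e

    ν-at-n : ν n ≡ n
    ν-at-n = ν-at-last n refl

    ν≤id′ : ∀ x → x ℕ.≤ n → ν x ℕ.≤ x
    ν≤id′ zero _ = z≤n
    ν≤id′ (suc x) h with ℕₚ.m≤n⇒m<n∨m≡n h
    ... | inj₁ p = proj₁ (ν-spec x p)
    ... | inj₂ e = ℕₚ.≤-reflexive (trans (cong ν e) (trans ν-at-n (sym e)))

    δ-≡ : ∀ {u c} → c ≡ u → δ u c ≡ 1ℤ
    δ-≡ {u} refl = δ-refl u

    upper-mid : ∀ x → suc x ℕ.< n → ∀ c → upper (suc x) c ≡ colPrefix ν (suc x) c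
    upper-mid x p c with ν-spec x p | ℕₚ.≤-<-connex c (suc x)
    ... | le , z , un | inj₁ cx with c ℕₚ.≟ ν (suc x)
    ...   | yes ce = trans (subst (λ w → upper (suc x) w ≡ 0ℤ) (sym ce) z)
                        (sym (cong₂ _-_ (θ-< (s≤s cx)) (δ-≡ ce)))
    ...   | no cn with col-bits c (suc x)
    ...     | inj₁ w = ⊥-elim (cn (un c cx w))
    ...     | inj₂ w = trans w (sym (cong₂ _-_ (θ-< (s≤s cx)) (δ-≢ cn)))
    upper-mid x p c | le , z , un | inj₂ q =
      trans (upper-right (suc x) c q)
        (sym (cong₂ _-_ (θ-≥ q) (δ-≢ {ν (suc x)} {c}
            (λ e → ℕₚ.<-irrefl refl (ℕₚ.<-≤-trans q (subst (ℕ._≤ suc x) (sym e) le))))))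

    upper≡colPrefix : ∀ x → x ℕ.≤ n → ∀ c → c ℕ.< n → upper x c ≡ colPrefix ν x c
    upper≡colPrefix zero _ c _ = sym (colPrefix-0 ν refl c)
    upper≡colPrefix (suc x) h c hc with ℕₚ.m≤n⇒m<n∨m≡n h
    ... | inj₁ p = upper-mid x p c
    ... | inj₂ e = trans (cong (λ z → upper z c) e) (trans (col-total c hc) (sym qn))
      where
      hc' : c ℕ.< suc x
      hc' = subst (c ℕ.<_) (sym e) hc
      qn : colPrefix ν (suc x) c ≡ 1ℤ
      qn = cong₂ _-_ (θ-< (ℕₚ.m<n⇒m<1+n hc'))
             (trans (cong (λ z → δ z c) (ν-at-last (suc x) e)) (δ-≢ {suc x} {c} (λ z → ℕₚ.<-irrefl z hc')))

    entry≡bandEntry : ∀ a c → a ℕ.< n → c ℕ.< n → entry A a c ≡ bandEntry ν a c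
    entry≡bandEntry a c ha hc = trans (psum-step (λ x → entry A x c) a)
                      (trans (cong₂ _-_ (upper≡colPrefix (suc a) ha c hc) (upper≡colPrefix a (ℕₚ.<⇒≤ ha) c hc))
                          (sym (bandEntry-colPrefix ν a c)))

    bandMatrix-ν≡A : bandMatrix n ν ≡ A
    bandMatrix-ν≡A = trans (Vecₚ.tabulate-cong (λ i → Vecₚ.tabulate-cong
        (λ j → sym (trans (sym (entry-at A i j)) (entry≡bandEntry (toℕ i) (toℕ j) (Finₚ.toℕ<n i)
        (Finₚ.toℕ<n j))))))
           (trans (Vecₚ.tabulate-cong (λ i → Vecₚ.tabulate∘lookup (lookup A i))) (Vecₚ.tabulate∘lookup A))

    band-sequence : BandSequence n ν
    band-sequence = record { starts-at-0 = refl ; monotone = monotone′ ; ν≤id = λ k p → ν≤id′ k (ℕₚ.<⇒≤ p) ;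
        ends-at-n = ν-at-n }
      where
      monotone′ : ∀ k → k ℕ.< n → ν k ℕ.≤ ν (suc k)
      monotone′ k kn with ℕₚ.≤-<-connex (ν k) (ν (suc k))
      ... | inj₁ p = p
      ... | inj₂ q = ⊥-elim (nb (row-bits k C))
        where
        C = suc (ν (suc k))
        Cn : C ℕ.≤ n
        Cn = ℕₚ.<-≤-trans q (ℕₚ.≤-trans (ν≤id′ k (ℕₚ.<⇒≤ kn)) (ℕₚ.<⇒≤ kn))
        val : psum (entry A k) C ≡ -1ℤ
        val = trans (psum-cong {entry A k} {bandEntry ν k} C
            (λ c p → entry≡bandEntry k c kn (ℕₚ.<-≤-trans p Cn)))
                (trans (psum-bandEntry-row ν k C) (−1-pattern (θ-≥ {ν k} {C} q)
                    (θ-< {ν (suc k)} {C} (ℕₚ.n<1+n _))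
                   (θ-≥ {suc k} {C} (ℕₚ.≤-trans q (ℕₚ.≤-trans (ν≤id′ k (ℕₚ.<⇒≤ kn)) (ℕₚ.n≤1+n k))))))
          where
          −1-pattern : ∀ {a b c} → a ≡ 0ℤ → b ≡ 1ℤ → c ≡ 0ℤ → a - b + c ≡ -1ℤ
          −1-pattern refl refl refl = refl
        nb : ¬ Bit (psum (entry A k) C)
        nb (inj₁ e) = -1≢0 (trans (sym val) e)
        nb (inj₂ e) = 1≢-1 (trans (sym e) val)

open import Function using (_∘_)

open import Data.Nat as ℕ using (ℕ; zero; suc; z≤n; s≤s; _≤_)
import Data.Nat.Properties as ℕₚ
open import Data.Integer as ℤ using (+_; _+_)
open import Data.Fin as Fin using (Fin; toℕ)
import Data.Fin.Properties as Finₚ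
open import Data.Vec as Vec using (Vec; []; _∷_; tabulate)
open import Data.Unit using (tt)
open import Data.Sum using (inj₁; inj₂)
open import Data.Product using (Σ; ∃; ∃-syntax; _×_; _,_; proj₁; proj₂)
open import Relation.Binary.PropositionalEquality
open import Function.Definitions using (Injective)
open import Function using (_∘_)
open import Defs
open PrefixSums
open PrefixSumForm
open BandMatrices
open KeyOfBandMatrix using (bandMatrix-counted)
open CountedAreBand using (counted⇒band)
open BandDecomposition
open BallotEnumeration

-- The sequence 0, v₁, …, v_k, k + 1, …; the default value of vget supplies
-- the final k + 1.
toν : ∀ {k} → Vec ℕ k → ℕ → ℕ
toν v zero = 0
toν {k} v (suc x) = vget (suc k) v x

ballotVec⇒bounds : ∀ {len} (v : Vec ℕ len) lo top d → BallotVec lo top v →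
      (∀ t → t ℕ.< len → vget d v t ℕ.≤ top ℕ.+ t) ×
      (∀ t → suc t ℕ.< len → vget d v t ℕ.≤ vget d v (suc t)) ×
      (∀ t → t ℕ.< len → lo ℕ.≤ vget d v t)
ballotVec⇒bounds [] lo top d _ = (λ t ()) , (λ t ()) , (λ t ())
ballotVec⇒bounds (w ∷ ws) lo top d (lw , wt , vl) with ballotVec⇒bounds ws w (suc top) d vl
... | bd , mo , lb = bd' , mo' , lb'
  where
  bd' : ∀ t → t ℕ.< suc _ → vget d (w ∷ ws) t ℕ.≤ top ℕ.+ t
  bd' zero _ = subst (w ℕ.≤_) (sym (ℕₚ.+-identityʳ top)) wt
  bd' (suc t) (s≤s p) = subst (vget d ws t ℕ.≤_) (sym (ℕₚ.+-suc top t)) (bd t p)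
  mo' : ∀ t → suc t ℕ.< suc _ → vget d (w ∷ ws) t ℕ.≤ vget d (w ∷ ws) (suc t)
  mo' zero (s≤s p) = lb 0 p
  mo' (suc t) (s≤s p) = mo t p
  lb' : ∀ t → t ℕ.< suc _ → lo ℕ.≤ vget d (w ∷ ws) t
  lb' zero _ = lw
  lb' (suc t) (s≤s p) = ℕₚ.≤-trans lw (lb t p)

bounds⇒ballotVec : ∀ {len} (v : Vec ℕ len) lo top d →
      (∀ t → t ℕ.< len → vget d v t ℕ.≤ top ℕ.+ t) →
      (∀ t → suc t ℕ.< len → vget d v t ℕ.≤ vget d v (suc t)) →
      (0 ℕ.< len → lo ℕ.≤ vget d v 0) → BallotVec lo top v
bounds⇒ballotVec [] lo top d _ _ _ = tt
bounds⇒ballotVec (w ∷ ws) lo top d bd mo hd =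
  hd (s≤s z≤n) , subst (w ℕ.≤_) (ℕₚ.+-identityʳ top) (bd 0 (s≤s z≤n)) ,
  bounds⇒ballotVec ws w (suc top) d (λ t p → subst (vget d ws t ℕ.≤_) (ℕₚ.+-suc top t) (bd (suc t) (s≤s p)))
      (λ t p → mo (suc t) (s≤s p)) (λ p → mo 0 (s≤s p))

toν-band : ∀ k (v : Vec ℕ k) → BallotVec 0 1 v → BandSequence (suc k) (toν v)
toν-band k v vl = record { starts-at-0 = refl ; monotone = vm ; ν≤id = vl' ; ends-at-n = vget-outside (suc k)
    v k ℕₚ.≤-refl }
  where
  props = ballotVec⇒bounds v 0 1 (suc k) vl
  vm : ∀ x → x ℕ.< suc k → toν v x ℕ.≤ toν v (suc x)
  vm zero _ = z≤n
  vm (suc t) (s≤s p) with ℕₚ.m≤n⇒m<n∨m≡n p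
  ... | inj₁ q = proj₁ (proj₂ props) t q
  ... | inj₂ q rewrite vget-outside (suc k) v (suc t) (ℕₚ.≤-reflexive (sym q)) =
        ℕₚ.≤-trans (proj₁ props t (subst (t ℕ.<_) q (ℕₚ.n<1+n t)))
          (ℕₚ.≤-trans (ℕₚ.≤-reflexive q) (ℕₚ.n≤1+n k))
  vl' : ∀ x → x ℕ.< suc k → toν v x ℕ.≤ x
  vl' zero _ = z≤n
  vl' (suc t) (s≤s p) = proj₁ props t p

band⇒ballotVec : ∀ k ν → BandSequence (suc k) ν → Σ (Vec ℕ k)
    (λ v → BallotVec 0 1 v × (∀ x → x ℕ.≤ suc k → toν v x ≡ ν x))
band⇒ballotVec k ν vd = v , bounds⇒ballotVec v 0 1 (suc k) bd mo (λ _ → z≤n) , agree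
  where
  open BandSequence vd
  v : Vec ℕ k
  v = tabulate (λ i → ν (suc (toℕ i)))
  vt : ∀ t → t ℕ.< k → vget (suc k) v t ≡ ν (suc t)
  vt t p = vget-tabulate (suc k) (λ x → ν (suc x)) t p
  bd : ∀ t → t ℕ.< k → vget (suc k) v t ℕ.≤ 1 ℕ.+ t
  bd t p rewrite vt t p = ν≤id (suc t) (s≤s p)
  mo : ∀ t → suc t ℕ.< k → vget (suc k) v t ℕ.≤ vget (suc k) v (suc t)
  mo t p rewrite vt t (ℕₚ.<-trans (ℕₚ.n<1+n t) p) | vt (suc t) p = monotone (suc t) (s≤s (ℕₚ.<⇒≤ p))
  agree : ∀ x → x ℕ.≤ suc k → toν v x ≡ ν x
  agree zero _ = sym starts-at-0
  agree (suc t) (s≤s p) with ℕₚ.m≤n⇒m<n∨m≡n p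
  ... | inj₁ q = vt t q
  ... | inj₂ refl = trans (vget-outside (suc k) v t ℕₚ.≤-refl) (sym ends-at-n)

vget-extensional : ∀ {len} (v w : Vec ℕ len) d → (∀ t → t ℕ.< len → vget d v t ≡ vget d w t) → v ≡ w
vget-extensional [] [] d h = refl
vget-extensional (a ∷ v) (b ∷ w) d h = cong₂ _∷_ (h 0 (s≤s z≤n))
    (vget-extensional v w d (λ t p → h (suc t) (s≤s p)))

bandMatrixᵥ : ∀ {k} → Vec ℕ k → Matrix (suc k)
bandMatrixᵥ v = bandMatrix _ (toν v)

bandMatrixᵥ-counted : ∀ {k} {v : Vec ℕ k} → BallotVec 0 1 v → Counted (bandMatrixᵥ v)
bandMatrixᵥ-counted {k} {v} bv = bandMatrix-counted (toν-band k v bv)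

bandMatrixᵥ-injective : ∀ {k} {v w : Vec ℕ k} → BallotVec 0 1 v → BallotVec 0 1 w →
                        bandMatrixᵥ v ≡ bandMatrixᵥ w → v ≡ w
bandMatrixᵥ-injective {k} {v} {w} bv bw eq =
  vget-extensional v w (suc k) (λ t t<k → same-ν (suc t) (ℕₚ.<⇒≤ (s≤s t<k)))
  where
  same-ν = bandMatrix-injective (suc k) (toν-band k v bv) (toν-band k w bw) eq

counted⇒bandMatrixᵥ : ∀ {k} (A : Matrix (suc k)) → Counted A → ∃[ v ] (BallotVec 0 1 v × bandMatrixᵥ v ≡ A)
counted⇒bandMatrixᵥ {k} A counted =
  let open BandASM A (proj₁ counted) (counted⇒band A counted)
      (v , bv , toν-v≗ν) = band⇒ballotVec k ν band-sequence
  in v , bv , trans (bandMatrix-cong (suc k) toν-v≗ν) bandMatrix-ν≡A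

enumerate : ∀ k → Fin (catalan (suc k)) → Vec ℕ k
enumerate k x = decode k 0 1 (Fin.cast (catalan≡ballotCount k) x)

enumerate-ballotVec : ∀ k x → BallotVec 0 1 (enumerate k x)
enumerate-ballotVec k x = decode-ballotVec k 0 1 _

enumerate-injective : ∀ k → Injective _≡_ _≡_ (enumerate k)
enumerate-injective k {x} {y} eq = begin
  x                                 ≡⟨ Finₚ.cast-involutive (sym e) e x ⟨
  Fin.cast (sym e) (Fin.cast e x)   ≡⟨ cong (Fin.cast (sym e)) (decode-injective k 0 1 _ _ eq) ⟩
  Fin.cast (sym e) (Fin.cast e y)   ≡⟨ Finₚ.cast-involutive (sym e) e y ⟩
  y                                 ∎
  where
  open ≡-Reasoning
  e = catalan≡ballotCount k

enumerate-surjective : ∀ k (v : Vec ℕ k) → BallotVec 0 1 v → ∃[ x ] (enumerate k x ≡ v)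
enumerate-surjective k v bv =
  let (y , decode-y≡v) = decode-surjective k 0 1 v bv
      e = catalan≡ballotCount k
  in Fin.cast (sym e) y , trans (cong (decode k 0 1) (Finₚ.cast-involutive e (sym e) y)) decode-y≡v

theorem4p8 : (n : ℕ) → 1 ≤ n →
    Σ (Fin (catalan n) → Matrix n) (λ f →
      Injective _≡_ _≡_ f × (∀ x → Counted (f x)) ×
      (∀ (A : Matrix n) → Counted A → ∃ (λ x → f x ≡ A)))
theorem4p8 (suc k) _ = bandMatrixᵥ ∘ enumerate k , injective , counted , surjective
  where
  injective : Injective _≡_ _≡_ (bandMatrixᵥ ∘ enumerate k)
  injective eq = enumerate-injective k
    (bandMatrixᵥ-injective (enumerate-ballotVec k _) (enumerate-ballotVec k _) eq)
  counted : ∀ x → Counted (bandMatrixᵥ (enumerate k x))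
  counted x = bandMatrixᵥ-counted (enumerate-ballotVec k x)
  surjective : ∀ A → Counted A → ∃ (λ x → bandMatrixᵥ (enumerate k x) ≡ A)
  surjective A counted-A =
    let (v , bv , v↦A) = counted⇒bandMatrixᵥ A counted-A
        (x , x↦v) = enumerate-surjective k v bv
    in x , trans (cong bandMatrixᵥ x↦v) v↦A
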